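{- As formal power series in $x$, \[ \mathbf{V}(u) = \sum_{k=0}^{\infty} \mathbf{P}_k(u) \Big( \mathbf{B}((yz)^k u) - \mathbf{N}((yz)^k u) \, \mathbf{V}(1) \Big), \qquad \mathbf{P}_k(u) := \prod_{j=0}^{k-1} \mathbf{M}((yz)^j u),\quad \mathbf{P}_0(u)=\mathbf{I}, \] where $\mathbf{I}$ is the $2\times2$ identity matrix.
   Context: A Catalan word of length $n\geq1$ is a sequence $w_1\cdots w_n$ of nonnegative integers with $w_1=0$ and $w_i\leq w_{i-1}+1$; its Catalan polyomino is the bargraph whose $i$th column has $w_i+1$ cells, columns bottom-aligned. For a Catalan polyomino $P$: $\mathrm{lth}(P)$ = number of columns, $\mathrm{last}(P)$ = number of cells in the last column, $\mathrm{ver}(P)$ = total number of cells in columns of odd index (first column index 1), $\mathrm{white}(P)$ = total number of cells in columns of even index. $EV(x,y,z,u)=\sum x^{\mathrm{lth}(P)}y^{\mathrm{ver}(P)}z^{\mathrm{white}(P)}u^{\mathrm{last}(P)}$ over $P$ with $\mathrm{lth}(P)$ even; $OD$ is the same sum over $P$ with $\mathrm{lth}(P)$ odd. $\mathbf{V}(u)=\begin{pmatrix} EV(x,y,z,u)\\ OD(x,y,z,u)\end{pmatrix}$ and \[\mathbf{M}(u)= \begin{pmatrix} \frac{x^2y^2z^4u^4}{(uz-1)(uyz-1)}& 0 \\ 0& \frac{x^2y^4z^2u^4}{(uy-1)(uyz-1)} \end{pmatrix}, \quad \mathbf{N}(u)= \begin{pmatrix} \frac{x^2yz^3u^3}{(uz-1)(uyz-1)}&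 \frac{xzu}{uz-1}\\ \frac{xyu}{uy-1}& \frac{x^2y^3zu^3}{(uy-1)(uyz-1)} \end{pmatrix},\quad \mathbf{B}(u)= \begin{pmatrix} \frac{x^2yz^3u^3}{uz-1}\\ xyu \end{pmatrix}. \] -}

module Defs where

open import Data.Nat as ℕ using (ℕ; zero; suc; _∸_; _≡ᵇ_; _≤ᵇ_)
open import Data.Integer as ℤ using (ℤ; +_; 0ℤ; 1ℤ)
open import Data.Bool using (Bool; true; false; _∧_; not; if_then_else_)
open import Data.List using (List; []; _∷_; length; map; concatMap; upTo)
open import Relation.Binary.PropositionalEquality using (_≡_)
open import Data.Product using (_×_)

-- Formal power series in x, y, z, u with integer coefficients.
-- f n a b c  is the coefficient of  x^n y^a z^b u^c.

Series : Set
Series = ℕ → ℕ → ℕ → ℕ → ℤ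

Σ≤ : ℕ → (ℕ → ℤ) → ℤ
Σ≤ zero    f = f 0
Σ≤ (suc N) f = Σ≤ N f ℤ.+ f (suc N)

mono : ℕ → ℕ → ℕ → ℕ → Series
mono e1 e2 e3 e4 n a b c =
  if (n ≡ᵇ e1) ∧ (a ≡ᵇ e2) ∧ (b ≡ᵇ e3) ∧ (c ≡ᵇ e4) then 1ℤ else 0ℤ

0ₛ : Series
0ₛ _ _ _ _ = 0ℤ

1ₛ : Series
1ₛ = mono 0 0 0 0

infixl 6 _⊕_ _⊝_
infixl 7 _⊛_

_⊕_ : Series → Series → Series
(f ⊕ g) n a b c = f n a b c ℤ.+ g n a b c

⊖_ : Series → Series
(⊖ f) n a b c = ℤ.- f n a b c

_⊝_ : Series → Series → Series
f ⊝ g = f ⊕ (⊖ g)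

_⊛_ : Series → Series → Series
(f ⊛ g) n a b c =
  Σ≤ n λ i → Σ≤ a λ j → Σ≤ b λ k → Σ≤ c λ l →
    f i j k l ℤ.* g (n ∸ i) (a ∸ j) (b ∸ k) (c ∸ l)

pow : Series → ℕ → Series
pow f zero    = 1ₛ
pow f (suc t) = pow f t ⊛ f

-- 1/(1 - g) = Σ_t g^t, for g with zero constant term (then g^t only has
-- monomials of total degree ≥ t, so the truncation below is exact).
invOneMinus : Series → Series
invOneMinus g n a b c = Σ≤ (n ℕ.+ a ℕ.+ b ℕ.+ c) λ t → pow g t n a b c

recipMinusOne : Series → Series
recipMinusOne g = ⊖ invOneMinus g

-- substitution u ↦ (yz)^k u
substU : ℕ → Series → Series
substU k f n a b c =
  if (k ℕ.* c ≤ᵇ a) ∧ (k ℕ.* c ≤ᵇ b)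
  then f n (a ∸ k ℕ.* c) (b ∸ k ℕ.* c) c
  else 0ℤ

-- Sum Σ_{k≥0} t k of a family whose k-th term has x-order ≥ k
-- (x-adically convergent): only k ≤ n contribute to the coefficient of x^n.
sumₖ : (ℕ → Series) → Series
sumₖ t n a b c = Σ≤ n λ k → t k n a b c

uz uyz uy : Series
uz  = mono 0 0 1 1
uyz = mono 0 1 1 1
uy  = mono 0 1 0 1

record Vec2 : Set where
  constructor ⟨_,_⟩
  field
    v₁ v₂ : Series
open Vec2 public

record Mat2 : Set where
  constructor mat
  field
    m₁₁ m₁₂ m₂₁ m₂₂ : Series
open Mat2 public

I₂ : Mat2
I₂ = mat 1ₛ 0ₛ 0ₛ 1ₛ

_⊗_ : Mat2 → Mat2 → Mat2
A ⊗ B = mat (m₁₁ A ⊛ m₁₁ B ⊕ m₁₂ A ⊛ m₂₁ B) (m₁₁ A ⊛ m₁₂ B ⊕ m₁₂ A ⊛ m₂₂ B)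
            (m₂₁ A ⊛ m₁₁ B ⊕ m₂₂ A ⊛ m₂₁ B) (m₂₁ A ⊛ m₁₂ B ⊕ m₂₂ A ⊛ m₂₂ B)

_·ᵥ_ : Mat2 → Vec2 → Vec2
A ·ᵥ v = ⟨ m₁₁ A ⊛ v₁ v ⊕ m₁₂ A ⊛ v₂ v , m₂₁ A ⊛ v₁ v ⊕ m₂₂ A ⊛ v₂ v ⟩

_−ᵥ_ : Vec2 → Vec2 → Vec2
v −ᵥ w = ⟨ v₁ v ⊝ v₁ w , v₂ v ⊝ v₂ w ⟩

substUₘ : ℕ → Mat2 → Mat2
substUₘ k A = mat (substU k (m₁₁ A)) (substU k (m₁₂ A)) (substU k (m₂₁ A)) (substU k (m₂₂ A))

substUᵥ : ℕ → Vec2 → Vec2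
substUᵥ k v = ⟨ substU k (v₁ v) , substU k (v₂ v) ⟩

sumᵥ : (ℕ → Vec2) → Vec2
sumᵥ t = ⟨ sumₖ (λ k → v₁ (t k)) , sumₖ (λ k → v₂ (t k)) ⟩

_≈ᵥ_ : Vec2 → Vec2 → Set
v ≈ᵥ w = (∀ n a b c → v₁ v n a b c ≡ v₁ w n a b c)
       × (∀ n a b c → v₂ v n a b c ≡ v₂ w n a b c)

𝐌 : Mat2
𝐌 = mat (mono 2 2 4 4 ⊛ recipMinusOne uz ⊛ recipMinusOne uyz) 0ₛ
        0ₛ (mono 2 4 2 4 ⊛ recipMinusOne uy ⊛ recipMinusOne uyz)

𝐍 : Mat2
𝐍 = mat (mono 2 1 3 3 ⊛ recipMinusOne uz ⊛ recipMinusOne uyz) (mono 1 0 1 1 ⊛ recipMinusOne uz)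
        (mono 1 1 0 1 ⊛ recipMinusOne uy) (mono 2 3 1 3 ⊛ recipMinusOne uy ⊛ recipMinusOne uyz)

𝐁 : Vec2
𝐁 = ⟨ mono 2 1 3 3 ⊛ recipMinusOne uz , mono 1 1 0 1 ⟩

𝐏 : ℕ → Mat2
𝐏 zero    = I₂
𝐏 (suc k) = 𝐏 k ⊗ substUₘ k 𝐌

stepsOK : ℕ → List ℕ → Bool
stepsOK p []       = true
stepsOK p (w ∷ ws) = (w ≤ᵇ suc p) ∧ stepsOK w ws

isCatalan : List ℕ → Bool
isCatalan []       = false
isCatalan (w ∷ ws) = (w ≡ᵇ 0) ∧ stepsOK w ws

words : ℕ → ℕ → List (List ℕ)
words zero    k = [] ∷ []
words (suc n) k = concatMap (λ v → map (v ∷_) (words n k)) (upTo k)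

-- Catalan words of length n (entries of such a word are < n)
catalanWords : ℕ → List (List ℕ)
catalanWords n = words n n

-- statistics of the Catalan polyomino of a word (column i has w_i + 1 cells)
lth : List ℕ → ℕ
lth = length

mutual
  ver : List ℕ → ℕ        -- cells in columns of odd index
  ver []       = 0
  ver (w ∷ ws) = suc w ℕ.+ white ws

  white : List ℕ → ℕ      -- cells in columns of even index
  white []       = 0
  white (w ∷ ws) = ver ws

last : List ℕ → ℕ
last []           = 0
last (w ∷ [])     = suc w
last (w ∷ v ∷ ws) = last (v ∷ ws)

evenᵇ : ℕ → Bool
evenᵇ zero    = true
evenᵇ (suc n) = not (evenᵇ n)

count : {A : Set} → (A → Bool) → List A → ℕ
count p []       = 0
count p (x ∷ xs) = if p x then suc (count p xs) else count p xs

EV OD : Series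
EV n a b c = + count (λ w → isCatalan w ∧ evenᵇ (lth w) ∧ (ver w ≡ᵇ a) ∧ (white w ≡ᵇ b) ∧ (last w ≡ᵇ c)) (catalanWords n)
OD n a b c = + count (λ w → isCatalan w ∧ not (evenᵇ (lth w)) ∧ (ver w ≡ᵇ a) ∧ (white w ≡ᵇ b) ∧ (last w ≡ᵇ c)) (catalanWords n)

-- EV(x,y,z,1) and OD(x,y,z,1), as series with no u
EV1 OD1 : Series
EV1 n a b zero    = + count (λ w → isCatalan w ∧ evenᵇ (lth w) ∧ (ver w ≡ᵇ a) ∧ (white w ≡ᵇ b)) (catalanWords n)
EV1 n a b (suc c) = 0ℤ
OD1 n a b zero    = + count (λ w → isCatalan w ∧ not (evenᵇ (lth w)) ∧ (ver w ≡ᵇ a) ∧ (white w ≡ᵇ b)) (catalanWords n)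
OD1 n a b (suc c) = 0ℤ

𝐕 : Vec2
𝐕 = ⟨ EV , OD ⟩

𝐕1 : Vec2
𝐕1 = ⟨ EV1 , OD1 ⟩

-- Deleting the last column of a Catalan polyomino of length n + 1 leaves one of length n, and the deleted
-- column may have any height 1, …, last + 1. Summing these geometric series gives the functional equations
--   (1 − zu) EV(u) = xzu OD(1) − xz²u² OD(zu),   (1 − yu) (OD(u) − xyu) = xyu EV(1) − xy²u² EV(yu),
-- which are checked coefficientwise by counting words. Substituting u ↦ zu into the second and u ↦ yu
-- into the first and solving the resulting linear equations gives V(u) = B(u) − N(u) V(1) + M(u) V(yzu).
-- Unrolling this K times writes V(u) as the first K terms of the sum plus P_K(u) V((yz)ᴷ u); since M has
-- x-order 2, the remainder does not contribute to the coefficient of xⁿ once K > n.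
module Submission where

open import Defs

open import Algebra.Bundles using (CommutativeRing)
open import Algebra.Structures using (IsCommutativeRing)
import Algebra.Construct.Pointwise as Pointwise
import Algebra.Properties.AbelianGroup as AbelianGroupProperties
import Algebra.Properties.CommutativeSemigroup as CommutativeSemigroupProperties
import Algebra.Properties.Ring as RingProperties
import Algebra.Properties.Semiring.Mult.TCOptimised as Multiples
import Algebra.Solver.Ring.AlmostCommutativeRing as ACR
import Algebra.Solver.Ring as RingSolver
open import Data.Bool using (Bool; true; false; _∧_; not; if_then_else_)
open import Data.Bool.Properties using (∧-assoc; ∧-identityʳ; ∧-zeroʳ; not-involutive; T-≡)
open import Data.Empty using (⊥-elim)
open import Data.Integer as ℤ using (ℤ; +_; -[1+_]; 0ℤ; 1ℤ)
import Data.Integer.Properties as ℤ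
import Data.Integer.Tactic.RingSolver as ℤ-Solver
open import Data.List using (List; []; _∷_; _++_; _∷ʳ_; length; map; concatMap; upTo)
import Data.List.Properties as List
open import Data.List.Relation.Unary.All as All using (All; []; _∷_)
import Data.List.Relation.Unary.All.Properties as All
open import Data.List.Relation.Unary.Any using (Any; here; there)
open import Data.Maybe using (Maybe; just; nothing)
open import Data.Nat as ℕ using (ℕ; zero; suc; _∸_; _≤_; _<_; z≤n; s≤s; _≡ᵇ_; _≤ᵇ_)
import Data.Nat.Properties as ℕ
open import Data.Nat.Tactic.RingSolver using (solve-∀)
open import Data.Product using (_×_; _,_; proj₁; proj₂)
open import Data.Sign as Sign using (Sign)
open import Data.Sum using (_⊎_; inj₁; inj₂)
open import Function using (_∘_)
open import Function.Bundles using (Equivalence; mk⇔)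
open import Level using (0ℓ)
open import Relation.Binary.Bundles using (Setoid)
open import Relation.Binary.Definitions using (tri<; tri≈; tri>)
open import Relation.Binary.PropositionalEquality as ≡ using (_≡_; refl; cong; cong₂; sym; trans)
import Relation.Binary.Reasoning.Setoid as SetoidReasoning
open import Relation.Nullary using (¬_; yes; no)
open import Relation.Nullary.Decidable using (dec-true; dec-false; does-⇔; _×-dec_)

-- Finite sums, power series and a ring solver over a commutative ring

module FiniteSums {c ℓ} (R : CommutativeRing c ℓ) where
  open CommutativeRing R hiding (zero) renaming (refl to ≈-refl; sym to ≈-sym; trans to ≈-trans)
  open SetoidReasoning setoid
  open CommutativeSemigroupProperties +-commutativeSemigroup using (interchange)

  ∑ : ℕ → (ℕ → Carrier) → Carrier
  ∑ zero    f = f 0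
  ∑ (suc N) f = ∑ N f + f (suc N)

  ∑-cong≤ : ∀ N {f g} → (∀ i → i ≤ N → f i ≈ g i) → ∑ N f ≈ ∑ N g
  ∑-cong≤ zero    f≈g = f≈g 0 z≤n
  ∑-cong≤ (suc N) f≈g = +-cong (∑-cong≤ N (λ i i≤N → f≈g i (ℕ.m≤n⇒m≤1+n i≤N))) (f≈g (suc N) ℕ.≤-refl)

  ∑-cong : ∀ N {f g} → (∀ i → f i ≈ g i) → ∑ N f ≈ ∑ N g
  ∑-cong N f≈g = ∑-cong≤ N (λ i _ → f≈g i)

  ∑-zero : ∀ N {f} → (∀ i → i ≤ N → f i ≈ 0#) → ∑ N f ≈ 0#
  ∑-zero zero    f≈0 = f≈0 0 z≤n
  ∑-zero (suc N) f≈0 =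
    ≈-trans (+-cong (∑-zero N (λ i i≤N → f≈0 i (ℕ.m≤n⇒m≤1+n i≤N))) (f≈0 (suc N) ℕ.≤-refl)) (+-identityˡ 0#)

  ∑-+ : ∀ N f g → ∑ N (λ i → f i + g i) ≈ ∑ N f + ∑ N g
  ∑-+ zero    f g = ≈-refl
  ∑-+ (suc N) f g = ≈-trans (+-cong (∑-+ N f g) ≈-refl) (interchange _ _ _ _)

  ∑-*ˡ : ∀ N x f → x * ∑ N f ≈ ∑ N (λ i → x * f i)
  ∑-*ˡ zero    x f = ≈-refl
  ∑-*ˡ (suc N) x f = ≈-trans (distribˡ x _ _) (+-cong (∑-*ˡ N x f) ≈-refl)

  ∑-*ʳ : ∀ N x f → ∑ N f * x ≈ ∑ N (λ i → f i * x)
  ∑-*ʳ zero    x f = ≈-refl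
  ∑-*ʳ (suc N) x f = ≈-trans (distribʳ x _ _) (+-cong (∑-*ʳ N x f) ≈-refl)

  ∑-unconsˡ : ∀ N f → ∑ (suc N) f ≈ f 0 + ∑ N (λ i → f (suc i))
  ∑-unconsˡ zero    f = ≈-refl
  ∑-unconsˡ (suc N) f = ≈-trans (+-cong (∑-unconsˡ N f) ≈-refl) (+-assoc _ _ _)

  ∑-reverse : ∀ N f → ∑ N f ≈ ∑ N (λ i → f (N ∸ i))
  ∑-reverse zero    f = ≈-refl
  ∑-reverse (suc N) f = begin
    ∑ N f + f (suc N)                  ≈⟨ +-cong (∑-reverse N f) ≈-refl ⟩
    ∑ N (λ i → f (N ∸ i)) + f (suc N)  ≈⟨ +-comm _ _ ⟩
    f (suc N) + ∑ N (λ i → f (N ∸ i))  ≈⟨ ∑-unconsˡ N (λ i → f (suc N ∸ i)) ⟨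
    ∑ (suc N) (λ i → f (suc N ∸ i))    ∎

  ∑-swap : ∀ N M (F : ℕ → ℕ → Carrier) → ∑ N (λ i → ∑ M (F i)) ≈ ∑ M (λ j → ∑ N (λ i → F i j))
  ∑-swap zero    M F = ≈-refl
  ∑-swap (suc N) M F = ≈-trans (+-cong (∑-swap N M F) ≈-refl) (≈-sym (∑-+ M _ _))

  ∑-triangle : ∀ N (F : ℕ → ℕ → Carrier) →
               ∑ N (λ i → ∑ i (F i)) ≈ ∑ N (λ j → ∑ (N ∸ j) (λ i → F (j ℕ.+ i) j))
  ∑-triangle zero    F = ≈-refl
  ∑-triangle (suc N) F = begin
    ∑ (suc N) (λ i → ∑ i (F i))
      ≈⟨ ∑-unconsˡ N _ ⟩
    F 0 0 + ∑ N (λ i → ∑ (suc i) (F (suc i)))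
      ≈⟨ +-cong ≈-refl (∑-cong N (λ i → ∑-unconsˡ i _)) ⟩
    F 0 0 + ∑ N (λ i → F (suc i) 0 + ∑ i (λ j → F (suc i) (suc j)))
      ≈⟨ +-cong ≈-refl (∑-+ N _ _) ⟩
    F 0 0 + (∑ N (λ i → F (suc i) 0) + ∑ N (λ i → ∑ i (λ j → F (suc i) (suc j))))
      ≈⟨ +-cong ≈-refl (+-cong ≈-refl (∑-triangle N (λ i j → F (suc i) (suc j)))) ⟩
    F 0 0 + (∑ N (λ i → F (suc i) 0) + ∑ N (λ j → ∑ (N ∸ j) (λ i → F (suc (j ℕ.+ i)) (suc j))))
      ≈⟨ +-assoc _ _ _ ⟨
    (F 0 0 + ∑ N (λ i → F (suc i) 0)) + ∑ N (λ j → ∑ (N ∸ j) (λ i → F (suc (j ℕ.+ i)) (suc j)))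
      ≈⟨ +-cong (∑-unconsˡ N (λ i → F i 0)) ≈-refl ⟨
    ∑ (suc N) (λ i → F i 0) + ∑ N (λ j → ∑ (N ∸ j) (λ i → F (suc (j ℕ.+ i)) (suc j)))
      ≈⟨ ∑-unconsˡ N _ ⟨
    ∑ (suc N) (λ j → ∑ (suc N ∸ j) (λ i → F (j ℕ.+ i) j)) ∎

  ∑-single : ∀ N m {f} → m ≤ N → (∀ i → i ≤ N → ¬ i ≡ m → f i ≈ 0#) → ∑ N f ≈ f m
  ∑-single zero    .zero z≤n _    = ≈-refl
  ∑-single (suc N) m {f} m≤1+N f≈0 with ℕ.m≤n⇒m<n∨m≡n m≤1+N
  ... | inj₁ (s≤s m≤N) = ≈-trans
    (+-cong (∑-single N m m≤N (λ i i≤N → f≈0 i (ℕ.m≤n⇒m≤1+n i≤N)))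
            (f≈0 (suc N) ℕ.≤-refl (λ 1+N≡m → ℕ.<-irrefl (≡.sym 1+N≡m) (s≤s m≤N))))
    (+-identityʳ (f m))
  ... | inj₂ ≡.refl = ≈-trans
    (+-cong (∑-zero N (λ i i≤N → f≈0 i (ℕ.m≤n⇒m≤1+n i≤N) (λ i≡m → ℕ.<-irrefl i≡m (s≤s i≤N)))) ≈-refl)
    (+-identityˡ (f (suc N)))

module PowerSeries (R : CommutativeRing 0ℓ 0ℓ) where
  private module R = CommutativeRing R
  open FiniteSums R
  open SetoidReasoning R.setoid

  Coefficients : Set
  Coefficients = ℕ → R.Carrier

  infix  4 _≈ᵖ_
  infixl 6 _+ᵖ_
  infixl 7 _*ᵖ_

  _≈ᵖ_ : Coefficients → Coefficients → Set
  f ≈ᵖ g = ∀ n → f n R.≈ g n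

  _+ᵖ_ : Coefficients → Coefficients → Coefficients
  (f +ᵖ g) n = f n R.+ g n

  -ᵖ_ : Coefficients → Coefficients
  (-ᵖ f) n = R.- f n

  0ᵖ : Coefficients
  0ᵖ _ = R.0#

  1ᵖ : Coefficients
  1ᵖ zero    = R.1#
  1ᵖ (suc n) = R.0#

  _*ᵖ_ : Coefficients → Coefficients → Coefficients
  (f *ᵖ g) n = ∑ n (λ i → f i R.* g (n ∸ i))

  *ᵖ-cong : ∀ {f f′ g g′} → f ≈ᵖ f′ → g ≈ᵖ g′ → f *ᵖ g ≈ᵖ f′ *ᵖ g′
  *ᵖ-cong f≈f′ g≈g′ n = ∑-cong n (λ i → R.*-cong (f≈f′ i) (g≈g′ (n ∸ i)))

  *ᵖ-comm : ∀ f g → f *ᵖ g ≈ᵖ g *ᵖ f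
  *ᵖ-comm f g n = begin
    ∑ n (λ i → f i R.* g (n ∸ i))             ≈⟨ ∑-reverse n _ ⟩
    ∑ n (λ i → f (n ∸ i) R.* g (n ∸ (n ∸ i))) ≈⟨ ∑-cong≤ n (λ i i≤n → R.trans (R.*-comm _ _)
                                                   (R.*-cong (R.reflexive (≡.cong g (ℕ.m∸[m∸n]≡n i≤n))) R.refl)) ⟩
    ∑ n (λ i → g i R.* f (n ∸ i))             ∎

  *ᵖ-identityˡ : ∀ f → 1ᵖ *ᵖ f ≈ᵖ f
  *ᵖ-identityˡ f zero    = R.*-identityˡ _
  *ᵖ-identityˡ f (suc n) = begin
    ∑ (suc n) (λ i → 1ᵖ i R.* f (suc n ∸ i))          ≈⟨ ∑-unconsˡ n _ ⟩
    R.1# R.* f (suc n) R.+ ∑ n (λ i → R.0# R.* f (n ∸ i)) ≈⟨ R.+-cong (R.*-identityˡ _) (∑-zero n (λ i _ → R.zeroˡ _)) ⟩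
    f (suc n) R.+ R.0#                                 ≈⟨ R.+-identityʳ _ ⟩
    f (suc n)                                          ∎

  *ᵖ-distribˡ : ∀ f g h → f *ᵖ (g +ᵖ h) ≈ᵖ f *ᵖ g +ᵖ f *ᵖ h
  *ᵖ-distribˡ f g h n = R.trans (∑-cong n (λ i → R.distribˡ _ _ _)) (∑-+ n _ _)

  *ᵖ-assoc : ∀ f g h → (f *ᵖ g) *ᵖ h ≈ᵖ f *ᵖ (g *ᵖ h)
  *ᵖ-assoc f g h n = begin
    ∑ n (λ i → ∑ i (λ j → f j R.* g (i ∸ j)) R.* h (n ∸ i))
      ≈⟨ ∑-cong n (λ i → ∑-*ʳ i _ _) ⟩
    ∑ n (λ i → ∑ i (λ j → (f j R.* g (i ∸ j)) R.* h (n ∸ i)))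
      ≈⟨ ∑-triangle n _ ⟩
    ∑ n (λ j → ∑ (n ∸ j) (λ i → (f j R.* g ((j ℕ.+ i) ∸ j)) R.* h (n ∸ (j ℕ.+ i))))
      ≈⟨ ∑-cong n (λ j → ∑-cong (n ∸ j) (λ i → R.trans (R.*-assoc _ _ _)
           (R.*-cong R.refl (R.*-cong (R.reflexive (≡.cong g (ℕ.m+n∸m≡n j i)))
                                      (R.reflexive (≡.cong h (≡.sym (ℕ.∸-+-assoc n j i)))))))) ⟩
    ∑ n (λ j → ∑ (n ∸ j) (λ i → f j R.* (g i R.* h (n ∸ j ∸ i))))
      ≈⟨ ∑-cong n (λ j → ∑-*ˡ (n ∸ j) _ _) ⟨
    ∑ n (λ j → f j R.* ∑ (n ∸ j) (λ i → g i R.* h (n ∸ j ∸ i)))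
      ∎

  isCommutativeRing : IsCommutativeRing _≈ᵖ_ _+ᵖ_ _*ᵖ_ -ᵖ_ 0ᵖ 1ᵖ
  isCommutativeRing = record
    { isRing = record
      { +-isAbelianGroup = Pointwise.isAbelianGroup ℕ R.+-isAbelianGroup
      ; *-cong           = *ᵖ-cong
      ; *-assoc          = *ᵖ-assoc
      ; *-identity       = *ᵖ-identityˡ , λ f n → R.trans (*ᵖ-comm f 1ᵖ n) (*ᵖ-identityˡ f n)
      ; distrib          = *ᵖ-distribˡ , λ f g h n → R.trans (*ᵖ-comm (g +ᵖ h) f n)
                             (R.trans (*ᵖ-distribˡ f g h n) (R.+-cong (*ᵖ-comm f g n) (*ᵖ-comm f h n)))
      }
    ; *-comm = *ᵖ-comm
    }

  commutativeRing : CommutativeRing 0ℓ 0ℓ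
  commutativeRing = record { isCommutativeRing = isCommutativeRing }

module IntegerCoefficientSolver (R : CommutativeRing 0ℓ 0ℓ) where
  open CommutativeRing R renaming (refl to ≈-refl; sym to ≈-sym; trans to ≈-trans)
  open Multiples semiring using (×-homo-+; ×1-homo-*) renaming (_×_ to _×ᴿ_)
  open RingProperties ring using (-‿distribˡ-*; -‿distribʳ-*; -‿involutive; -0#≈0#)
  open AbelianGroupProperties +-abelianGroup using (⁻¹-∙-comm)
  open SetoidReasoning setoid

  -- With the optimised multiples 1 ×ᴿ x reduces to x, so the solver constants con 0ℤ and con 1ℤ
  -- evaluate to 0# and 1# definitionally.
  ⟦_⟧ᶻ : ℤ → Carrier
  ⟦ + n      ⟧ᶻ = n ×ᴿ 1#
  ⟦ -[1+ n ] ⟧ᶻ = - (suc n ×ᴿ 1#)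

  private
    [_]1 : ℕ → Carrier
    [ n ]1 = n ×ᴿ 1#

    signed : Sign → Carrier → Carrier
    signed Sign.+ x = x
    signed Sign.- x = - x

  ⟦⟧-neg : ∀ i → ⟦ ℤ.- i ⟧ᶻ ≈ - ⟦ i ⟧ᶻ
  ⟦⟧-neg (+ zero)  = ≈-sym -0#≈0#
  ⟦⟧-neg (+ suc n) = ≈-refl
  ⟦⟧-neg -[1+ n ]  = ≈-sym (-‿involutive _)

  ⟦⟧-⊖ : ∀ m n → ⟦ m ℤ.⊖ n ⟧ᶻ ≈ [ m ]1 - [ n ]1
  ⟦⟧-⊖ m n with ℕ.≤-<-connex n m
  ... | inj₁ n≤m = begin
    ⟦ m ℤ.⊖ n ⟧ᶻ                      ≡⟨ ≡.cong ⟦_⟧ᶻ (ℤ.⊖-≥ n≤m) ⟩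
    [ m ∸ n ]1                        ≈⟨ x≈x+y-y _ [ n ]1 ⟩
    [ m ∸ n ]1 + [ n ]1 - [ n ]1      ≈⟨ +-cong (×-homo-+ 1# (m ∸ n) n) ≈-refl ⟨
    [ m ∸ n ℕ.+ n ]1 - [ n ]1         ≡⟨ ≡.cong (λ k → [ k ]1 - [ n ]1) (ℕ.m∸n+n≡m n≤m) ⟩
    [ m ]1 - [ n ]1                   ∎
    where
    x≈x+y-y : ∀ x y → x ≈ x + y - y
    x≈x+y-y x y = begin
      x             ≈⟨ +-identityʳ x ⟨
      x + 0#        ≈⟨ +-cong ≈-refl (-‿inverseʳ y) ⟨
      x + (y - y)   ≈⟨ +-assoc _ _ _ ⟨
      x + y - y     ∎
  ... | inj₂ m<n = begin
    ⟦ m ℤ.⊖ n ⟧ᶻ                    ≡⟨ ≡.cong ⟦_⟧ᶻ (ℤ.⊖-< m<n) ⟩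
    ⟦ ℤ.- (+ (n ∸ m)) ⟧ᶻ            ≈⟨ ⟦⟧-neg (+ (n ∸ m)) ⟩
    - [ n ∸ m ]1                   ≈⟨ -x≈y-[x+y] _ [ m ]1 ⟩
    [ m ]1 - ([ n ∸ m ]1 + [ m ]1) ≈⟨ +-cong ≈-refl (-‿cong (×-homo-+ 1# (n ∸ m) m)) ⟨
    [ m ]1 - [ n ∸ m ℕ.+ m ]1      ≡⟨ ≡.cong (λ k → [ m ]1 - [ k ]1) (ℕ.m∸n+n≡m (ℕ.<⇒≤ m<n)) ⟩
    [ m ]1 - [ n ]1                ∎
    where
    -x≈y-[x+y] : ∀ x y → - x ≈ y - (x + y)
    -x≈y-[x+y] x y = begin
      - x            ≈⟨ +-identityˡ _ ⟨
      0# + - x       ≈⟨ +-cong (-‿inverseʳ y) ≈-refl ⟨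
      y - y + - x    ≈⟨ +-assoc _ _ _ ⟩
      y + (- y - x)  ≈⟨ +-cong ≈-refl (+-comm _ _) ⟩
      y + (- x - y)  ≈⟨ +-cong ≈-refl (⁻¹-∙-comm x y) ⟩
      y - (x + y)    ∎

  ⟦⟧-+ : ∀ i j → ⟦ i ℤ.+ j ⟧ᶻ ≈ ⟦ i ⟧ᶻ + ⟦ j ⟧ᶻ
  ⟦⟧-+ (+ m)    (+ n)    = ×-homo-+ 1# m n
  ⟦⟧-+ (+ m)    -[1+ n ] = ⟦⟧-⊖ m (suc n)
  ⟦⟧-+ -[1+ m ] (+ n)    = ≈-trans (⟦⟧-⊖ n (suc m)) (+-comm _ _)
  ⟦⟧-+ -[1+ m ] -[1+ n ] = begin
    - [ suc (suc (m ℕ.+ n)) ]1        ≡⟨ ≡.cong (λ k → - [ suc k ]1) (≡.sym (ℕ.+-suc m n)) ⟩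
    - [ suc m ℕ.+ suc n ]1            ≈⟨ -‿cong (×-homo-+ 1# (suc m) (suc n)) ⟩
    - ([ suc m ]1 + [ suc n ]1)       ≈⟨ ⁻¹-∙-comm _ _ ⟨
    - [ suc m ]1 + - [ suc n ]1       ∎

  private
    signed-cong : ∀ s {x y} → x ≈ y → signed s x ≈ signed s y
    signed-cong Sign.+ x≈y = x≈y
    signed-cong Sign.- x≈y = -‿cong x≈y

    signed-* : ∀ s t x y → signed (s Sign.* t) (x * y) ≈ signed s x * signed t y
    signed-* Sign.+ Sign.+ x y = ≈-refl
    signed-* Sign.+ Sign.- x y = -‿distribʳ-* x y
    signed-* Sign.- Sign.+ x y = -‿distribˡ-* x y
    signed-* Sign.- Sign.- x y = begin
      x * y         ≈⟨ -‿involutive _ ⟨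
      - - (x * y)   ≈⟨ -‿cong (-‿distribˡ-* x y) ⟩
      - (- x * y)   ≈⟨ -‿distribʳ-* _ _ ⟩
      - x * - y     ∎

    ⟦⟧-◃ : ∀ s n → ⟦ s ℤ.◃ n ⟧ᶻ ≈ signed s [ n ]1
    ⟦⟧-◃ Sign.+ zero    = ≈-refl
    ⟦⟧-◃ Sign.- zero    = ≈-sym -0#≈0#
    ⟦⟧-◃ Sign.+ (suc n) = ≈-refl
    ⟦⟧-◃ Sign.- (suc n) = ≈-refl

    ⟦⟧-signed : ∀ i → ⟦ i ⟧ᶻ ≈ signed (ℤ.sign i) [ ℤ.∣ i ∣ ]1
    ⟦⟧-signed (+ n)    = ≈-refl
    ⟦⟧-signed -[1+ n ] = ≈-refl

  ⟦⟧-* : ∀ i j → ⟦ i ℤ.* j ⟧ᶻ ≈ ⟦ i ⟧ᶻ * ⟦ j ⟧ᶻ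
  ⟦⟧-* i j = begin
    ⟦ s ℤ.◃ ℤ.∣ i ∣ ℕ.* ℤ.∣ j ∣ ⟧ᶻ                           ≈⟨ ⟦⟧-◃ s (ℤ.∣ i ∣ ℕ.* ℤ.∣ j ∣) ⟩
    signed s [ ℤ.∣ i ∣ ℕ.* ℤ.∣ j ∣ ]1                        ≈⟨ signed-cong s (×1-homo-* ℤ.∣ i ∣ ℤ.∣ j ∣) ⟩
    signed s ([ ℤ.∣ i ∣ ]1 * [ ℤ.∣ j ∣ ]1)                   ≈⟨ signed-* (ℤ.sign i) (ℤ.sign j) _ _ ⟩
    signed (ℤ.sign i) [ ℤ.∣ i ∣ ]1 * signed (ℤ.sign j) [ ℤ.∣ j ∣ ]1 ≈⟨ *-cong (⟦⟧-signed i) (⟦⟧-signed j) ⟨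
    ⟦ i ⟧ᶻ * ⟦ j ⟧ᶻ                                             ∎
    where
    s : Sign
    s = ℤ.sign i Sign.* ℤ.sign j

  morphism : ACR._-Raw-AlmostCommutative⟶_ (CommutativeRing.rawRing ℤ.+-*-commutativeRing) (ACR.fromCommutativeRing R)
  morphism = record
    { ⟦_⟧    = ⟦_⟧ᶻ
    ; +-homo = ⟦⟧-+
    ; *-homo = ⟦⟧-*
    ; -‿homo = ⟦⟧-neg
    ; 0-homo = ≈-refl
    ; 1-homo = ≈-refl
    }

  ⟦⟧-≟ : ∀ i j → Maybe (⟦ i ⟧ᶻ ≈ ⟦ j ⟧ᶻ)
  ⟦⟧-≟ i j with i ℤ.≟ j
  ... | yes ≡.refl = just ≈-refl
  ... | no  _      = nothing

  open RingSolver (CommutativeRing.rawRing ℤ.+-*-commutativeRing) (ACR.fromCommutativeRing R) morphism ⟦⟧-≟ public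
    using (solve; _:=_; _:+_; _:*_; _:-_; :-_; con)

module FixedPoints (R : CommutativeRing 0ℓ 0ℓ) where
  open CommutativeRing R renaming (refl to ≈-refl; sym to ≈-sym; trans to ≈-trans)
  open IntegerCoefficientSolver R using (solve; _:=_; _:+_; _:*_; _:-_; :-_; con)
  open SetoidReasoning setoid

  fixed-point : ∀ {g A P X} → (g - 1#) * A ≈ 1# → X ≈ g * X + P → X ≈ - (A * P)
  fixed-point {g} {A} {P} {X} inverse X≈gX+P = begin
    X                          ≈⟨ *-identityˡ X ⟨
    1# * X                     ≈⟨ *-cong inverse ≈-refl ⟨
    (g - 1#) * A * X           ≈⟨ solve 3 (λ g A X → (g :- con 1ℤ) :* A :* X := A :* (g :* X :- X)) ≈-refl g A X ⟩
    A * (g * X - X)            ≈⟨ *-cong ≈-refl (+-cong ≈-refl (-‿cong X≈gX+P)) ⟩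
    A * (g * X - (g * X + P))  ≈⟨ solve 4 (λ g A X P → A :* (g :* X :- (g :* X :+ P)) := :- (A :* P))
                                          ≈-refl g A X P ⟩
    - (A * P)                  ∎

  fixed-point-shifted : ∀ {g A P δ X} → (g - 1#) * A ≈ 1# → X ≈ g * X + P + δ - g * δ → X ≈ δ - A * P
  fixed-point-shifted {g} {A} {P} {δ} {X} inverse X≈ = begin
    X                ≈⟨ solve 2 (λ X δ → X := δ :+ (X :- δ)) ≈-refl X δ ⟩
    δ + (X - δ)      ≈⟨ +-cong ≈-refl (fixed-point inverse shifted) ⟩
    δ + - (A * P)    ∎
    where
    shifted : X - δ ≈ g * (X - δ) + P
    shifted = begin
      X - δ                                ≈⟨ +-cong X≈ ≈-refl ⟩
      g * X + P + δ - g * δ - δ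
        ≈⟨ solve 4 (λ g X P δ → g :* X :+ P :+ δ :- g :* δ :- δ := g :* (X :- δ) :+ P) ≈-refl g X P δ ⟩
      g * (X - δ) + P            ∎

-- Series in x, y, z, u

module ℤSums = FiniteSums ℤ.+-*-commutativeRing

Σ≤≗∑ : ∀ N f → Σ≤ N f ≡ ℤSums.∑ N f
Σ≤≗∑ zero    f = refl
Σ≤≗∑ (suc N) f = cong (ℤ._+ f (suc N)) (Σ≤≗∑ N f)

Σ≤-cong≤ : ∀ N {f g} → (∀ i → i ≤ N → f i ≡ g i) → Σ≤ N f ≡ Σ≤ N g
Σ≤-cong≤ N {f} {g} f≡g = trans (Σ≤≗∑ N f) (trans (ℤSums.∑-cong≤ N f≡g) (sym (Σ≤≗∑ N g)))

Σ≤-cong : ∀ N {f g} → (∀ i → f i ≡ g i) → Σ≤ N f ≡ Σ≤ N g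
Σ≤-cong N f≡g = Σ≤-cong≤ N (λ i _ → f≡g i)

Σ≤-zero : ∀ N {f} → (∀ i → i ≤ N → f i ≡ 0ℤ) → Σ≤ N f ≡ 0ℤ
Σ≤-zero N {f} f≡0 = trans (Σ≤≗∑ N f) (ℤSums.∑-zero N f≡0)

Σ≤-*ˡ : ∀ N x f → x ℤ.* Σ≤ N f ≡ Σ≤ N (λ i → x ℤ.* f i)
Σ≤-*ˡ N x f = trans (cong (x ℤ.*_) (Σ≤≗∑ N f)) (trans (ℤSums.∑-*ˡ N x f) (sym (Σ≤≗∑ N _)))

Σ≤-single : ∀ N m {f} → m ≤ N → (∀ i → i ≤ N → ¬ i ≡ m → f i ≡ 0ℤ) → Σ≤ N f ≡ f m
Σ≤-single N m {f} m≤N f≡0 = trans (Σ≤≗∑ N f) (ℤSums.∑-single N m m≤N f≡0)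

Σ≤-swap : ∀ N M (F : ℕ → ℕ → ℤ) → Σ≤ N (λ i → Σ≤ M (F i)) ≡ Σ≤ M (λ j → Σ≤ N (λ i → F i j))
Σ≤-swap N M F = begin
  Σ≤ N (λ i → Σ≤ M (F i))                    ≡⟨ Σ≤-cong N (λ i → Σ≤≗∑ M (F i)) ⟩
  Σ≤ N (λ i → ℤSums.∑ M (F i))               ≡⟨ Σ≤≗∑ N _ ⟩
  ℤSums.∑ N (λ i → ℤSums.∑ M (F i))          ≡⟨ ℤSums.∑-swap N M F ⟩
  ℤSums.∑ M (λ j → ℤSums.∑ N (λ i → F i j))  ≡⟨ Σ≤≗∑ M _ ⟨
  Σ≤ M (λ j → ℤSums.∑ N (λ i → F i j))       ≡⟨ Σ≤-cong M (λ j → Σ≤≗∑ N _) ⟨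
  Σ≤ M (λ j → Σ≤ N (λ i → F i j))            ∎
  where open ≡.≡-Reasoning

-- Series = ℤ[[u]][[z]][[y]][[x]]: the ring laws of ⊛ are inherited from the univariate case.
module U    = PowerSeries ℤ.+-*-commutativeRing
module ZU   = PowerSeries U.commutativeRing
module YZU  = PowerSeries ZU.commutativeRing
module XYZU = PowerSeries YZU.commutativeRing

∑ᵘ-at : ∀ N (F : ℕ → U.Coefficients) c → FiniteSums.∑ U.commutativeRing N F c ≡ Σ≤ N (λ i → F i c)
∑ᵘ-at zero    F c = refl
∑ᵘ-at (suc N) F c = cong (ℤ._+ F (suc N) c) (∑ᵘ-at N F c)

∑ᶻᵘ-at : ∀ N (F : ℕ → ZU.Coefficients) b c → FiniteSums.∑ ZU.commutativeRing N F b c ≡ Σ≤ N (λ i → F i b c)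
∑ᶻᵘ-at zero    F b c = refl
∑ᶻᵘ-at (suc N) F b c = cong (ℤ._+ F (suc N) b c) (∑ᶻᵘ-at N F b c)

∑ʸᶻᵘ-at : ∀ N (F : ℕ → YZU.Coefficients) a b c → FiniteSums.∑ YZU.commutativeRing N F a b c ≡ Σ≤ N (λ i → F i a b c)
∑ʸᶻᵘ-at zero    F a b c = refl
∑ʸᶻᵘ-at (suc N) F a b c = cong (ℤ._+ F (suc N) a b c) (∑ʸᶻᵘ-at N F a b c)

-- A record, so that f and g can be recovered from a proof of f ≈ₛ g during unification.
infix 4 _≈ₛ_
record _≈ₛ_ (f g : Series) : Set where
  constructor mk≈
  field coeff-≡ : ∀ n a b c → f n a b c ≡ g n a b c
open _≈ₛ_ public

private module XYZU-ring = CommutativeRing XYZU.commutativeRing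

infixl 6 _+ₛ_
infixl 7 _*ₛ_

-- Opaque, so that unification never unfolds a product into its coefficient sums.
opaque
  _+ₛ_ : Series → Series → Series
  _+ₛ_ = XYZU._+ᵖ_

  -ₛ_ : Series → Series
  -ₛ_ = XYZU.-ᵖ_

  0ₛ′ : Series
  0ₛ′ = XYZU.0ᵖ

  1ₛ′ : Series
  1ₛ′ = XYZU.1ᵖ

  _*ₛ_ : Series → Series → Series
  _*ₛ_ = XYZU._*ᵖ_

opaque
  unfolding _+ₛ_ -ₛ_ 0ₛ′ 1ₛ′ _*ₛ_

  isCommutativeRingₛ : IsCommutativeRing _≈ₛ_ _+ₛ_ _*ₛ_ -ₛ_ 0ₛ′ 1ₛ′
  isCommutativeRingₛ = record
    { isRing = record
      { +-isAbelianGroup = record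
        { isGroup = record
          { isMonoid = record
            { isSemigroup = record
              { isMagma = record
                { isEquivalence = record
                  { refl  = mk≈ λ _ _ _ _ → refl
                  ; sym   = λ f≈g → mk≈ λ n a b c → sym (coeff-≡ f≈g n a b c)
                  ; trans = λ f≈g g≈h → mk≈ λ n a b c → trans (coeff-≡ f≈g n a b c) (coeff-≡ g≈h n a b c)
                  }
                ; ∙-cong = λ f≈f′ g≈g′ → mk≈ (XYZU-ring.+-cong (coeff-≡ f≈f′) (coeff-≡ g≈g′))
                }
              ; assoc = λ f g h → mk≈ (XYZU-ring.+-assoc f g h)
              }
            ; identity = (λ f → mk≈ (XYZU-ring.+-identityˡ f)) , (λ f → mk≈ (XYZU-ring.+-identityʳ f))
            }
          ; inverse = (λ f → mk≈ (XYZU-ring.-‿inverseˡ f)) , (λ f → mk≈ (XYZU-ring.-‿inverseʳ f))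
          ; ⁻¹-cong = λ f≈g → mk≈ (XYZU-ring.-‿cong (coeff-≡ f≈g))
          }
        ; comm = λ f g → mk≈ (XYZU-ring.+-comm f g)
        }
      ; *-cong     = λ f≈f′ g≈g′ → mk≈ (XYZU-ring.*-cong (coeff-≡ f≈f′) (coeff-≡ g≈g′))
      ; *-assoc    = λ f g h → mk≈ (XYZU-ring.*-assoc f g h)
      ; *-identity = (λ f → mk≈ (XYZU-ring.*-identityˡ f)) , (λ f → mk≈ (XYZU-ring.*-identityʳ f))
      ; distrib    = (λ f g h → mk≈ (XYZU-ring.distribˡ f g h)) , (λ f g h → mk≈ (XYZU-ring.distribʳ f g h))
      }
    ; *-comm = λ f g → mk≈ (XYZU-ring.*-comm f g)
    }

  ⊕≈+ₛ : ∀ f g → f ⊕ g ≈ₛ f +ₛ g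
  ⊕≈+ₛ f g = mk≈ λ _ _ _ _ → refl

  ⊖≈-ₛ : ∀ f → ⊖ f ≈ₛ -ₛ f
  ⊖≈-ₛ f = mk≈ λ _ _ _ _ → refl

  0ₛ≈0ₛ′ : 0ₛ ≈ₛ 0ₛ′
  0ₛ≈0ₛ′ = mk≈ λ _ _ _ _ → refl

  1ₛ≈1ₛ′ : 1ₛ ≈ₛ 1ₛ′
  1ₛ≈1ₛ′ = mk≈ at
    where
    at : ∀ n a b c → 1ₛ n a b c ≡ 1ₛ′ n a b c
    at zero    zero    zero    zero    = refl
    at zero    zero    zero    (suc c) = refl
    at zero    zero    (suc b) c       = refl
    at zero    (suc a) b       c       = refl
    at (suc n) a       b       c       = refl

  ⊛≈*ₛ : ∀ f g → f ⊛ g ≈ₛ f *ₛ g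
  ⊛≈*ₛ f g = mk≈ λ n a b c → sym (begin
    (f *ₛ g) n a b c
      ≡⟨ ∑ʸᶻᵘ-at n _ a b c ⟩
    Σ≤ n (λ i → (f i YZU.*ᵖ g (n ∸ i)) a b c)
      ≡⟨ Σ≤-cong n (λ i → ∑ᶻᵘ-at a _ b c) ⟩
    Σ≤ n (λ i → Σ≤ a (λ j → (f i j ZU.*ᵖ g (n ∸ i) (a ∸ j)) b c))
      ≡⟨ Σ≤-cong n (λ i → Σ≤-cong a (λ j → ∑ᵘ-at b _ c)) ⟩
    Σ≤ n (λ i → Σ≤ a (λ j → Σ≤ b (λ k → (f i j k U.*ᵖ g (n ∸ i) (a ∸ j) (b ∸ k)) c)))
      ≡⟨ Σ≤-cong n (λ i → Σ≤-cong a (λ j → Σ≤-cong b (λ k → Σ≤≗∑ c _))) ⟨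
    (f ⊛ g) n a b c ∎)
    where open ≡.≡-Reasoning

seriesRing : CommutativeRing 0ℓ 0ℓ
seriesRing = record
  { Carrier = Series ; _≈_ = _≈ₛ_ ; _+_ = _+ₛ_ ; _*_ = _*ₛ_ ; -_ = -ₛ_ ; 0# = 0ₛ′ ; 1# = 1ₛ′
  ; isCommutativeRing = isCommutativeRingₛ
  }

x≡0⇒x*y≡0 : ∀ {x} y → x ≡ 0ℤ → x ℤ.* y ≡ 0ℤ
x≡0⇒x*y≡0 y refl = ℤ.*-zeroˡ y

x≡0⇒y*x≡0 : ∀ {x} y → x ≡ 0ℤ → y ℤ.* x ≡ 0ℤ
x≡0⇒y*x≡0 y refl = ℤ.*-zeroʳ y

𝟙 : Bool → ℤ
𝟙 b = if b then 1ℤ else 0ℤ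

-- _≡ᵇ_ and _≤ᵇ_ are definitionally the booleans decided by ℕ._≟_ and ℕ._≤?_, so dec-true and
-- dec-false evaluate them (also inside mono).
≤ᵇ-true : ∀ {m n} → m ≤ n → (m ≤ᵇ n) ≡ true
≤ᵇ-true {m} {n} = dec-true (m ℕ.≤? n)

≤ᵇ-false : ∀ {m n} → n < m → (m ≤ᵇ n) ≡ false
≤ᵇ-false {m} {n} n<m = dec-false (m ℕ.≤? n) (ℕ.<⇒≱ n<m)

if-0≡𝟙* : ∀ b x → (if b then x else 0ℤ) ≡ 𝟙 b ℤ.* x
if-0≡𝟙* true  x = sym (ℤ.*-identityˡ x)
if-0≡𝟙* false x = sym (ℤ.*-zeroˡ x)

𝟙-∧ : ∀ b b′ → 𝟙 (b ∧ b′) ≡ 𝟙 b ℤ.* 𝟙 b′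
𝟙-∧ true  b′ = sym (ℤ.*-identityˡ (𝟙 b′))
𝟙-∧ false b′ = refl

𝟙-true : ∀ {b} x → b ≡ true → 𝟙 b ℤ.* x ≡ x
𝟙-true x refl = ℤ.*-identityˡ x

𝟙-false : ∀ {b} x → b ≡ false → 𝟙 b ℤ.* x ≡ 0ℤ
𝟙-false x refl = ℤ.*-zeroˡ x

Σ⁴ : ℕ → ℕ → ℕ → ℕ → (ℕ → ℕ → ℕ → ℕ → ℤ) → ℤ
Σ⁴ n a b c T = Σ≤ n λ i → Σ≤ a λ j → Σ≤ b λ k → Σ≤ c λ l → T i j k l

Σ⁴-zero : ∀ n a b c {T} → (∀ i j k l → i ≤ n → j ≤ a → k ≤ b → l ≤ c → T i j k l ≡ 0ℤ) → Σ⁴ n a b c T ≡ 0ℤ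
Σ⁴-zero n a b c T≡0 =
  Σ≤-zero n λ i i≤n → Σ≤-zero a λ j j≤a → Σ≤-zero b λ k k≤b → Σ≤-zero c λ l l≤c → T≡0 i j k l i≤n j≤a k≤b l≤c

mono-off : ∀ e₁ e₂ e₃ e₄ n a b c → ¬ (n ≡ e₁ × a ≡ e₂ × b ≡ e₃ × c ≡ e₄) → mono e₁ e₂ e₃ e₄ n a b c ≡ 0ℤ
mono-off e₁ e₂ e₃ e₄ n a b c ≢ =
  cong 𝟙 (dec-false (n ℕ.≟ e₁ ×-dec a ℕ.≟ e₂ ×-dec b ℕ.≟ e₃ ×-dec c ℕ.≟ e₄) ≢)

mono-on : ∀ e₁ e₂ e₃ e₄ → mono e₁ e₂ e₃ e₄ e₁ e₂ e₃ e₄ ≡ 1ℤ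
mono-on e₁ e₂ e₃ e₄ = cong 𝟙 (dec-true (e₁ ℕ.≟ e₁ ×-dec e₂ ℕ.≟ e₂ ×-dec e₃ ℕ.≟ e₃ ×-dec e₄ ℕ.≟ e₄) (refl , refl , refl , refl))

mono-⊛ : ∀ e₁ e₂ e₃ e₄ f n a b c → (mono e₁ e₂ e₃ e₄ ⊛ f) (e₁ ℕ.+ n) (e₂ ℕ.+ a) (e₃ ℕ.+ b) (e₄ ℕ.+ c) ≡ f n a b c
mono-⊛ e₁ e₂ e₃ e₄ f n a b c = begin
  Σ⁴ N A B C term
    ≡⟨ Σ≤-single N e₁ (ℕ.m≤m+n e₁ n) (λ i _ i≢ →
         Σ≤-zero A λ j _ → Σ≤-zero B λ k _ → Σ≤-zero C λ l _ → off i j k l (λ (i≡ , _) → i≢ i≡)) ⟩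
  (Σ≤ A λ j → Σ≤ B λ k → Σ≤ C λ l → term e₁ j k l)
    ≡⟨ Σ≤-single A e₂ (ℕ.m≤m+n e₂ a) (λ j _ j≢ →
         Σ≤-zero B λ k _ → Σ≤-zero C λ l _ → off e₁ j k l (λ (_ , j≡ , _) → j≢ j≡)) ⟩
  (Σ≤ B λ k → Σ≤ C λ l → term e₁ e₂ k l)
    ≡⟨ Σ≤-single B e₃ (ℕ.m≤m+n e₃ b) (λ k _ k≢ → Σ≤-zero C λ l _ → off e₁ e₂ k l (λ (_ , _ , k≡ , _) → k≢ k≡)) ⟩
  Σ≤ C (term e₁ e₂ e₃)
    ≡⟨ Σ≤-single C e₄ (ℕ.m≤m+n e₄ c) (λ l _ l≢ → off e₁ e₂ e₃ l (λ (_ , _ , _ , l≡) → l≢ l≡)) ⟩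
  mono e₁ e₂ e₃ e₄ e₁ e₂ e₃ e₄ ℤ.* f (N ∸ e₁) (A ∸ e₂) (B ∸ e₃) (C ∸ e₄)
    ≡⟨ cong (ℤ._* f (N ∸ e₁) (A ∸ e₂) (B ∸ e₃) (C ∸ e₄)) (mono-on e₁ e₂ e₃ e₄) ⟩
  1ℤ ℤ.* f (N ∸ e₁) (A ∸ e₂) (B ∸ e₃) (C ∸ e₄)
    ≡⟨ ℤ.*-identityˡ _ ⟩
  f (N ∸ e₁) (A ∸ e₂) (B ∸ e₃) (C ∸ e₄)
    ≡⟨ cong₂ (λ x y → f x y (B ∸ e₃) (C ∸ e₄)) (ℕ.m+n∸m≡n e₁ n) (ℕ.m+n∸m≡n e₂ a) ⟩
  f n a (B ∸ e₃) (C ∸ e₄)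
    ≡⟨ cong₂ (f n a) (ℕ.m+n∸m≡n e₃ b) (ℕ.m+n∸m≡n e₄ c) ⟩
  f n a b c ∎
  where
  open ≡.≡-Reasoning
  N A B C : ℕ
  N = e₁ ℕ.+ n
  A = e₂ ℕ.+ a
  B = e₃ ℕ.+ b
  C = e₄ ℕ.+ c
  term : ℕ → ℕ → ℕ → ℕ → ℤ
  term i j k l = mono e₁ e₂ e₃ e₄ i j k l ℤ.* f (N ∸ i) (A ∸ j) (B ∸ k) (C ∸ l)
  off : ∀ i j k l → ¬ (i ≡ e₁ × j ≡ e₂ × k ≡ e₃ × l ≡ e₄) → term i j k l ≡ 0ℤ
  off i j k l ≢ = x≡0⇒x*y≡0 (f (N ∸ i) (A ∸ j) (B ∸ k) (C ∸ l)) (mono-off e₁ e₂ e₃ e₄ i j k l ≢)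

mono-⊛-below : ∀ e₁ e₂ e₃ e₄ f n a b c → n < e₁ ⊎ a < e₂ ⊎ b < e₃ ⊎ c < e₄ → (mono e₁ e₂ e₃ e₄ ⊛ f) n a b c ≡ 0ℤ
mono-⊛-below e₁ e₂ e₃ e₄ f n a b c below = Σ⁴-zero n a b c {term} λ i j k l i≤n j≤a k≤b l≤c →
  x≡0⇒x*y≡0 (f (n ∸ i) (a ∸ j) (b ∸ k) (c ∸ l)) (mono-off e₁ e₂ e₃ e₄ i j k l (not-exponent below i≤n j≤a k≤b l≤c))
  where
  term : ℕ → ℕ → ℕ → ℕ → ℤ
  term i j k l = mono e₁ e₂ e₃ e₄ i j k l ℤ.* f (n ∸ i) (a ∸ j) (b ∸ k) (c ∸ l)
  not-exponent : ∀ {i j k l} → n < e₁ ⊎ a < e₂ ⊎ b < e₃ ⊎ c < e₄ → i ≤ n → j ≤ a → k ≤ b → l ≤ c →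
                 ¬ (i ≡ e₁ × j ≡ e₂ × k ≡ e₃ × l ≡ e₄)
  not-exponent (inj₁ n<e₁)                 i≤n _ _ _ (refl , _) = ℕ.<⇒≱ n<e₁ i≤n
  not-exponent (inj₂ (inj₁ a<e₂))          _ j≤a _ _ (_ , refl , _) = ℕ.<⇒≱ a<e₂ j≤a
  not-exponent (inj₂ (inj₂ (inj₁ b<e₃)))   _ _ k≤b _ (_ , _ , refl , _) = ℕ.<⇒≱ b<e₃ k≤b
  not-exponent (inj₂ (inj₂ (inj₂ c<e₄)))   _ _ _ l≤c (_ , _ , _ , refl) = ℕ.<⇒≱ c<e₄ l≤c

at-shifted : ∀ {F G : ℕ → ℕ → ℕ → ℕ → ℤ} e₁ e₂ e₃ e₄ →
             (∀ n a b c → F (e₁ ℕ.+ n) (e₂ ℕ.+ a) (e₃ ℕ.+ b) (e₄ ℕ.+ c) ≡ G (e₁ ℕ.+ n) (e₂ ℕ.+ a) (e₃ ℕ.+ b) (e₄ ℕ.+ c)) →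
             ∀ {n a b c} → e₁ ≤ n → e₂ ≤ a → e₃ ≤ b → e₄ ≤ c → F n a b c ≡ G n a b c
at-shifted e₁ e₂ e₃ e₄ F≡G e₁≤n e₂≤a e₃≤b e₄≤c
  with _ , refl ← ℕ.m≤n⇒∃[o]m+o≡n e₁≤n | _ , refl ← ℕ.m≤n⇒∃[o]m+o≡n e₂≤a
     | _ , refl ← ℕ.m≤n⇒∃[o]m+o≡n e₃≤b | _ , refl ← ℕ.m≤n⇒∃[o]m+o≡n e₄≤c = F≡G _ _ _ _

≡ᵇ-+-cancel : ∀ e m f → (e ℕ.+ m ≡ᵇ f ℕ.+ e) ≡ (m ≡ᵇ f)
≡ᵇ-+-cancel e m f = does-⇔ (mk⇔ (λ eq → ℕ.+-cancelˡ-≡ e _ _ (trans eq (ℕ.+-comm f e)))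
                              (λ { refl → ℕ.+-comm e m }))
                        (e ℕ.+ m ℕ.≟ f ℕ.+ e) (m ℕ.≟ f)

exponents≤? : ∀ e₁ e₂ e₃ e₄ n a b c → (e₁ ≤ n × e₂ ≤ a × e₃ ≤ b × e₄ ≤ c) ⊎ (n < e₁ ⊎ a < e₂ ⊎ b < e₃ ⊎ c < e₄)
exponents≤? e₁ e₂ e₃ e₄ n a b c with e₁ ℕ.≤? n | e₂ ℕ.≤? a | e₃ ℕ.≤? b | e₄ ℕ.≤? c
... | yes e₁≤n | yes e₂≤a | yes e₃≤b | yes e₄≤c = inj₁ (e₁≤n , e₂≤a , e₃≤b , e₄≤c)
... | no e₁≰n | _        | _        | _        = inj₂ (inj₁ (ℕ.≰⇒> e₁≰n))
... | yes _   | no e₂≰a  | _        | _        = inj₂ (inj₂ (inj₁ (ℕ.≰⇒> e₂≰a)))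
... | yes _   | yes _    | no e₃≰b  | _        = inj₂ (inj₂ (inj₂ (inj₁ (ℕ.≰⇒> e₃≰b))))
... | yes _   | yes _    | yes _    | no e₄≰c  = inj₂ (inj₂ (inj₂ (inj₂ (ℕ.≰⇒> e₄≰c))))

mono-*-mono : ∀ e₁ e₂ e₃ e₄ f₁ f₂ f₃ f₄ →
              mono e₁ e₂ e₃ e₄ ⊛ mono f₁ f₂ f₃ f₄ ≈ₛ mono (f₁ ℕ.+ e₁) (f₂ ℕ.+ e₂) (f₃ ℕ.+ e₃) (f₄ ℕ.+ e₄)
mono-*-mono e₁ e₂ e₃ e₄ f₁ f₂ f₃ f₄ = mk≈ at
  where
  product sum : Series
  product = mono e₁ e₂ e₃ e₄ ⊛ mono f₁ f₂ f₃ f₄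
  sum = mono (f₁ ℕ.+ e₁) (f₂ ℕ.+ e₂) (f₃ ℕ.+ e₃) (f₄ ℕ.+ e₄)
  at-shift : ∀ n a b c → product (e₁ ℕ.+ n) (e₂ ℕ.+ a) (e₃ ℕ.+ b) (e₄ ℕ.+ c) ≡ sum (e₁ ℕ.+ n) (e₂ ℕ.+ a) (e₃ ℕ.+ b) (e₄ ℕ.+ c)
  at-shift n a b c = trans (mono-⊛ e₁ e₂ e₃ e₄ (mono f₁ f₂ f₃ f₄) n a b c) (cong 𝟙 (sym
    (cong₂ _∧_ (≡ᵇ-+-cancel e₁ n f₁) (cong₂ _∧_ (≡ᵇ-+-cancel e₂ a f₂) (cong₂ _∧_ (≡ᵇ-+-cancel e₃ b f₃) (≡ᵇ-+-cancel e₄ c f₄))))))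
  not-sum : ∀ {n a b c} → n < e₁ ⊎ a < e₂ ⊎ b < e₃ ⊎ c < e₄ →
            ¬ (n ≡ f₁ ℕ.+ e₁ × a ≡ f₂ ℕ.+ e₂ × b ≡ f₃ ℕ.+ e₃ × c ≡ f₄ ℕ.+ e₄)
  not-sum (inj₁ n<e₁)               (refl , _)         = ℕ.<⇒≱ n<e₁ (ℕ.m≤n+m e₁ f₁)
  not-sum (inj₂ (inj₁ a<e₂))        (_ , refl , _)     = ℕ.<⇒≱ a<e₂ (ℕ.m≤n+m e₂ f₂)
  not-sum (inj₂ (inj₂ (inj₁ b<e₃))) (_ , _ , refl , _) = ℕ.<⇒≱ b<e₃ (ℕ.m≤n+m e₃ f₃)
  not-sum (inj₂ (inj₂ (inj₂ c<e₄))) (_ , _ , _ , refl) = ℕ.<⇒≱ c<e₄ (ℕ.m≤n+m e₄ f₄)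
  at : ∀ n a b c → product n a b c ≡ sum n a b c
  at n a b c with exponents≤? e₁ e₂ e₃ e₄ n a b c
  ... | inj₁ (e₁≤n , e₂≤a , e₃≤b , e₄≤c) = at-shifted {product} {sum} e₁ e₂ e₃ e₄ at-shift e₁≤n e₂≤a e₃≤b e₄≤c
  ... | inj₂ below = trans (mono-⊛-below e₁ e₂ e₃ e₄ (mono f₁ f₂ f₃ f₄) n a b c below)
                           (sym (mono-off (f₁ ℕ.+ e₁) (f₂ ℕ.+ e₂) (f₃ ℕ.+ e₃) (f₄ ℕ.+ e₄) n a b c (not-sum below)))

record Weight : Set where
  constructor weight
  field ωx ωy ωz ωu : ℕ

deg : Weight → ℕ → ℕ → ℕ → ℕ → ℕ
deg (weight α β γ δ) n a b c = α ℕ.* n ℕ.+ β ℕ.* a ℕ.+ γ ℕ.* b ℕ.+ δ ℕ.* c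

deg-+ : ∀ w n a b c n′ a′ b′ c′ →
        deg w (n ℕ.+ n′) (a ℕ.+ a′) (b ℕ.+ b′) (c ℕ.+ c′) ≡ deg w n a b c ℕ.+ deg w n′ a′ b′ c′
deg-+ (weight α β γ δ) n a b c n′ a′ b′ c′ = distributes α β γ δ n a b c n′ a′ b′ c′
  where
  open import Data.Nat.Base using (_+_; _*_)
  distributes : ∀ α β γ δ n a b c n′ a′ b′ c′ →
    α * (n + n′) + β * (a + a′) + γ * (b + b′) + δ * (c + c′) ≡ (α * n + β * a + γ * b + δ * c) + (α * n′ + β * a′ + γ * b′ + δ * c′)
  distributes = solve-∀

Order≥ : Weight → ℕ → Series → Set
Order≥ w p f = ∀ n a b c → deg w n a b c < p → f n a b c ≡ 0ℤ

Order≥-zero : ∀ w f → Order≥ w 0 f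
Order≥-zero w f n a b c ()

Order≥-weaken : ∀ w {f p q} → q ≤ p → Order≥ w p f → Order≥ w q f
Order≥-weaken w q≤p f≥p n a b c deg<q = f≥p n a b c (ℕ.<-≤-trans deg<q q≤p)

Order≥-0ₛ : ∀ w p → Order≥ w p 0ₛ
Order≥-0ₛ w p n a b c _ = refl

Order≥-⊕ : ∀ w {f g p} → Order≥ w p f → Order≥ w p g → Order≥ w p (f ⊕ g)
Order≥-⊕ w f≥p g≥p n a b c deg<p = cong₂ ℤ._+_ (f≥p n a b c deg<p) (g≥p n a b c deg<p)

Order≥-mono : ∀ w e₁ e₂ e₃ e₄ → Order≥ w (deg w e₁ e₂ e₃ e₄) (mono e₁ e₂ e₃ e₄)
Order≥-mono w e₁ e₂ e₃ e₄ n a b c deg<deg = mono-off e₁ e₂ e₃ e₄ n a b c λ { (refl , refl , refl , refl) → ℕ.<-irrefl refl deg<deg }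

Order≥-⊛ : ∀ w {f g p q} → Order≥ w p f → Order≥ w q g → Order≥ w (p ℕ.+ q) (f ⊛ g)
Order≥-⊛ w {f} {g} {p} {q} f≥p g≥q n a b c deg<p+q = Σ⁴-zero n a b c {term} vanishes
  where
  term : ℕ → ℕ → ℕ → ℕ → ℤ
  term i j k l = f i j k l ℤ.* g (n ∸ i) (a ∸ j) (b ∸ k) (c ∸ l)
  vanishes : ∀ i j k l → i ≤ n → j ≤ a → k ≤ b → l ≤ c → term i j k l ≡ 0ℤ
  vanishes i j k l i≤n j≤a k≤b l≤c with deg w i j k l ℕ.<? p
  ... | yes deg<p = x≡0⇒x*y≡0 _ (f≥p i j k l deg<p)
  ... | no  deg≮p = x≡0⇒y*x≡0 (f i j k l) (g≥q _ _ _ _ (ℕ.+-cancelˡ-< p _ _ (begin-strict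
        p ℕ.+ deg w (n ∸ i) (a ∸ j) (b ∸ k) (c ∸ l)                ≤⟨ ℕ.+-monoˡ-≤ _ (ℕ.≮⇒≥ deg≮p) ⟩
        deg w i j k l ℕ.+ deg w (n ∸ i) (a ∸ j) (b ∸ k) (c ∸ l)    ≡⟨ deg-+ w i j k l _ _ _ _ ⟨
        deg w (i ℕ.+ (n ∸ i)) (j ℕ.+ (a ∸ j)) (k ℕ.+ (b ∸ k)) (l ℕ.+ (c ∸ l))
                      ≡⟨ cong₂ (λ x y → deg w x y _ _) (ℕ.m+[n∸m]≡n i≤n) (ℕ.m+[n∸m]≡n j≤a) ⟩
        deg w n a (k ℕ.+ (b ∸ k)) (l ℕ.+ (c ∸ l))                  ≡⟨ cong₂ (deg w n a) (ℕ.m+[n∸m]≡n k≤b) (ℕ.m+[n∸m]≡n l≤c) ⟩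
        deg w n a b c                                               <⟨ deg<p+q ⟩
        p ℕ.+ q ∎)))
    where open ℕ.≤-Reasoning

open CommutativeRing seriesRing public
  using (_≈_; _+_; _*_; -_; _-_; 0#; 1#; +-cong; *-cong; -‿cong; +-assoc; distribˡ; setoid)
  renaming (refl to ≈-refl; sym to ≈-sym; trans to ≈-trans)
open IntegerCoefficientSolver seriesRing public using (solve; _:=_; _:+_; _:*_; _:-_; :-_; con)

⊕≈+ : ∀ {f f′ g g′} → f ≈ f′ → g ≈ g′ → f ⊕ g ≈ f′ + g′
⊕≈+ {f} {g = g} f≈f′ g≈g′ = ≈-trans (⊕≈+ₛ f g) (+-cong f≈f′ g≈g′)

⊛≈* : ∀ {f f′ g g′} → f ≈ f′ → g ≈ g′ → f ⊛ g ≈ f′ * g′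
⊛≈* {f} {g = g} f≈f′ g≈g′ = ≈-trans (⊛≈*ₛ f g) (*-cong f≈f′ g≈g′)

⊝≈- : ∀ {f f′ g g′} → f ≈ f′ → g ≈ g′ → f ⊝ g ≈ f′ - g′
⊝≈- {f} {g = g} f≈f′ g≈g′ = ≈-trans (⊕≈+ₛ f (⊖ g)) (+-cong f≈f′ (≈-trans (⊖≈-ₛ g) (-‿cong g≈g′)))

mono-* : ∀ e₁ e₂ e₃ e₄ f₁ f₂ f₃ f₄ →
         mono e₁ e₂ e₃ e₄ * mono f₁ f₂ f₃ f₄ ≈ mono (f₁ ℕ.+ e₁) (f₂ ℕ.+ e₂) (f₃ ℕ.+ e₃) (f₄ ℕ.+ e₄)
mono-* e₁ e₂ e₃ e₄ f₁ f₂ f₃ f₄ = ≈-trans (≈-sym (⊛≈*ₛ _ _)) (mono-*-mono e₁ e₂ e₃ e₄ f₁ f₂ f₃ f₄)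

total : Weight
total = weight 1 1 1 1

deg-total : ∀ n a b c → deg total n a b c ≡ n ℕ.+ a ℕ.+ b ℕ.+ c
deg-total n a b c = unit-weights n a b c
  where
  unit-weights : ∀ n a b c → 1 ℕ.* n ℕ.+ 1 ℕ.* a ℕ.+ 1 ℕ.* b ℕ.+ 1 ℕ.* c ≡ n ℕ.+ a ℕ.+ b ℕ.+ c
  unit-weights = solve-∀

xWeight : Weight
xWeight = weight 1 0 0 0

deg-x : ∀ n a b c → deg xWeight n a b c ≡ n
deg-x n a b c = x-weight n a b c
  where
  x-weight : ∀ n a b c → 1 ℕ.* n ℕ.+ 0 ℕ.* a ℕ.+ 0 ℕ.* b ℕ.+ 0 ℕ.* c ≡ n
  x-weight = solve-∀

Order≥-pow : ∀ w {g} → Order≥ w 1 g → ∀ t → Order≥ w t (pow g t)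
Order≥-pow w g≥1 zero    = Order≥-zero w _
Order≥-pow w {g} g≥1 (suc t) =
  ≡.subst (λ p → Order≥ w p (pow g (suc t))) (ℕ.+-comm t 1) (Order≥-⊛ w (Order≥-pow w g≥1 t) g≥1)

Σ≤-extend : ∀ N M f → N ≤ M → (∀ t → N < t → t ≤ M → f t ≡ 0ℤ) → Σ≤ M f ≡ Σ≤ N f
Σ≤-extend N zero    f z≤n    _   = refl
Σ≤-extend N (suc M) f N≤1+M f≡0 with ℕ.m≤n⇒m<n∨m≡n N≤1+M
... | inj₂ refl       = refl
... | inj₁ (s≤s N≤M) = begin
  Σ≤ M f ℤ.+ f (suc M) ≡⟨ cong₂ ℤ._+_ (Σ≤-extend N M f N≤M (λ t N<t t≤M → f≡0 t N<t (ℕ.m≤n⇒m≤1+n t≤M)))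
                                       (f≡0 (suc M) (s≤s N≤M) ℕ.≤-refl) ⟩
  Σ≤ N f ℤ.+ 0ℤ        ≡⟨ ℤ.+-identityʳ _ ⟩
  Σ≤ N f               ∎
  where open ≡.≡-Reasoning

⊛-local : ∀ f h h′ n a b c →
          (∀ n′ a′ b′ c′ → n′ ≤ n → a′ ≤ a → b′ ≤ b → c′ ≤ c → h n′ a′ b′ c′ ≡ h′ n′ a′ b′ c′) →
          (f ⊛ h) n a b c ≡ (f ⊛ h′) n a b c
⊛-local f h h′ n a b c h≡h′ =
  Σ≤-cong n λ i → Σ≤-cong a λ j → Σ≤-cong b λ k → Σ≤-cong c λ l →
    cong (f i j k l ℤ.*_) (h≡h′ _ _ _ _ (ℕ.m∸n≤m n i) (ℕ.m∸n≤m a j) (ℕ.m∸n≤m b k) (ℕ.m∸n≤m c l))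

geometricSum : Series → ℕ → Series
geometricSum g zero    = 1ₛ
geometricSum g (suc T) = geometricSum g T ⊕ pow g (suc T)

geometricSum-at : ∀ g T n a b c → geometricSum g T n a b c ≡ Σ≤ T (λ t → pow g t n a b c)
geometricSum-at g zero    n a b c = refl
geometricSum-at g (suc T) n a b c = cong (ℤ._+ pow g (suc T) n a b c) (geometricSum-at g T n a b c)

geometricSum-telescopes : ∀ g T → (1ₛ ⊝ g) ⊛ geometricSum g T ≈ 1ₛ ⊝ pow g (suc T)
geometricSum-telescopes g T = ≈-trans (⊛≈* (⊝≈- 1ₛ≈1ₛ′ ≈-refl) ≈-refl) (≈-trans (telescopes T) (≈-sym (⊝≈- 1ₛ≈1ₛ′ ≈-refl)))
  where
  open SetoidReasoning setoid
  telescopes : ∀ T → (1# - g) * geometricSum g T ≈ 1# - pow g (suc T)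
  telescopes zero = begin
    (1# - g) * 1ₛ     ≈⟨ *-cong ≈-refl 1ₛ≈1ₛ′ ⟩
    (1# - g) * 1#     ≈⟨ solve 1 (λ g → (con 1ℤ :- g) :* con 1ℤ := con 1ℤ :- con 1ℤ :* g) ≈-refl g ⟩
    1# - 1# * g       ≈⟨ +-cong ≈-refl (-‿cong (⊛≈* 1ₛ≈1ₛ′ ≈-refl)) ⟨
    1# - (1ₛ ⊛ g)     ∎
  telescopes (suc T) = begin
    (1# - g) * (geometricSum g T ⊕ p)                ≈⟨ *-cong ≈-refl (⊕≈+ₛ _ p) ⟩
    (1# - g) * (geometricSum g T + p)                ≈⟨ distribˡ _ _ p ⟩
    (1# - g) * geometricSum g T + (1# - g) * p       ≈⟨ +-cong (telescopes T) ≈-refl ⟩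
    (1# - p) + (1# - g) * p
      ≈⟨ solve 2 (λ g p → (con 1ℤ :- p) :+ (con 1ℤ :- g) :* p := con 1ℤ :- p :* g) ≈-refl g p ⟩
    1# - p * g                                       ≈⟨ +-cong ≈-refl (-‿cong (⊛≈*ₛ p g)) ⟨
    1# - (p ⊛ g)                                     ∎
    where
    p : Series
    p = pow g (suc T)

1-g*invOneMinus : ∀ g → Order≥ total 1 g → (1ₛ ⊝ g) ⊛ invOneMinus g ≈ 1ₛ
1-g*invOneMinus g g≥1 = mk≈ at
  where
  agrees : ∀ T n a b c → n ℕ.+ a ℕ.+ b ℕ.+ c ≤ T → geometricSum g T n a b c ≡ invOneMinus g n a b c
  agrees T n a b c tot≤T = trans (geometricSum-at g T n a b c)
    (Σ≤-extend _ T _ tot≤T (λ t tot<t _ → Order≥-pow total g≥1 t n a b c (ℕ.≤-<-trans (ℕ.≤-reflexive (deg-total n a b c)) tot<t)))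
  at : ∀ n a b c → ((1ₛ ⊝ g) ⊛ invOneMinus g) n a b c ≡ 1ₛ n a b c
  at n a b c = begin
    ((1ₛ ⊝ g) ⊛ invOneMinus g) n a b c
      ≡⟨ ⊛-local (1ₛ ⊝ g) _ _ n a b c (λ n′ a′ b′ c′ n′≤n a′≤a b′≤b c′≤c →
           sym (agrees T n′ a′ b′ c′ (ℕ.+-mono-≤ (ℕ.+-mono-≤ (ℕ.+-mono-≤ n′≤n a′≤a) b′≤b) c′≤c))) ⟩
    ((1ₛ ⊝ g) ⊛ geometricSum g T) n a b c
      ≡⟨ coeff-≡ (geometricSum-telescopes g T) n a b c ⟩
    1ₛ n a b c ℤ.+ ℤ.- pow g (suc T) n a b c
      ≡⟨ cong (λ x → 1ₛ n a b c ℤ.+ ℤ.- x) (Order≥-pow total g≥1 (suc T) n a b c (ℕ.≤-reflexive (cong suc (deg-total n a b c)))) ⟩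
    1ₛ n a b c ℤ.+ 0ℤ
      ≡⟨ ℤ.+-identityʳ _ ⟩
    1ₛ n a b c ∎
    where
    open ≡.≡-Reasoning
    T : ℕ
    T = n ℕ.+ a ℕ.+ b ℕ.+ c

recipMinusOne-inverse : ∀ g → Order≥ total 1 g → (g - 1#) * recipMinusOne g ≈ 1#
recipMinusOne-inverse g g≥1 = begin
  (g - 1#) * recipMinusOne g           ≈⟨ *-cong ≈-refl (⊖≈-ₛ (invOneMinus g)) ⟩
  (g - 1#) * - invOneMinus g           ≈⟨ solve 2 (λ g v → (g :- con 1ℤ) :* (:- v) := (con 1ℤ :- g) :* v) ≈-refl g (invOneMinus g) ⟩
  (1# - g) * invOneMinus g             ≈⟨ ⊛≈* (⊝≈- 1ₛ≈1ₛ′ ≈-refl) ≈-refl ⟨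
  (1ₛ ⊝ g) ⊛ invOneMinus g             ≈⟨ 1-g*invOneMinus g g≥1 ⟩
  1ₛ                                   ≈⟨ 1ₛ≈1ₛ′ ⟩
  1#                                   ∎
  where open SetoidReasoning setoid

-- The substitution u ↦ y^p z^q u

Σ≤-from : ∀ s m (X : ℕ → ℤ) → Σ≤ (s ℕ.+ m) (λ j → 𝟙 (s ≤ᵇ j) ℤ.* X j) ≡ Σ≤ m (λ j → X (s ℕ.+ j))
Σ≤-from s zero X = begin
  Σ≤ (s ℕ.+ 0) (λ j → 𝟙 (s ≤ᵇ j) ℤ.* X j) ≡⟨ cong (λ N → Σ≤ N (λ j → 𝟙 (s ≤ᵇ j) ℤ.* X j)) (ℕ.+-identityʳ s) ⟩
  Σ≤ s (λ j → 𝟙 (s ≤ᵇ j) ℤ.* X j)         ≡⟨ Σ≤-single s s ℕ.≤-refl (λ j j≤s j≢s → 𝟙-false (X j) (≤ᵇ-false (ℕ.≤∧≢⇒< j≤s j≢s))) ⟩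
  𝟙 (s ≤ᵇ s) ℤ.* X s                       ≡⟨ 𝟙-true (X s) (≤ᵇ-true (ℕ.≤-refl {s})) ⟩
  X s                                      ≡⟨ cong X (ℕ.+-identityʳ s) ⟨
  X (s ℕ.+ 0)                              ∎
  where open ≡.≡-Reasoning
Σ≤-from s (suc m) X = begin
  Σ≤ (s ℕ.+ suc m) (λ j → 𝟙 (s ≤ᵇ j) ℤ.* X j)
    ≡⟨ cong (λ N → Σ≤ N (λ j → 𝟙 (s ≤ᵇ j) ℤ.* X j)) (ℕ.+-suc s m) ⟩
  Σ≤ (s ℕ.+ m) (λ j → 𝟙 (s ≤ᵇ j) ℤ.* X j) ℤ.+ 𝟙 (s ≤ᵇ suc (s ℕ.+ m)) ℤ.* X (suc (s ℕ.+ m))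
    ≡⟨ cong₂ ℤ._+_ (Σ≤-from s m X) (𝟙-true (X (suc (s ℕ.+ m))) (≤ᵇ-true (ℕ.m≤n⇒m≤1+n (ℕ.m≤m+n s m)))) ⟩
  Σ≤ m (λ j → X (s ℕ.+ j)) ℤ.+ X (suc (s ℕ.+ m))
    ≡⟨ cong (λ k → Σ≤ m (λ j → X (s ℕ.+ j)) ℤ.+ X k) (ℕ.+-suc s m) ⟨
  Σ≤ (suc m) (λ j → X (s ℕ.+ j)) ∎
  where open ≡.≡-Reasoning

Σ≤-upTo : ∀ N m (K : ℕ → ℤ) → Σ≤ (N ℕ.+ m) (λ j → 𝟙 (j ≤ᵇ N) ℤ.* K j) ≡ Σ≤ N K
Σ≤-upTo N m K = trans (Σ≤-extend N (N ℕ.+ m) _ (ℕ.m≤m+n N m) (λ j N<j _ → 𝟙-false (K j) (≤ᵇ-false N<j)))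
                      (Σ≤-cong≤ N (λ j j≤N → 𝟙-true (K j) (≤ᵇ-true j≤N)))

Σ≤-shifted-convolution : ∀ A s d (H : ℕ → ℕ → ℤ) →
  Σ≤ A (λ j → 𝟙 (s ≤ᵇ j) ℤ.* (𝟙 (d ≤ᵇ A ∸ j) ℤ.* H (j ∸ s) (A ∸ j ∸ d)))
  ≡ 𝟙 (s ℕ.+ d ≤ᵇ A) ℤ.* Σ≤ (A ∸ (s ℕ.+ d)) (λ j → H j (A ∸ (s ℕ.+ d) ∸ j))
Σ≤-shifted-convolution A s d H with s ℕ.+ d ℕ.≤? A
... | no  s+d≰A = trans (Σ≤-zero A outside) (sym (𝟙-false _ (≤ᵇ-false (ℕ.≰⇒> s+d≰A))))
  where
  outside : ∀ j → j ≤ A → 𝟙 (s ≤ᵇ j) ℤ.* (𝟙 (d ≤ᵇ A ∸ j) ℤ.* H (j ∸ s) (A ∸ j ∸ d)) ≡ 0ℤ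
  outside j j≤A with s ℕ.≤? j | d ℕ.≤? A ∸ j
  ... | no s≰j | _      = 𝟙-false _ (≤ᵇ-false (ℕ.≰⇒> s≰j))
  ... | yes _  | no d≰  = x≡0⇒y*x≡0 (𝟙 (s ≤ᵇ j)) (𝟙-false _ (≤ᵇ-false (ℕ.≰⇒> d≰)))
  ... | yes s≤j | yes d≤ = ⊥-elim (s+d≰A (≡.subst (s ℕ.+ d ≤_) (ℕ.m+[n∸m]≡n j≤A) (ℕ.+-mono-≤ s≤j d≤)))
... | yes s+d≤A with r , refl ← ℕ.m≤n⇒∃[o]m+o≡n s+d≤A = begin
  Σ≤ (s ℕ.+ d ℕ.+ r) (λ j → 𝟙 (s ≤ᵇ j) ℤ.* X j)
    ≡⟨ cong (λ N → Σ≤ N (λ j → 𝟙 (s ≤ᵇ j) ℤ.* X j)) (ℕ.+-assoc s d r) ⟩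
  Σ≤ (s ℕ.+ (d ℕ.+ r)) (λ j → 𝟙 (s ≤ᵇ j) ℤ.* X j)
    ≡⟨ Σ≤-from s (d ℕ.+ r) X ⟩
  Σ≤ (d ℕ.+ r) (λ j → X (s ℕ.+ j))
    ≡⟨ Σ≤-cong≤ (d ℕ.+ r) shifted ⟩
  Σ≤ (d ℕ.+ r) (λ j → 𝟙 (j ≤ᵇ r) ℤ.* H j (r ∸ j))
    ≡⟨ cong (λ N → Σ≤ N (λ j → 𝟙 (j ≤ᵇ r) ℤ.* H j (r ∸ j))) (ℕ.+-comm d r) ⟩
  Σ≤ (r ℕ.+ d) (λ j → 𝟙 (j ≤ᵇ r) ℤ.* H j (r ∸ j))
    ≡⟨ Σ≤-upTo r d (λ j → H j (r ∸ j)) ⟩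
  Σ≤ r (λ j → H j (r ∸ j))
    ≡⟨ cong (λ m → Σ≤ m (λ j → H j (m ∸ j))) (ℕ.m+n∸m≡n (s ℕ.+ d) r) ⟨
  Σ≤ (s ℕ.+ d ℕ.+ r ∸ (s ℕ.+ d)) (λ j → H j (s ℕ.+ d ℕ.+ r ∸ (s ℕ.+ d) ∸ j))
    ≡⟨ 𝟙-true _ (≤ᵇ-true (ℕ.m≤m+n (s ℕ.+ d) r)) ⟨
  𝟙 (s ℕ.+ d ≤ᵇ s ℕ.+ d ℕ.+ r) ℤ.* Σ≤ (s ℕ.+ d ℕ.+ r ∸ (s ℕ.+ d)) (λ j → H j (s ℕ.+ d ℕ.+ r ∸ (s ℕ.+ d) ∸ j)) ∎
  where
  open ≡.≡-Reasoning
  X : ℕ → ℤ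
  X j = 𝟙 (d ≤ᵇ s ℕ.+ d ℕ.+ r ∸ j) ℤ.* H (j ∸ s) (s ℕ.+ d ℕ.+ r ∸ j ∸ d)
  shifted : ∀ j → j ≤ d ℕ.+ r → X (s ℕ.+ j) ≡ 𝟙 (j ≤ᵇ r) ℤ.* H j (r ∸ j)
  shifted j j≤d+r = begin
    𝟙 (d ≤ᵇ s ℕ.+ d ℕ.+ r ∸ (s ℕ.+ j)) ℤ.* H (s ℕ.+ j ∸ s) (s ℕ.+ d ℕ.+ r ∸ (s ℕ.+ j) ∸ d)
      ≡⟨ cong₂ (λ m i → 𝟙 (d ≤ᵇ m) ℤ.* H i (m ∸ d)) drop-s (ℕ.m+n∸m≡n s j) ⟩
    𝟙 (d ≤ᵇ d ℕ.+ r ∸ j) ℤ.* H j (d ℕ.+ r ∸ j ∸ d)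
      ≡⟨ cong₂ (λ b m → 𝟙 b ℤ.* H j m) in-window drop-d ⟩
    𝟙 (j ≤ᵇ r) ℤ.* H j (r ∸ j) ∎
    where
    drop-s : s ℕ.+ d ℕ.+ r ∸ (s ℕ.+ j) ≡ d ℕ.+ r ∸ j
    drop-s = trans (cong (_∸ (s ℕ.+ j)) (ℕ.+-assoc s d r)) (ℕ.[m+n]∸[m+o]≡n∸o s (d ℕ.+ r) j)
    drop-d : d ℕ.+ r ∸ j ∸ d ≡ r ∸ j
    drop-d = trans (ℕ.∸-+-assoc (d ℕ.+ r) j d) (trans (cong (d ℕ.+ r ∸_) (ℕ.+-comm j d)) (ℕ.[m+n]∸[m+o]≡n∸o d r j))
    in-window : (d ≤ᵇ d ℕ.+ r ∸ j) ≡ (j ≤ᵇ r)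
    in-window = does-⇔ (mk⇔ (λ d≤ → ℕ.+-cancelˡ-≤ d j r (≡.subst (d ℕ.+ j ≤_) (ℕ.m∸n+n≡m j≤d+r) (ℕ.+-monoˡ-≤ j d≤)))
                             (λ j≤r → ≡.subst (d ≤_) (sym (ℕ.+-∸-assoc d j≤r)) (ℕ.m≤m+n d (r ∸ j))))
                       (d ℕ.≤? d ℕ.+ r ∸ j) (j ℕ.≤? r)

Σ≤²-shifted-convolution : ∀ A B s d s′ d′ (H : ℕ → ℕ → ℕ → ℕ → ℤ) →
  Σ≤ A (λ j → Σ≤ B (λ k → 𝟙 (s ≤ᵇ j) ℤ.* (𝟙 (d ≤ᵇ A ∸ j) ℤ.* (𝟙 (s′ ≤ᵇ k) ℤ.* (𝟙 (d′ ≤ᵇ B ∸ k) ℤ.*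
                            H (j ∸ s) (A ∸ j ∸ d) (k ∸ s′) (B ∸ k ∸ d′))))))
  ≡ (𝟙 (s ℕ.+ d ≤ᵇ A) ℤ.* 𝟙 (s′ ℕ.+ d′ ≤ᵇ B)) ℤ.*
    Σ≤ (A ∸ (s ℕ.+ d)) (λ j → Σ≤ (B ∸ (s′ ℕ.+ d′)) (λ k → H j (A ∸ (s ℕ.+ d) ∸ j) k (B ∸ (s′ ℕ.+ d′) ∸ k)))
Σ≤²-shifted-convolution A B s d s′ d′ H = begin
  Σ≤ A (λ j → Σ≤ B (λ k → u j ℤ.* (v j ℤ.* (u′ k ℤ.* (v′ k ℤ.* H (j ∸ s) (A ∸ j ∸ d) (k ∸ s′) (B ∸ k ∸ d′))))))
    ≡⟨ Σ≤-cong A (λ j → trans (sym (Σ≤-*ˡ B (u j) _)) (cong (u j ℤ.*_) (sym (Σ≤-*ˡ B (v j) _)))) ⟩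
  Σ≤ A (λ j → u j ℤ.* (v j ℤ.* Σ≤ B (λ k → u′ k ℤ.* (v′ k ℤ.* H (j ∸ s) (A ∸ j ∸ d) (k ∸ s′) (B ∸ k ∸ d′)))))
    ≡⟨ Σ≤-cong A (λ j → cong (λ x → u j ℤ.* (v j ℤ.* x)) (Σ≤-shifted-convolution B s′ d′ (H (j ∸ s) (A ∸ j ∸ d)))) ⟩
  Σ≤ A (λ j → u j ℤ.* (v j ℤ.* (κ′ ℤ.* Y (j ∸ s) (A ∸ j ∸ d))))
    ≡⟨ Σ≤-cong A (λ j → pull-out (u j) (v j) κ′ (Y (j ∸ s) (A ∸ j ∸ d))) ⟩
  Σ≤ A (λ j → κ′ ℤ.* (u j ℤ.* (v j ℤ.* Y (j ∸ s) (A ∸ j ∸ d))))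
    ≡⟨ Σ≤-*ˡ A κ′ _ ⟨
  κ′ ℤ.* Σ≤ A (λ j → u j ℤ.* (v j ℤ.* Y (j ∸ s) (A ∸ j ∸ d)))
    ≡⟨ cong (κ′ ℤ.*_) (Σ≤-shifted-convolution A s d Y) ⟩
  κ′ ℤ.* (κ ℤ.* Σ≤ (A ∸ (s ℕ.+ d)) (λ j → Y j (A ∸ (s ℕ.+ d) ∸ j)))
    ≡⟨ reassociate κ′ κ _ ⟩
  (κ ℤ.* κ′) ℤ.* Σ≤ (A ∸ (s ℕ.+ d)) (λ j → Y j (A ∸ (s ℕ.+ d) ∸ j)) ∎
  where
  open ≡.≡-Reasoning
  u v : ℕ → ℤ
  u j = 𝟙 (s ≤ᵇ j)
  v j = 𝟙 (d ≤ᵇ A ∸ j)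
  u′ v′ : ℕ → ℤ
  u′ k = 𝟙 (s′ ≤ᵇ k)
  v′ k = 𝟙 (d′ ≤ᵇ B ∸ k)
  κ κ′ : ℤ
  κ  = 𝟙 (s ℕ.+ d ≤ᵇ A)
  κ′ = 𝟙 (s′ ℕ.+ d′ ≤ᵇ B)
  Y : ℕ → ℕ → ℤ
  Y x y = Σ≤ (B ∸ (s′ ℕ.+ d′)) (λ k → H x y k (B ∸ (s′ ℕ.+ d′) ∸ k))
  pull-out : ∀ u v κ y → u ℤ.* (v ℤ.* (κ ℤ.* y)) ≡ κ ℤ.* (u ℤ.* (v ℤ.* y))
  pull-out = ℤ-Solver.solve-∀
  reassociate : ∀ κ′ κ y → κ′ ℤ.* (κ ℤ.* y) ≡ (κ ℤ.* κ′) ℤ.* y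
  reassociate = ℤ-Solver.solve-∀

-- sub p q f = f(x, y, z, y^p z^q u); substU k is sub k k.
sub : ℕ → ℕ → Series → Series
sub p q f n a b c = if (p ℕ.* c ≤ᵇ a) ∧ (q ℕ.* c ≤ᵇ b) then f n (a ∸ p ℕ.* c) (b ∸ q ℕ.* c) c else 0ℤ

sub-at : ∀ p q f n a b c → sub p q f n a b c ≡ (𝟙 (p ℕ.* c ≤ᵇ a) ℤ.* 𝟙 (q ℕ.* c ≤ᵇ b)) ℤ.* f n (a ∸ p ℕ.* c) (b ∸ q ℕ.* c) c
sub-at p q f n a b c = trans (if-0≡𝟙* ((p ℕ.* c ≤ᵇ a) ∧ (q ℕ.* c ≤ᵇ b)) value) (cong (ℤ._* value) (𝟙-∧ (p ℕ.* c ≤ᵇ a) (q ℕ.* c ≤ᵇ b)))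
  where
  value : ℤ
  value = f n (a ∸ p ℕ.* c) (b ∸ q ℕ.* c) c

Σ⁴-reorder : ∀ n a b c T → Σ⁴ n a b c T ≡ (Σ≤ n λ i → Σ≤ c λ l → Σ≤ a λ j → Σ≤ b λ k → T i j k l)
Σ⁴-reorder n a b c T = Σ≤-cong n λ i →
  trans (Σ≤-cong a (λ j → Σ≤-swap b c (T i j))) (Σ≤-swap a c (λ j l → Σ≤ b (λ k → T i j k l)))

sub-⊛-slice : ∀ p q f g n a b c i l → l ≤ c →
  (Σ≤ a λ j → Σ≤ b λ k → sub p q f i j k l ℤ.* sub p q g (n ∸ i) (a ∸ j) (b ∸ k) (c ∸ l))
  ≡ (𝟙 (p ℕ.* c ≤ᵇ a) ℤ.* 𝟙 (q ℕ.* c ≤ᵇ b)) ℤ.*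
    (Σ≤ (a ∸ p ℕ.* c) λ j → Σ≤ (b ∸ q ℕ.* c) λ k → f i j k l ℤ.* g (n ∸ i) (a ∸ p ℕ.* c ∸ j) (b ∸ q ℕ.* c ∸ k) (c ∸ l))
sub-⊛-slice p q f g n a b c i l l≤c = begin
  (Σ≤ a λ j → Σ≤ b λ k → sub p q f i j k l ℤ.* sub p q g (n ∸ i) (a ∸ j) (b ∸ k) (c ∸ l))
    ≡⟨ Σ≤-cong a (λ j → Σ≤-cong b (factor j)) ⟩
  (Σ≤ a λ j → Σ≤ b λ k → 𝟙 (s ≤ᵇ j) ℤ.* (𝟙 (d ≤ᵇ a ∸ j) ℤ.* (𝟙 (s′ ≤ᵇ k) ℤ.* (𝟙 (d′ ≤ᵇ b ∸ k) ℤ.*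
                           H (j ∸ s) (a ∸ j ∸ d) (k ∸ s′) (b ∸ k ∸ d′)))))
    ≡⟨ Σ≤²-shifted-convolution a b s d s′ d′ H ⟩
  (𝟙 (s ℕ.+ d ≤ᵇ a) ℤ.* 𝟙 (s′ ℕ.+ d′ ≤ᵇ b)) ℤ.*
    Σ≤ (a ∸ (s ℕ.+ d)) (λ j → Σ≤ (b ∸ (s′ ℕ.+ d′)) (λ k → H j (a ∸ (s ℕ.+ d) ∸ j) k (b ∸ (s′ ℕ.+ d′) ∸ k)))
    ≡⟨ cong₂ (λ x y → (𝟙 (x ≤ᵇ a) ℤ.* 𝟙 (y ≤ᵇ b)) ℤ.*
                       Σ≤ (a ∸ x) (λ j → Σ≤ (b ∸ y) (λ k → H j (a ∸ x ∸ j) k (b ∸ y ∸ k))))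
             (split p) (split q) ⟩
  (𝟙 (p ℕ.* c ≤ᵇ a) ℤ.* 𝟙 (q ℕ.* c ≤ᵇ b)) ℤ.*
    (Σ≤ (a ∸ p ℕ.* c) λ j → Σ≤ (b ∸ q ℕ.* c) λ k → f i j k l ℤ.* g (n ∸ i) (a ∸ p ℕ.* c ∸ j) (b ∸ q ℕ.* c ∸ k) (c ∸ l)) ∎
  where
  open ≡.≡-Reasoning
  s d s′ d′ : ℕ
  s = p ℕ.* l
  d = p ℕ.* (c ∸ l)
  s′ = q ℕ.* l
  d′ = q ℕ.* (c ∸ l)
  H : ℕ → ℕ → ℕ → ℕ → ℤ
  H x y z w = f i x z l ℤ.* g (n ∸ i) y w (c ∸ l)
  split : ∀ r → r ℕ.* l ℕ.+ r ℕ.* (c ∸ l) ≡ r ℕ.* c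
  split r = trans (sym (ℕ.*-distribˡ-+ r l (c ∸ l))) (cong (r ℕ.*_) (ℕ.m+[n∸m]≡n l≤c))
  interleave : ∀ u u′ F v v′ G → ((u ℤ.* u′) ℤ.* F) ℤ.* ((v ℤ.* v′) ℤ.* G) ≡ u ℤ.* (v ℤ.* (u′ ℤ.* (v′ ℤ.* (F ℤ.* G))))
  interleave = ℤ-Solver.solve-∀
  factor : ∀ j k → sub p q f i j k l ℤ.* sub p q g (n ∸ i) (a ∸ j) (b ∸ k) (c ∸ l)
                 ≡ 𝟙 (s ≤ᵇ j) ℤ.* (𝟙 (d ≤ᵇ a ∸ j) ℤ.* (𝟙 (s′ ≤ᵇ k) ℤ.* (𝟙 (d′ ≤ᵇ b ∸ k) ℤ.*
                     H (j ∸ s) (a ∸ j ∸ d) (k ∸ s′) (b ∸ k ∸ d′))))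
  factor j k = trans (cong₂ ℤ._*_ (sub-at p q f i j k l) (sub-at p q g (n ∸ i) (a ∸ j) (b ∸ k) (c ∸ l)))
                     (interleave (𝟙 (s ≤ᵇ j)) (𝟙 (s′ ≤ᵇ k)) (f i (j ∸ s) (k ∸ s′) l)
                                 (𝟙 (d ≤ᵇ a ∸ j)) (𝟙 (d′ ≤ᵇ b ∸ k)) (g (n ∸ i) (a ∸ j ∸ d) (b ∸ k ∸ d′) (c ∸ l)))

sub-⊛ : ∀ p q f g → sub p q (f ⊛ g) ≈ₛ sub p q f ⊛ sub p q g
sub-⊛ p q f g = mk≈ at
  where
  at : ∀ n a b c → sub p q (f ⊛ g) n a b c ≡ (sub p q f ⊛ sub p q g) n a b c
  at n a b c = begin
    sub p q (f ⊛ g) n a b c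
      ≡⟨ sub-at p q (f ⊛ g) n a b c ⟩
    κ ℤ.* Σ⁴ n A B c (λ i j k l → f i j k l ℤ.* g (n ∸ i) (A ∸ j) (B ∸ k) (c ∸ l))
      ≡⟨ cong (κ ℤ.*_) (Σ⁴-reorder n A B c _) ⟩
    κ ℤ.* (Σ≤ n λ i → Σ≤ c λ l → Σ≤ A λ j → Σ≤ B λ k → f i j k l ℤ.* g (n ∸ i) (A ∸ j) (B ∸ k) (c ∸ l))
      ≡⟨ trans (Σ≤-*ˡ n κ _) (Σ≤-cong n (λ i → Σ≤-*ˡ c κ _)) ⟩
    (Σ≤ n λ i → Σ≤ c λ l → κ ℤ.* (Σ≤ A λ j → Σ≤ B λ k → f i j k l ℤ.* g (n ∸ i) (A ∸ j) (B ∸ k) (c ∸ l)))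
      ≡⟨ Σ≤-cong n (λ i → Σ≤-cong≤ c (λ l l≤c → sym (sub-⊛-slice p q f g n a b c i l l≤c))) ⟩
    (Σ≤ n λ i → Σ≤ c λ l → Σ≤ a λ j → Σ≤ b λ k → sub p q f i j k l ℤ.* sub p q g (n ∸ i) (a ∸ j) (b ∸ k) (c ∸ l))
      ≡⟨ Σ⁴-reorder n a b c _ ⟨
    (sub p q f ⊛ sub p q g) n a b c ∎
    where
    open ≡.≡-Reasoning
    A B : ℕ
    A = a ∸ p ℕ.* c
    B = b ∸ q ℕ.* c
    κ : ℤ
    κ = 𝟙 (p ℕ.* c ≤ᵇ a) ℤ.* 𝟙 (q ℕ.* c ≤ᵇ b)

sub-shift : ∀ p q f n a b c → sub p q f n (p ℕ.* c ℕ.+ a) (q ℕ.* c ℕ.+ b) c ≡ f n a b c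
sub-shift p q f n a b c = begin
  sub p q f n (p ℕ.* c ℕ.+ a) (q ℕ.* c ℕ.+ b) c
    ≡⟨ cong₂ (λ x y → if x ∧ y then f n (p ℕ.* c ℕ.+ a ∸ p ℕ.* c) (q ℕ.* c ℕ.+ b ∸ q ℕ.* c) c else 0ℤ)
             (≤ᵇ-true (ℕ.m≤m+n (p ℕ.* c) a)) (≤ᵇ-true (ℕ.m≤m+n (q ℕ.* c) b)) ⟩
  f n (p ℕ.* c ℕ.+ a ∸ p ℕ.* c) (q ℕ.* c ℕ.+ b ∸ q ℕ.* c) c
    ≡⟨ cong₂ (λ x y → f n x y c) (ℕ.m+n∸m≡n (p ℕ.* c) a) (ℕ.m+n∸m≡n (q ℕ.* c) b) ⟩
  f n a b c ∎
  where open ≡.≡-Reasoning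

sub-below : ∀ p q f n a b c → a < p ℕ.* c ⊎ b < q ℕ.* c → sub p q f n a b c ≡ 0ℤ
sub-below p q f n a b c (inj₁ a<pc) =
  cong (λ x → if x ∧ (q ℕ.* c ≤ᵇ b) then f n (a ∸ p ℕ.* c) (b ∸ q ℕ.* c) c else 0ℤ) (≤ᵇ-false a<pc)
sub-below p q f n a b c (inj₂ b<qc) =
  trans (cong (λ x → if (p ℕ.* c ≤ᵇ a) ∧ x then f n (a ∸ p ℕ.* c) (b ∸ q ℕ.* c) c else 0ℤ) (≤ᵇ-false b<qc))
        (cong (λ x → if x then f n (a ∸ p ℕ.* c) (b ∸ q ℕ.* c) c else 0ℤ) (∧-zeroʳ (p ℕ.* c ≤ᵇ a)))

below-or-shifted : ∀ p q c (P : ℕ → ℕ → Set) → (∀ a b → a < p ℕ.* c ⊎ b < q ℕ.* c → P a b) →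
            (∀ a b → P (p ℕ.* c ℕ.+ a) (q ℕ.* c ℕ.+ b)) → ∀ a b → P a b
below-or-shifted p q c P below shifted a b with p ℕ.* c ℕ.≤? a | q ℕ.* c ℕ.≤? b
... | no pc≰a | _      = below a b (inj₁ (ℕ.≰⇒> pc≰a))
... | yes _   | no qc≰b = below a b (inj₂ (ℕ.≰⇒> qc≰b))
... | yes pc≤a | yes qc≤b with _ , refl ← ℕ.m≤n⇒∃[o]m+o≡n pc≤a | _ , refl ← ℕ.m≤n⇒∃[o]m+o≡n qc≤b = shifted _ _

if-0-distrib-+ : ∀ b x y → (if b then x ℤ.+ y else 0ℤ) ≡ (if b then x else 0ℤ) ℤ.+ (if b then y else 0ℤ)
if-0-distrib-+ true  x y = refl
if-0-distrib-+ false x y = refl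

if-0-distrib-neg : ∀ b x → (if b then ℤ.- x else 0ℤ) ≡ ℤ.- (if b then x else 0ℤ)
if-0-distrib-neg true  x = refl
if-0-distrib-neg false x = refl

if-0-zero : ∀ b {x} → x ≡ 0ℤ → (if b then x else 0ℤ) ≡ 0ℤ
if-0-zero true  x≡0 = x≡0
if-0-zero false x≡0 = refl

sub-cong : ∀ p q {f g} → f ≈ₛ g → sub p q f ≈ₛ sub p q g
sub-cong p q f≈g = mk≈ λ n a b c →
  cong (λ x → if (p ℕ.* c ≤ᵇ a) ∧ (q ℕ.* c ≤ᵇ b) then x else 0ℤ) (coeff-≡ f≈g n (a ∸ p ℕ.* c) (b ∸ q ℕ.* c) c)

sub-⊕ : ∀ p q f g → sub p q (f ⊕ g) ≈ₛ sub p q f ⊕ sub p q g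
sub-⊕ p q f g = mk≈ λ n a b c → if-0-distrib-+ ((p ℕ.* c ≤ᵇ a) ∧ (q ℕ.* c ≤ᵇ b)) _ _

sub-⊖ : ∀ p q f → sub p q (⊖ f) ≈ₛ ⊖ sub p q f
sub-⊖ p q f = mk≈ λ n a b c → if-0-distrib-neg ((p ℕ.* c ≤ᵇ a) ∧ (q ℕ.* c ≤ᵇ b)) _

sub-u-free : ∀ p q f → (∀ n a b c → f n a b (suc c) ≡ 0ℤ) → sub p q f ≈ₛ f
sub-u-free p q f u-free = mk≈ at
  where
  at : ∀ n a b c → sub p q f n a b c ≡ f n a b c
  at n a b zero rewrite ℕ.*-zeroʳ p | ℕ.*-zeroʳ q = refl
  at n a b (suc c) = trans (if-0-zero ((p ℕ.* suc c ≤ᵇ a) ∧ (q ℕ.* suc c ≤ᵇ b)) (u-free _ _ _ c)) (sym (u-free n a b c))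

sub-Order≥ : ∀ p q {P f} → Order≥ xWeight P f → Order≥ xWeight P (sub p q f)
sub-Order≥ p q f≥P n a b c deg<P = if-0-zero ((p ℕ.* c ≤ᵇ a) ∧ (q ℕ.* c ≤ᵇ b)) (f≥P n _ _ c deg<P)

sub-sub : ∀ p q p′ q′ f → sub p q (sub p′ q′ f) ≈ₛ sub (p′ ℕ.+ p) (q′ ℕ.+ q) f
sub-sub p q p′ q′ f = mk≈ λ n a b c → below-or-shifted p q c (P n c) (outer-below n c) (outer-shifted n c) a b
  where
  P : ℕ → ℕ → ℕ → ℕ → Set
  P n c a b = sub p q (sub p′ q′ f) n a b c ≡ sub (p′ ℕ.+ p) (q′ ℕ.+ q) f n a b c
  swap-distrib : ∀ c r s → s ℕ.* c ℕ.+ r ℕ.* c ≡ (r ℕ.+ s) ℕ.* c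
  swap-distrib c r s = trans (ℕ.+-comm (s ℕ.* c) (r ℕ.* c)) (sym (ℕ.*-distribʳ-+ c r s))
  outer-below : ∀ n c a b → a < p ℕ.* c ⊎ b < q ℕ.* c → P n c a b
  outer-below n c a b below = trans (sub-below p q (sub p′ q′ f) n a b c below)
                                    (sym (sub-below (p′ ℕ.+ p) (q′ ℕ.+ q) f n a b c (widen below)))
    where
    widen : a < p ℕ.* c ⊎ b < q ℕ.* c → a < (p′ ℕ.+ p) ℕ.* c ⊎ b < (q′ ℕ.+ q) ℕ.* c
    widen (inj₁ a<pc) = inj₁ (ℕ.<-≤-trans a<pc (ℕ.*-monoˡ-≤ c (ℕ.m≤n+m p p′)))
    widen (inj₂ b<qc) = inj₂ (ℕ.<-≤-trans b<qc (ℕ.*-monoˡ-≤ c (ℕ.m≤n+m q q′)))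
  inner-below : ∀ n c a b → a < p′ ℕ.* c ⊎ b < q′ ℕ.* c → P n c (p ℕ.* c ℕ.+ a) (q ℕ.* c ℕ.+ b)
  inner-below n c a b below = trans (sub-shift p q (sub p′ q′ f) n a b c)
    (trans (sub-below p′ q′ f n a b c below) (sym (sub-below (p′ ℕ.+ p) (q′ ℕ.+ q) f n _ _ c (shift below))))
    where
    shift : a < p′ ℕ.* c ⊎ b < q′ ℕ.* c → p ℕ.* c ℕ.+ a < (p′ ℕ.+ p) ℕ.* c ⊎ q ℕ.* c ℕ.+ b < (q′ ℕ.+ q) ℕ.* c
    shift (inj₁ a<p′c) = inj₁ (≡.subst (p ℕ.* c ℕ.+ a <_) (swap-distrib c p′ p) (ℕ.+-monoʳ-< (p ℕ.* c) a<p′c))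
    shift (inj₂ b<q′c) = inj₂ (≡.subst (q ℕ.* c ℕ.+ b <_) (swap-distrib c q′ q) (ℕ.+-monoʳ-< (q ℕ.* c) b<q′c))
  inner-shifted : ∀ n c a b → P n c (p ℕ.* c ℕ.+ (p′ ℕ.* c ℕ.+ a)) (q ℕ.* c ℕ.+ (q′ ℕ.* c ℕ.+ b))
  inner-shifted n c a b = begin
    sub p q (sub p′ q′ f) n (p ℕ.* c ℕ.+ (p′ ℕ.* c ℕ.+ a)) (q ℕ.* c ℕ.+ (q′ ℕ.* c ℕ.+ b)) c
      ≡⟨ trans (sub-shift p q (sub p′ q′ f) n _ _ c) (sub-shift p′ q′ f n a b c) ⟩
    f n a b c
      ≡⟨ sub-shift (p′ ℕ.+ p) (q′ ℕ.+ q) f n a b c ⟨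
    sub (p′ ℕ.+ p) (q′ ℕ.+ q) f n ((p′ ℕ.+ p) ℕ.* c ℕ.+ a) ((q′ ℕ.+ q) ℕ.* c ℕ.+ b) c
      ≡⟨ cong₂ (λ x y → sub (p′ ℕ.+ p) (q′ ℕ.+ q) f n x y c) (regroup p′ p a) (regroup q′ q b) ⟩
    sub (p′ ℕ.+ p) (q′ ℕ.+ q) f n (p ℕ.* c ℕ.+ (p′ ℕ.* c ℕ.+ a)) (q ℕ.* c ℕ.+ (q′ ℕ.* c ℕ.+ b)) c ∎
    where
    open ≡.≡-Reasoning
    regroup : ∀ r s x → (r ℕ.+ s) ℕ.* c ℕ.+ x ≡ s ℕ.* c ℕ.+ (r ℕ.* c ℕ.+ x)
    regroup r s x = trans (cong (ℕ._+ x) (sym (swap-distrib c r s))) (ℕ.+-assoc (s ℕ.* c) (r ℕ.* c) x)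
  outer-shifted : ∀ n c a b → P n c (p ℕ.* c ℕ.+ a) (q ℕ.* c ℕ.+ b)
  outer-shifted n c = below-or-shifted p′ q′ c (λ a b → P n c (p ℕ.* c ℕ.+ a) (q ℕ.* c ℕ.+ b))
                                       (inner-below n c) (inner-shifted n c)

sub-mono : ∀ p q e₁ e₂ e₃ e₄ → sub p q (mono e₁ e₂ e₃ e₄) ≈ₛ mono e₁ (e₂ ℕ.+ p ℕ.* e₄) (e₃ ℕ.+ q ℕ.* e₄) e₄
sub-mono p q e₁ e₂ e₃ e₄ = mk≈ λ n a b c → below-or-shifted p q c (P n c) (below n c) (shifted n c) a b
  where
  P : ℕ → ℕ → ℕ → ℕ → Set
  P n c a b = sub p q (mono e₁ e₂ e₃ e₄) n a b c ≡ mono e₁ (e₂ ℕ.+ p ℕ.* e₄) (e₃ ℕ.+ q ℕ.* e₄) e₄ n a b c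
  below : ∀ n c a b → a < p ℕ.* c ⊎ b < q ℕ.* c → P n c a b
  below n c a b a<pc⊎b<qc = trans (sub-below p q (mono e₁ e₂ e₃ e₄) n a b c a<pc⊎b<qc)
                                    (sym (mono-off e₁ (e₂ ℕ.+ p ℕ.* e₄) (e₃ ℕ.+ q ℕ.* e₄) e₄ n a b c (off a<pc⊎b<qc)))
    where
    off : a < p ℕ.* c ⊎ b < q ℕ.* c → ¬ (n ≡ e₁ × a ≡ e₂ ℕ.+ p ℕ.* e₄ × b ≡ e₃ ℕ.+ q ℕ.* e₄ × c ≡ e₄)
    off (inj₁ a<pc) (_ , refl , _ , refl) = ℕ.<⇒≱ a<pc (ℕ.m≤n+m (p ℕ.* c) e₂)
    off (inj₂ b<qc) (_ , _ , refl , refl) = ℕ.<⇒≱ b<qc (ℕ.m≤n+m (q ℕ.* c) e₃)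
  shifted : ∀ n c a b → P n c (p ℕ.* c ℕ.+ a) (q ℕ.* c ℕ.+ b)
  shifted n c a b with c ℕ.≟ e₄
  ... | yes refl = trans (sub-shift p q (mono e₁ e₂ e₃ c) n a b c)
                         (cong 𝟙 (cong₂ (λ x y → (n ≡ᵇ e₁) ∧ x ∧ y ∧ (c ≡ᵇ c))
                                        (sym (≡ᵇ-+-cancel (p ℕ.* c) a e₂)) (sym (≡ᵇ-+-cancel (q ℕ.* c) b e₃))))
  ... | no c≢e₄  = trans (sub-shift p q (mono e₁ e₂ e₃ e₄) n a b c)
                         (trans (mono-off e₁ e₂ e₃ e₄ n a b c (λ (_ , _ , _ , c≡) → c≢e₄ c≡))
                                (sym (mono-off e₁ (e₂ ℕ.+ p ℕ.* e₄) (e₃ ℕ.+ q ℕ.* e₄) e₄ n (p ℕ.* c ℕ.+ a) (q ℕ.* c ℕ.+ b) c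
                                               (λ (_ , _ , _ , c≡) → c≢e₄ c≡))))

sub-homo-* : ∀ p q f g → sub p q (f * g) ≈ sub p q f * sub p q g
sub-homo-* p q f g = ≈-trans (sub-cong p q (≈-sym (⊛≈*ₛ f g))) (≈-trans (sub-⊛ p q f g) (⊛≈*ₛ _ _))

sub-homo-+ : ∀ p q f g → sub p q (f + g) ≈ sub p q f + sub p q g
sub-homo-+ p q f g = ≈-trans (sub-cong p q (≈-sym (⊕≈+ₛ f g))) (≈-trans (sub-⊕ p q f g) (⊕≈+ₛ _ _))

sub-homo-− : ∀ p q f g → sub p q (f - g) ≈ sub p q f - sub p q g
sub-homo-− p q f g = ≈-trans (sub-homo-+ p q f (- g)) (+-cong ≈-refl
  (≈-trans (sub-cong p q (≈-sym (⊖≈-ₛ g))) (≈-trans (sub-⊖ p q g) (⊖≈-ₛ _))))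

sub-mono-* : ∀ p q e₁ e₂ e₃ e₄ f →
             sub p q (mono e₁ e₂ e₃ e₄ * f) ≈ mono e₁ (e₂ ℕ.+ p ℕ.* e₄) (e₃ ℕ.+ q ℕ.* e₄) e₄ * sub p q f
sub-mono-* p q e₁ e₂ e₃ e₄ f = ≈-trans (sub-homo-* p q _ f) (*-cong (sub-mono p q e₁ e₂ e₃ e₄) ≈-refl)

-- Catalan words and the functional equations

sumOver : {A : Set} → (A → ℤ) → List A → ℤ
sumOver f []       = 0ℤ
sumOver f (x ∷ xs) = f x ℤ.+ sumOver f xs

module _ {A : Set} where

  count≡sumOver : ∀ (p : A → Bool) xs → + count p xs ≡ sumOver (λ x → 𝟙 (p x)) xs
  count≡sumOver p []       = refl
  count≡sumOver p (x ∷ xs) with p x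
  ... | true  = cong (ℤ._+_ 1ℤ) (count≡sumOver p xs)
  ... | false = cong (ℤ._+_ 0ℤ) (count≡sumOver p xs)

  sumOver-++ : ∀ (f : A → ℤ) xs ys → sumOver f (xs ++ ys) ≡ sumOver f xs ℤ.+ sumOver f ys
  sumOver-++ f []       ys = sym (ℤ.+-identityˡ _)
  sumOver-++ f (x ∷ xs) ys = trans (cong (ℤ._+_ (f x)) (sumOver-++ f xs ys)) (sym (ℤ.+-assoc (f x) _ _))

  sumOver-cong : ∀ {f g : A → ℤ} {xs} → All (λ x → f x ≡ g x) xs → sumOver f xs ≡ sumOver g xs
  sumOver-cong []             = refl
  sumOver-cong (fx≡gx ∷ f≡g) = cong₂ ℤ._+_ fx≡gx (sumOver-cong f≡g)

  sumOver-zero : ∀ {f : A → ℤ} {xs} → All (λ x → f x ≡ 0ℤ) xs → sumOver f xs ≡ 0ℤ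
  sumOver-zero []             = refl
  sumOver-zero (fx≡0 ∷ f≡0) = cong₂ ℤ._+_ fx≡0 (sumOver-zero f≡0)

  sumOver-+ : ∀ (f g : A → ℤ) xs → sumOver (λ x → f x ℤ.+ g x) xs ≡ sumOver f xs ℤ.+ sumOver g xs
  sumOver-+ f g []       = refl
  sumOver-+ f g (x ∷ xs) = trans (cong (ℤ._+_ (f x ℤ.+ g x)) (sumOver-+ f g xs)) (interchange (f x) (g x) _ _)
    where
    interchange : ∀ a b c d → a ℤ.+ b ℤ.+ (c ℤ.+ d) ≡ a ℤ.+ c ℤ.+ (b ℤ.+ d)
    interchange = ℤ-Solver.solve-∀

  sumOver-neg : ∀ (f : A → ℤ) xs → sumOver (λ x → ℤ.- f x) xs ≡ ℤ.- sumOver f xs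
  sumOver-neg f []       = refl
  sumOver-neg f (x ∷ xs) = trans (cong (ℤ._+_ (ℤ.- f x)) (sumOver-neg f xs)) (sym (ℤ.neg-distrib-+ (f x) _))

  sumOver-*ˡ : ∀ k (f : A → ℤ) xs → k ℤ.* sumOver f xs ≡ sumOver (λ x → k ℤ.* f x) xs
  sumOver-*ˡ k f []       = ℤ.*-zeroʳ k
  sumOver-*ˡ k f (x ∷ xs) = trans (ℤ.*-distribˡ-+ k (f x) _) (cong (ℤ._+_ (k ℤ.* f x)) (sumOver-*ˡ k f xs))

sumOver-upTo : ∀ k (g : ℕ → ℤ) → sumOver g (upTo (suc k)) ≡ Σ≤ k g
sumOver-upTo zero    g = ℤ.+-identityʳ (g 0)
sumOver-upTo (suc k) g = begin
  sumOver g (upTo (suc (suc k)))                  ≡⟨ cong (sumOver g) (List.upTo-∷ʳ (suc k)) ⟨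
  sumOver g (upTo (suc k) ∷ʳ suc k)               ≡⟨ sumOver-++ g (upTo (suc k)) (suc k ∷ []) ⟩
  sumOver g (upTo (suc k)) ℤ.+ (g (suc k) ℤ.+ 0ℤ) ≡⟨ cong₂ ℤ._+_ (sumOver-upTo k g) (ℤ.+-identityʳ (g (suc k))) ⟩
  Σ≤ k g ℤ.+ g (suc k)                            ∎
  where open ≡.≡-Reasoning

words-length : ∀ n k → All (λ w → length w ≡ n) (words n k)
words-length zero    k = refl ∷ []
words-length (suc n) k =
  All.concat⁺ (All.map⁺ (All.applyUpTo⁺₂ _ k (λ v → All.map⁺ (All.map (cong suc) (words-length n k)))))

sumOver-words-∷ : ∀ n k (f : List ℕ → ℤ) →
                  sumOver f (words (suc n) k) ≡ sumOver (λ v → sumOver (λ w → f (v ∷ w)) (words n k)) (upTo k)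
sumOver-words-∷ n k f = go (upTo k)
  where
  go : ∀ vs → sumOver f (concatMap (λ v → map (v ∷_) (words n k)) vs) ≡ sumOver (λ v → sumOver (λ w → f (v ∷ w)) (words n k)) vs
  go []       = refl
  go (v ∷ vs) = trans (sumOver-++ f (map (v ∷_) (words n k)) _) (cong₂ ℤ._+_ (sumOver-map (words n k)) (go vs))
    where
    sumOver-map : ∀ ws → sumOver f (map (v ∷_) ws) ≡ sumOver (λ w → f (v ∷ w)) ws
    sumOver-map []       = refl
    sumOver-map (w ∷ ws) = cong (ℤ._+_ (f (v ∷ w))) (sumOver-map ws)

sumOver-words-∷ʳ : ∀ n k (f : List ℕ → ℤ) →
                   sumOver f (words (suc n) k) ≡ sumOver (λ w → sumOver (λ t → f (w ∷ʳ t)) (upTo k)) (words n k)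
sumOver-words-∷ʳ zero    k f = trans (sumOver-words-∷ zero k f) (go (upTo k))
  where
  go : ∀ vs → sumOver (λ v → f (v ∷ []) ℤ.+ 0ℤ) vs ≡ sumOver (λ t → f (t ∷ [])) vs ℤ.+ 0ℤ
  go vs = trans (sumOver-cong (All.universal (λ v → ℤ.+-identityʳ (f (v ∷ []))) vs)) (sym (ℤ.+-identityʳ _))
sumOver-words-∷ʳ (suc n) k f = begin
  sumOver f (words (suc (suc n)) k)
    ≡⟨ sumOver-words-∷ (suc n) k f ⟩
  sumOver (λ v → sumOver (λ w → f (v ∷ w)) (words (suc n) k)) (upTo k)
    ≡⟨ sumOver-cong (All.universal (λ v → sumOver-words-∷ʳ n k (λ w → f (v ∷ w))) (upTo k)) ⟩
  sumOver (λ v → sumOver (λ w → sumOver (λ t → f (v ∷ w ∷ʳ t)) (upTo k)) (words n k)) (upTo k)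
    ≡⟨ sumOver-words-∷ n k (λ w → sumOver (λ t → f (w ∷ʳ t)) (upTo k)) ⟨
  sumOver (λ w → sumOver (λ t → f (w ∷ʳ t)) (upTo k)) (words (suc n) k) ∎
  where open ≡.≡-Reasoning

sumOver-words-shrink : ∀ n k (f : List ℕ → ℤ) → (∀ w → length w ≡ n → Any (k ≤_) w → f w ≡ 0ℤ) →
                       sumOver f (words n (suc k)) ≡ sumOver f (words n k)
sumOver-words-shrink zero    k f _         = refl
sumOver-words-shrink (suc n) k f f≡0 = begin
  sumOver f (words (suc n) (suc k))
    ≡⟨ sumOver-words-∷ n (suc k) f ⟩
  sumOver (F (suc k)) (upTo (suc k))
    ≡⟨ cong (sumOver (F (suc k))) (List.upTo-∷ʳ k) ⟨
  sumOver (F (suc k)) (upTo k ∷ʳ k)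
    ≡⟨ sumOver-++ (F (suc k)) (upTo k) (k ∷ []) ⟩
  sumOver (F (suc k)) (upTo k) ℤ.+ (F (suc k) k ℤ.+ 0ℤ)
    ≡⟨ cong₂ ℤ._+_ (sumOver-cong (All.universal smaller-letters (upTo k))) (cong (ℤ._+ 0ℤ) largest-letter) ⟩
  sumOver (F k) (upTo k) ℤ.+ 0ℤ
    ≡⟨ ℤ.+-identityʳ _ ⟩
  sumOver (F k) (upTo k)
    ≡⟨ sumOver-words-∷ n k f ⟨
  sumOver f (words (suc n) k) ∎
  where
  open ≡.≡-Reasoning
  F : ℕ → ℕ → ℤ
  F k′ v = sumOver (λ w → f (v ∷ w)) (words n k′)
  smaller-letters : ∀ v → F (suc k) v ≡ F k v
  smaller-letters v = sumOver-words-shrink n k (λ w → f (v ∷ w)) (λ w |w| k≤ → f≡0 (v ∷ w) (cong suc |w|) (there k≤))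
  largest-letter : F (suc k) k ≡ 0ℤ
  largest-letter = sumOver-zero (All.map (λ |w| → f≡0 (k ∷ _) (cong suc |w|) (here ℕ.≤-refl)) (words-length n (suc k)))

length-∷ʳ : ∀ (w : List ℕ) t → length (w ∷ʳ t) ≡ suc (length w)
length-∷ʳ w t = trans (List.length-++ w) (ℕ.+-comm (length w) 1)

last-∷ʳ : ∀ w t → last (w ∷ʳ t) ≡ suc t
last-∷ʳ []           t = refl
last-∷ʳ (x ∷ [])     t = refl
last-∷ʳ (x ∷ y ∷ ys) t = last-∷ʳ (y ∷ ys) t

cellsIf : Bool → ℕ → ℕ
cellsIf true  t = suc t
cellsIf false t = 0

mutual
  ver-∷ʳ : ∀ w t → ver (w ∷ʳ t) ≡ ver w ℕ.+ cellsIf (evenᵇ (length w)) t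
  ver-∷ʳ []      t = ℕ.+-identityʳ (suc t)
  ver-∷ʳ (x ∷ w) t = trans (cong (suc x ℕ.+_) (white-∷ʳ w t)) (sym (ℕ.+-assoc (suc x) (white w) _))

  white-∷ʳ : ∀ w t → white (w ∷ʳ t) ≡ white w ℕ.+ cellsIf (not (evenᵇ (length w))) t
  white-∷ʳ []      t = refl
  white-∷ʳ (x ∷ w) t = trans (ver-∷ʳ w t) (cong (λ e → ver w ℕ.+ cellsIf e t) (sym (not-involutive (evenᵇ (length w)))))

lastFrom : ℕ → List ℕ → ℕ
lastFrom p []       = p
lastFrom p (x ∷ xs) = lastFrom x xs

last-∷ : ∀ x xs → last (x ∷ xs) ≡ suc (lastFrom x xs)
last-∷ x []       = refl
last-∷ x (y ∷ ys) = last-∷ y ys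

stepsOK-∷ʳ : ∀ p xs t → stepsOK p (xs ∷ʳ t) ≡ stepsOK p xs ∧ (t ≤ᵇ suc (lastFrom p xs))
stepsOK-∷ʳ p []       t = ∧-identityʳ (t ≤ᵇ suc p)
stepsOK-∷ʳ p (y ∷ ys) t = trans (cong ((y ≤ᵇ suc p) ∧_) (stepsOK-∷ʳ y ys t)) (sym (∧-assoc (y ≤ᵇ suc p) (stepsOK y ys) _))

isCatalan-∷ʳ : ∀ x xs t → isCatalan ((x ∷ xs) ∷ʳ t) ≡ isCatalan (x ∷ xs) ∧ (t ≤ᵇ last (x ∷ xs))
isCatalan-∷ʳ x xs t = begin
  (x ≡ᵇ 0) ∧ stepsOK x (xs ∷ʳ t)                          ≡⟨ cong ((x ≡ᵇ 0) ∧_) (stepsOK-∷ʳ x xs t) ⟩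
  (x ≡ᵇ 0) ∧ (stepsOK x xs ∧ (t ≤ᵇ suc (lastFrom x xs)))  ≡⟨ ∧-assoc (x ≡ᵇ 0) (stepsOK x xs) _ ⟨
  isCatalan (x ∷ xs) ∧ (t ≤ᵇ suc (lastFrom x xs))         ≡⟨ cong (λ l → isCatalan (x ∷ xs) ∧ (t ≤ᵇ l)) (last-∷ x xs) ⟨
  isCatalan (x ∷ xs) ∧ (t ≤ᵇ last (x ∷ xs))               ∎
  where open ≡.≡-Reasoning

∧-true⇒ : ∀ {b b′} → (b ∧ b′) ≡ true → b ≡ true × b′ ≡ true
∧-true⇒ {true} b′≡true = refl , b′≡true

≤ᵇ-true⇒≤ : ∀ {m n} → (m ≤ᵇ n) ≡ true → m ≤ n
≤ᵇ-true⇒≤ {m} {n} m≤ᵇn = ℕ.≤ᵇ⇒≤ m n (Equivalence.from T-≡ m≤ᵇn)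

stepsOK-bound : ∀ p xs → stepsOK p xs ≡ true → All (_≤ p ℕ.+ length xs) xs × lastFrom p xs ≤ p ℕ.+ length xs
stepsOK-bound p []       _  = [] , ℕ.m≤m+n p 0
stepsOK-bound p (y ∷ ys) ok with ∧-true⇒ {y ≤ᵇ suc p} ok
... | y≤ᵇ1+p , ok′ with stepsOK-bound y ys ok′
...   | ys≤ , last≤ = ℕ.≤-trans (ℕ.m≤m+n y (length ys)) widen ∷ All.map (λ z≤ → ℕ.≤-trans z≤ widen) ys≤
                    , ℕ.≤-trans last≤ widen
  where
  widen : y ℕ.+ length ys ≤ p ℕ.+ suc (length ys)
  widen = ℕ.≤-trans (ℕ.+-monoˡ-≤ (length ys) (≤ᵇ-true⇒≤ y≤ᵇ1+p)) (ℕ.≤-reflexive (sym (ℕ.+-suc p (length ys))))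

catalan-letters< : ∀ w → isCatalan w ≡ true → All (_< length w) w
catalan-letters< (x ∷ xs) cat with ∧-true⇒ {x ≡ᵇ 0} cat
... | x≡ᵇ0 , ok rewrite ℕ.≡ᵇ⇒≡ x 0 (Equivalence.from T-≡ x≡ᵇ0) =
  s≤s z≤n ∷ All.map s≤s (proj₁ (stepsOK-bound 0 xs ok))

catalan-last≤ : ∀ w → isCatalan w ≡ true → last w ≤ length w
catalan-last≤ (x ∷ xs) cat with ∧-true⇒ {x ≡ᵇ 0} cat
... | x≡ᵇ0 , ok rewrite ℕ.≡ᵇ⇒≡ x 0 (Equivalence.from T-≡ x≡ᵇ0) =
  ℕ.≤-trans (ℕ.≤-reflexive (last-∷ 0 xs)) (s≤s (proj₂ (stepsOK-bound 0 xs ok)))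

-- Length-n words over the alphabet {0, …, n} of catalanWords (suc n): appending a letter gives all of those.
Words : ℕ → List (List ℕ)
Words n = words n (suc n)

count-catalanWords : ∀ n (p : List ℕ → Bool) → (∀ w → p w ≡ true → isCatalan w ≡ true) →
                     + count p (catalanWords n) ≡ sumOver (λ w → 𝟙 (p w)) (Words n)
count-catalanWords n p p⇒cat =
  trans (count≡sumOver p (words n n)) (sym (sumOver-words-shrink n n (λ w → 𝟙 (p w)) not-catalan))
  where
  not-catalan : ∀ w → length w ≡ n → Any (n ≤_) w → 𝟙 (p w) ≡ 0ℤ
  not-catalan w refl big with p w in pw
  ... | false = refl
  ... | true  = ⊥-elim (All.All¬⇒¬Any (All.map ℕ.<⇒≱ (catalan-letters< w (p⇒cat w pw))) big)

count-catalanWords-∷ʳ : ∀ n (p : List ℕ → Bool) →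
                        + count p (catalanWords (suc n)) ≡ sumOver (λ w → Σ≤ n (λ t → 𝟙 (p (w ∷ʳ t)))) (Words n)
count-catalanWords-∷ʳ n p = begin
  + count p (words (suc n) (suc n))
    ≡⟨ count≡sumOver p (words (suc n) (suc n)) ⟩
  sumOver (λ w → 𝟙 (p w)) (words (suc n) (suc n))
    ≡⟨ sumOver-words-∷ʳ n (suc n) (λ w → 𝟙 (p w)) ⟩
  sumOver (λ w → sumOver (λ t → 𝟙 (p (w ∷ʳ t))) (upTo (suc n))) (Words n)
    ≡⟨ sumOver-cong (All.universal (λ w → sumOver-upTo n (λ t → 𝟙 (p (w ∷ʳ t)))) (Words n)) ⟩
  sumOver (λ w → Σ≤ n (λ t → 𝟙 (p (w ∷ʳ t)))) (Words n) ∎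
  where open ≡.≡-Reasoning

-- window W L x c = 1 iff a column of height c can follow a last column of L cells (1 ≤ c ≤ L + 1) and
-- takes the statistic receiving it from W to x (W + c = x). With t the variable of that statistic,
-- window W L = tᵂ (tu + ⋯ + (tu)ᴸ⁺¹), shift multiplies by tu, initial W = tᵂ and final W L = tᵂ (tu)ᴸ;
-- window-recurrence is the geometric-sum identity (1 − tu) · window W L = tu · tᵂ − (tu)² · tᵂ (tu)ᴸ.
shift : (ℕ → ℕ → ℤ) → ℕ → ℕ → ℤ
shift g x       zero    = 0ℤ
shift g zero    (suc c) = 0ℤ
shift g (suc x) (suc c) = g x c

window : ℕ → ℕ → ℕ → ℕ → ℤ
window W L x zero    = 0ℤ
window W L x (suc t) = 𝟙 ((t ≤ᵇ L) ∧ (W ℕ.+ suc t ≡ᵇ x))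

initial : ℕ → ℕ → ℕ → ℤ
initial W x zero    = 𝟙 (W ≡ᵇ x)
initial W x (suc c) = 0ℤ

final : ℕ → ℕ → ℕ → ℕ → ℤ
final W L x c = 𝟙 (c ≤ᵇ x) ℤ.* 𝟙 ((W ≡ᵇ x ∸ c) ∧ (L ≡ᵇ c))

private
  +suc-≡ᵇ-suc : ∀ W t x → (W ℕ.+ suc t ≡ᵇ suc x) ≡ (W ℕ.+ t ≡ᵇ x)
  +suc-≡ᵇ-suc W t x = cong (_≡ᵇ suc x) (ℕ.+-suc W t)

  no-column : ∀ X W t → 𝟙 (X ∧ (W ℕ.+ suc t ≡ᵇ zero)) ≡ 0ℤ
  no-column X W t = trans (cong (λ b → 𝟙 (X ∧ b)) (cong (_≡ᵇ zero) (ℕ.+-suc W t))) (cong 𝟙 (∧-zeroʳ X))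

  +-≡ᵇ : ∀ W t x → (W ℕ.+ t ≡ᵇ x) ≡ (t ≤ᵇ x) ∧ (W ≡ᵇ x ∸ t)
  +-≡ᵇ W t x = does-⇔ (mk⇔ (λ { refl → ℕ.m≤n+m t W , sym (ℕ.m+n∸n≡m W t) })
                            (λ (t≤x , W≡) → trans (cong (ℕ._+ t) W≡) (ℕ.m∸n+n≡m t≤x)))
                      (W ℕ.+ t ℕ.≟ x) (t ℕ.≤? x ×-dec W ℕ.≟ x ∸ t)

  last-column-split : ∀ t L E → 𝟙 ((t ≤ᵇ L) ∧ E) ≡ 𝟙 ((suc t ≤ᵇ L) ∧ E) ℤ.+ 𝟙 (E ∧ (L ≡ᵇ t))
  last-column-split t L E with ℕ.<-cmp L t
  ... | tri< L<t L≢t _ rewrite ≤ᵇ-false L<t | ≤ᵇ-false (ℕ.m<n⇒m<1+n L<t) | dec-false (L ℕ.≟ t) L≢t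
    = sym (trans (ℤ.+-identityˡ _) (cong 𝟙 (∧-zeroʳ E)))
  ... | tri≈ _ refl _  rewrite ≤ᵇ-true (ℕ.≤-refl {t}) | ≤ᵇ-false (ℕ.n<1+n t) | dec-true (t ℕ.≟ t) refl
    = sym (trans (ℤ.+-identityˡ _) (cong 𝟙 (∧-identityʳ E)))
  ... | tri> _ L≢t t<L rewrite ≤ᵇ-true (ℕ.<⇒≤ t<L) | ≤ᵇ-true t<L | dec-false (L ℕ.≟ t) L≢t
    = trans (sym (ℤ.+-identityʳ (𝟙 E))) (cong (ℤ._+_ (𝟙 E)) (sym (cong 𝟙 (∧-zeroʳ E))))

window-recurrence : ∀ W L x c →
  window W L x c ≡ shift (window W L) x c ℤ.+ shift (initial W) x c ℤ.- shift (shift (final W L)) x c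
window-recurrence W L x             zero          = refl
window-recurrence W L zero          (suc t)       = no-column (t ≤ᵇ L) W t
window-recurrence W L (suc x)       (suc zero)    = begin
  𝟙 (W ℕ.+ 1 ≡ᵇ suc x)       ≡⟨ cong 𝟙 (trans (+suc-≡ᵇ-suc W 0 x) (cong (_≡ᵇ x) (ℕ.+-identityʳ W))) ⟩
  𝟙 (W ≡ᵇ x)                 ≡⟨ only-initial (𝟙 (W ≡ᵇ x)) ⟩
  0ℤ ℤ.+ 𝟙 (W ≡ᵇ x) ℤ.- 0ℤ   ∎
  where
  open ≡.≡-Reasoning
  only-initial : ∀ i → i ≡ 0ℤ ℤ.+ i ℤ.- 0ℤ
  only-initial = ℤ-Solver.solve-∀
window-recurrence W L (suc zero)    (suc (suc t)) =
  trans (trans (cong (λ b → 𝟙 ((suc t ≤ᵇ L) ∧ b)) (+suc-≡ᵇ-suc W (suc t) 0)) (no-column (suc t ≤ᵇ L) W t))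
        (sym (cong (λ i → i ℤ.+ 0ℤ ℤ.- 0ℤ) (no-column (t ≤ᵇ L) W t)))
window-recurrence W L (suc (suc x)) (suc (suc t)) = begin
  𝟙 ((suc t ≤ᵇ L) ∧ (W ℕ.+ suc (suc t) ≡ᵇ suc (suc x)))
    ≡⟨ cong (λ b → 𝟙 ((suc t ≤ᵇ L) ∧ b)) (trans (+suc-≡ᵇ-suc W (suc t) (suc x)) (+suc-≡ᵇ-suc W t x)) ⟩
  𝟙 ((suc t ≤ᵇ L) ∧ E)
    ≡⟨ rearrange (𝟙 ((suc t ≤ᵇ L) ∧ E)) (𝟙 (E ∧ (L ≡ᵇ t))) ⟩
  𝟙 ((suc t ≤ᵇ L) ∧ E) ℤ.+ 𝟙 (E ∧ (L ≡ᵇ t)) ℤ.+ 0ℤ ℤ.- 𝟙 (E ∧ (L ≡ᵇ t))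
    ≡⟨ cong₂ (λ i j → i ℤ.+ 0ℤ ℤ.- j) (sym (last-column-split t L E)) stop ⟩
  𝟙 ((t ≤ᵇ L) ∧ E) ℤ.+ 0ℤ ℤ.- final W L x t
    ≡⟨ cong (λ b → 𝟙 ((t ≤ᵇ L) ∧ b) ℤ.+ 0ℤ ℤ.- final W L x t) (+suc-≡ᵇ-suc W t x) ⟨
  𝟙 ((t ≤ᵇ L) ∧ (W ℕ.+ suc t ≡ᵇ suc x)) ℤ.+ 0ℤ ℤ.- final W L x t ∎
  where
  open ≡.≡-Reasoning
  E : Bool
  E = W ℕ.+ t ≡ᵇ x
  rearrange : ∀ i j → i ≡ i ℤ.+ j ℤ.+ 0ℤ ℤ.- j
  rearrange = ℤ-Solver.solve-∀
  stop : 𝟙 (E ∧ (L ≡ᵇ t)) ≡ final W L x t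
  stop = begin
    𝟙 (E ∧ (L ≡ᵇ t))                                   ≡⟨ cong (λ b → 𝟙 (b ∧ (L ≡ᵇ t))) (+-≡ᵇ W t x) ⟩
    𝟙 (((t ≤ᵇ x) ∧ (W ≡ᵇ x ∸ t)) ∧ (L ≡ᵇ t))          ≡⟨ cong 𝟙 (∧-assoc (t ≤ᵇ x) _ _) ⟩
    𝟙 ((t ≤ᵇ x) ∧ (W ≡ᵇ x ∸ t) ∧ (L ≡ᵇ t))            ≡⟨ 𝟙-∧ (t ≤ᵇ x) _ ⟩
    final W L x t                                      ∎

-- κᴱ a w: w is a Catalan word of odd length with ver w = a. Appending a column to it yields the even
-- words counted by EV _ a; the new column has even index, so it changes white and not ver (dually for κᴼ).
κᴱ : ℕ → List ℕ → ℤ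
κᴱ a w = 𝟙 (isCatalan w ∧ not (evenᵇ (length w)) ∧ (ver w ≡ᵇ a))

κᴼ : ℕ → List ℕ → ℤ
κᴼ b w = 𝟙 (isCatalan w ∧ evenᵇ (length w) ∧ (white w ≡ᵇ b))

EV-pred OD-pred : ℕ → ℕ → ℕ → List ℕ → Bool
EV-pred a b c w = isCatalan w ∧ evenᵇ (lth w) ∧ (ver w ≡ᵇ a) ∧ (white w ≡ᵇ b) ∧ (last w ≡ᵇ c)
OD-pred a b c w = isCatalan w ∧ not (evenᵇ (lth w)) ∧ (ver w ≡ᵇ a) ∧ (white w ≡ᵇ b) ∧ (last w ≡ᵇ c)

private
  𝟙-∧⁵ : ∀ C T A B S → 𝟙 ((C ∧ T) ∧ A ∧ B ∧ S) ≡ (𝟙 C ℤ.* 𝟙 T) ℤ.* (𝟙 A ℤ.* (𝟙 B ℤ.* 𝟙 S))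
  𝟙-∧⁵ C T A B S = begin
    𝟙 ((C ∧ T) ∧ A ∧ B ∧ S)                            ≡⟨ 𝟙-∧ (C ∧ T) _ ⟩
    𝟙 (C ∧ T) ℤ.* 𝟙 (A ∧ B ∧ S)                        ≡⟨ cong₂ ℤ._*_ (𝟙-∧ C T) (trans (𝟙-∧ A _) (cong (𝟙 A ℤ.*_) (𝟙-∧ B S))) ⟩
    (𝟙 C ℤ.* 𝟙 T) ℤ.* (𝟙 A ℤ.* (𝟙 B ℤ.* 𝟙 S))         ∎
    where open ≡.≡-Reasoning

  𝟙-regroup : ∀ C E X Y → 𝟙 (C ∧ E ∧ X ∧ Y) ≡ 𝟙 (C ∧ E ∧ X) ℤ.* 𝟙 Y
  𝟙-regroup false E     X     Y     = refl
  𝟙-regroup true  false X     Y     = refl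
  𝟙-regroup true  true  false Y     = refl
  𝟙-regroup true  true  true  false = refl
  𝟙-regroup true  true  true  true  = refl

  𝟙-regroup′ : ∀ C E X Y → 𝟙 (C ∧ E ∧ X ∧ Y) ≡ 𝟙 (C ∧ E ∧ Y) ℤ.* 𝟙 X
  𝟙-regroup′ false E     X     Y     = refl
  𝟙-regroup′ true  false X     Y     = refl
  𝟙-regroup′ true  true  false false = refl
  𝟙-regroup′ true  true  false true  = refl
  𝟙-regroup′ true  true  true  false = refl
  𝟙-regroup′ true  true  true  true  = refl

  𝟙-regroup″ : ∀ C E X Y Z → 𝟙 (C ∧ E ∧ X ∧ Y ∧ Z) ≡ 𝟙 (C ∧ E ∧ Y) ℤ.* 𝟙 (X ∧ Z)
  𝟙-regroup″ false E     X     Y     Z     = refl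
  𝟙-regroup″ true  false X     Y     Z     = refl
  𝟙-regroup″ true  true  false false Z     = refl
  𝟙-regroup″ true  true  false true  Z     = refl
  𝟙-regroup″ true  true  true  false Z     = refl
  𝟙-regroup″ true  true  true  true  false = refl
  𝟙-regroup″ true  true  true  true  true  = refl

Σ≤-window-pick : ∀ n C K W L x c → (C ≡ true → L ≤ n) →
  Σ≤ n (λ t → 𝟙 (suc t ≡ᵇ c) ℤ.* (𝟙 (C ∧ K) ℤ.* 𝟙 ((t ≤ᵇ L) ∧ (W ℕ.+ suc t ≡ᵇ x)))) ≡ 𝟙 (C ∧ K) ℤ.* window W L x c
Σ≤-window-pick n C K W L x zero    _   = trans (Σ≤-zero n (λ t _ → refl)) (sym (ℤ.*-zeroʳ (𝟙 (C ∧ K))))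
Σ≤-window-pick n C K W L x (suc c) C⇒L≤n with c ℕ.≤? n
... | yes c≤n = trans (Σ≤-single n c c≤n (λ t _ t≢c → 𝟙-false _ (dec-false (t ℕ.≟ c) t≢c)))
                      (𝟙-true _ (dec-true (c ℕ.≟ c) refl))
... | no  c≰n = trans (Σ≤-zero n (λ t t≤n → 𝟙-false _ (dec-false (t ℕ.≟ c) (λ { refl → c≰n t≤n }))))
                      (sym (beyond C C⇒L≤n))
  where
  beyond : ∀ C → (C ≡ true → L ≤ n) → 𝟙 (C ∧ K) ℤ.* 𝟙 ((c ≤ᵇ L) ∧ (W ℕ.+ suc c ≡ᵇ x)) ≡ 0ℤ
  beyond false _       = refl
  beyond true  C⇒L≤n = x≡0⇒y*x≡0 (𝟙 K) (cong 𝟙 (cong (_∧ (W ℕ.+ suc c ≡ᵇ x)) (≤ᵇ-false (ℕ.≤-<-trans (C⇒L≤n refl) (ℕ.≰⇒> c≰n)))))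

private
  column-termᴱ : ∀ C e V W L a b c t →
    𝟙 ((C ∧ (t ≤ᵇ L)) ∧ not e ∧ (V ℕ.+ cellsIf e t ≡ᵇ a) ∧ (W ℕ.+ cellsIf (not e) t ≡ᵇ b) ∧ (suc t ≡ᵇ c))
    ≡ 𝟙 (suc t ≡ᵇ c) ℤ.* (𝟙 (C ∧ not e ∧ (V ≡ᵇ a)) ℤ.* 𝟙 ((t ≤ᵇ L) ∧ (W ℕ.+ suc t ≡ᵇ b)))
  column-termᴱ C true V W L a b c t = begin
    𝟙 ((C ∧ (t ≤ᵇ L)) ∧ false)                ≡⟨ cong 𝟙 (∧-zeroʳ (C ∧ (t ≤ᵇ L))) ⟩
    0ℤ                                        ≡⟨ x≡0⇒y*x≡0 (𝟙 (suc t ≡ᵇ c)) (x≡0⇒x*y≡0 _ (cong 𝟙 (∧-zeroʳ C))) ⟨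
    𝟙 (suc t ≡ᵇ c) ℤ.* (𝟙 (C ∧ false) ℤ.* 𝟙 ((t ≤ᵇ L) ∧ (W ℕ.+ suc t ≡ᵇ b))) ∎
    where open ≡.≡-Reasoning
  column-termᴱ C false V W L a b c t = begin
    𝟙 ((C ∧ T) ∧ (V ℕ.+ 0 ≡ᵇ a) ∧ B ∧ S)      ≡⟨ cong (λ v → 𝟙 ((C ∧ T) ∧ (v ≡ᵇ a) ∧ B ∧ S)) (ℕ.+-identityʳ V) ⟩
    𝟙 ((C ∧ T) ∧ A ∧ B ∧ S)                    ≡⟨ 𝟙-∧⁵ C T A B S ⟩
    (𝟙 C ℤ.* 𝟙 T) ℤ.* (𝟙 A ℤ.* (𝟙 B ℤ.* 𝟙 S)) ≡⟨ shuffle (𝟙 C) (𝟙 T) (𝟙 A) (𝟙 B) (𝟙 S) ⟩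
    𝟙 S ℤ.* ((𝟙 C ℤ.* 𝟙 A) ℤ.* (𝟙 T ℤ.* 𝟙 B)) ≡⟨ cong₂ (λ κ ω → 𝟙 S ℤ.* (κ ℤ.* ω)) (𝟙-∧ C A) (𝟙-∧ T B) ⟨
    𝟙 S ℤ.* (𝟙 (C ∧ A) ℤ.* 𝟙 (T ∧ B))         ∎
    where
    open ≡.≡-Reasoning
    T A B S : Bool
    T = t ≤ᵇ L
    A = V ≡ᵇ a
    B = W ℕ.+ suc t ≡ᵇ b
    S = suc t ≡ᵇ c
    shuffle : ∀ c t a b s → (c ℤ.* t) ℤ.* (a ℤ.* (b ℤ.* s)) ≡ s ℤ.* ((c ℤ.* a) ℤ.* (t ℤ.* b))
    shuffle = ℤ-Solver.solve-∀

  column-termᴼ : ∀ C e V W L a b c t →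
    𝟙 ((C ∧ (t ≤ᵇ L)) ∧ not (not e) ∧ (V ℕ.+ cellsIf e t ≡ᵇ a) ∧ (W ℕ.+ cellsIf (not e) t ≡ᵇ b) ∧ (suc t ≡ᵇ c))
    ≡ 𝟙 (suc t ≡ᵇ c) ℤ.* (𝟙 (C ∧ e ∧ (W ≡ᵇ b)) ℤ.* 𝟙 ((t ≤ᵇ L) ∧ (V ℕ.+ suc t ≡ᵇ a)))
  column-termᴼ C false V W L a b c t = begin
    𝟙 ((C ∧ (t ≤ᵇ L)) ∧ false)                ≡⟨ cong 𝟙 (∧-zeroʳ (C ∧ (t ≤ᵇ L))) ⟩
    0ℤ                                        ≡⟨ x≡0⇒y*x≡0 (𝟙 (suc t ≡ᵇ c)) (x≡0⇒x*y≡0 _ (cong 𝟙 (∧-zeroʳ C))) ⟨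
    𝟙 (suc t ≡ᵇ c) ℤ.* (𝟙 (C ∧ false) ℤ.* 𝟙 ((t ≤ᵇ L) ∧ (V ℕ.+ suc t ≡ᵇ a))) ∎
    where open ≡.≡-Reasoning
  column-termᴼ C true V W L a b c t = begin
    𝟙 ((C ∧ T) ∧ A ∧ (W ℕ.+ 0 ≡ᵇ b) ∧ S)      ≡⟨ cong (λ v → 𝟙 ((C ∧ T) ∧ A ∧ (v ≡ᵇ b) ∧ S)) (ℕ.+-identityʳ W) ⟩
    𝟙 ((C ∧ T) ∧ A ∧ B ∧ S)                    ≡⟨ 𝟙-∧⁵ C T A B S ⟩
    (𝟙 C ℤ.* 𝟙 T) ℤ.* (𝟙 A ℤ.* (𝟙 B ℤ.* 𝟙 S)) ≡⟨ shuffle (𝟙 C) (𝟙 T) (𝟙 A) (𝟙 B) (𝟙 S) ⟩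
    𝟙 S ℤ.* ((𝟙 C ℤ.* 𝟙 B) ℤ.* (𝟙 T ℤ.* 𝟙 A)) ≡⟨ cong₂ (λ κ ω → 𝟙 S ℤ.* (κ ℤ.* ω)) (𝟙-∧ C B) (𝟙-∧ T A) ⟨
    𝟙 S ℤ.* (𝟙 (C ∧ B) ℤ.* 𝟙 (T ∧ A))         ∎
    where
    open ≡.≡-Reasoning
    T A B S : Bool
    T = t ≤ᵇ L
    A = V ℕ.+ suc t ≡ᵇ a
    B = W ≡ᵇ b
    S = suc t ≡ᵇ c
    shuffle : ∀ c t a b s → (c ℤ.* t) ℤ.* (a ℤ.* (b ℤ.* s)) ≡ s ℤ.* ((c ℤ.* b) ℤ.* (t ℤ.* a))
    shuffle = ℤ-Solver.solve-∀

  pred-cong : ∀ {C C′ e e′ v v′ w w′ l l′} a b c → C ≡ C′ → e ≡ e′ → v ≡ v′ → w ≡ w′ → l ≡ l′ →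
              (C ∧ e ∧ (v ≡ᵇ a) ∧ (w ≡ᵇ b) ∧ (l ≡ᵇ c)) ≡ (C′ ∧ e′ ∧ (v′ ≡ᵇ a) ∧ (w′ ≡ᵇ b) ∧ (l′ ≡ᵇ c))
  pred-cong a b c refl refl refl refl refl = refl

extensionᴱ : ∀ m a b c w → length w ≡ suc m →
  Σ≤ (suc m) (λ t → 𝟙 (EV-pred a b c (w ∷ʳ t))) ≡ κᴱ a w ℤ.* window (white w) (last w) b c
extensionᴱ m a b c (x ∷ xs) |w| = begin
  Σ≤ (suc m) (λ t → 𝟙 (EV-pred a b c ((x ∷ xs) ∷ʳ t)))
    ≡⟨ Σ≤-cong (suc m) (λ t → trans (cong 𝟙 (pred-cong a b c (isCatalan-∷ʳ x xs t) (cong evenᵇ (length-∷ʳ w t))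
                                                                (ver-∷ʳ w t) (white-∷ʳ w t) (last-∷ʳ w t)))
                                    (column-termᴱ (isCatalan w) (evenᵇ (length w)) (ver w) (white w) (last w) a b c t)) ⟩
  Σ≤ (suc m) (λ t → 𝟙 (suc t ≡ᵇ c) ℤ.* (κᴱ a w ℤ.* 𝟙 ((t ≤ᵇ last w) ∧ (white w ℕ.+ suc t ≡ᵇ b))))
    ≡⟨ Σ≤-window-pick (suc m) (isCatalan w) _ (white w) (last w) b c (λ cat → ℕ.≤-trans (catalan-last≤ w cat) (ℕ.≤-reflexive |w|)) ⟩
  κᴱ a w ℤ.* window (white w) (last w) b c ∎
  where
  open ≡.≡-Reasoning
  w : List ℕ
  w = x ∷ xs

extensionᴼ : ∀ m a b c w → length w ≡ suc m →
  Σ≤ (suc m) (λ t → 𝟙 (OD-pred a b c (w ∷ʳ t))) ≡ κᴼ b w ℤ.* window (ver w) (last w) a c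
extensionᴼ m a b c (x ∷ xs) |w| = begin
  Σ≤ (suc m) (λ t → 𝟙 (OD-pred a b c ((x ∷ xs) ∷ʳ t)))
    ≡⟨ Σ≤-cong (suc m) (λ t → trans (cong 𝟙 (pred-cong a b c (isCatalan-∷ʳ x xs t) (cong (not ∘ evenᵇ) (length-∷ʳ w t))
                                                                (ver-∷ʳ w t) (white-∷ʳ w t) (last-∷ʳ w t)))
                                    (column-termᴼ (isCatalan w) (evenᵇ (length w)) (ver w) (white w) (last w) a b c t)) ⟩
  Σ≤ (suc m) (λ t → 𝟙 (suc t ≡ᵇ c) ℤ.* (κᴼ b w ℤ.* 𝟙 ((t ≤ᵇ last w) ∧ (ver w ℕ.+ suc t ≡ᵇ a))))
    ≡⟨ Σ≤-window-pick (suc m) (isCatalan w) _ (ver w) (last w) a c (λ cat → ℕ.≤-trans (catalan-last≤ w cat) (ℕ.≤-reflexive |w|)) ⟩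
  κᴼ b w ℤ.* window (ver w) (last w) a c ∎
  where
  open ≡.≡-Reasoning
  w : List ℕ
  w = x ∷ xs

EV-extension : ∀ m a b c → EV (suc (suc m)) a b c ≡ sumOver (λ w → κᴱ a w ℤ.* window (white w) (last w) b c) (Words (suc m))
EV-extension m a b c = trans (count-catalanWords-∷ʳ (suc m) (EV-pred a b c))
  (sumOver-cong (All.map (λ {w} |w| → extensionᴱ m a b c w |w|) (words-length (suc m) (suc (suc m)))))

OD-extension : ∀ m a b c → OD (suc (suc m)) a b c ≡ sumOver (λ w → κᴼ b w ℤ.* window (ver w) (last w) a c) (Words (suc m))
OD-extension m a b c = trans (count-catalanWords-∷ʳ (suc m) (OD-pred a b c))
  (sumOver-cong (All.map (λ {w} |w| → extensionᴼ m a b c w |w|) (words-length (suc m) (suc (suc m)))))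

OD-words : ∀ n a b c → OD n a b c ≡ sumOver (λ w → κᴱ a w ℤ.* 𝟙 ((white w ≡ᵇ b) ∧ (last w ≡ᵇ c))) (Words n)
OD-words n a b c = trans (count-catalanWords n (OD-pred a b c) (λ w p → proj₁ (∧-true⇒ p)))
  (sumOver-cong (All.universal (λ w → 𝟙-regroup (isCatalan w) (not (evenᵇ (length w))) (ver w ≡ᵇ a)
                                                 ((white w ≡ᵇ b) ∧ (last w ≡ᵇ c))) (Words n)))

EV-words : ∀ n a b c → EV n a b c ≡ sumOver (λ w → κᴼ b w ℤ.* 𝟙 ((ver w ≡ᵇ a) ∧ (last w ≡ᵇ c))) (Words n)
EV-words n a b c = trans (count-catalanWords n (EV-pred a b c) (λ w p → proj₁ (∧-true⇒ p)))
  (sumOver-cong (All.universal (λ w → 𝟙-regroup″ (isCatalan w) (evenᵇ (length w)) (ver w ≡ᵇ a) (white w ≡ᵇ b)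
                                                  (last w ≡ᵇ c)) (Words n)))

OD1-words : ∀ n a b c → OD1 n a b c ≡ sumOver (λ w → κᴱ a w ℤ.* initial (white w) b c) (Words n)
OD1-words n a b zero    = trans (count-catalanWords n _ (λ w p → proj₁ (∧-true⇒ p)))
  (sumOver-cong (All.universal (λ w → 𝟙-regroup (isCatalan w) (not (evenᵇ (length w))) (ver w ≡ᵇ a) (white w ≡ᵇ b)) (Words n)))
OD1-words n a b (suc c) = sym (sumOver-zero (All.universal (λ w → ℤ.*-zeroʳ (κᴱ a w)) (Words n)))

EV1-words : ∀ n a b c → EV1 n a b c ≡ sumOver (λ w → κᴼ b w ℤ.* initial (ver w) a c) (Words n)
EV1-words n a b zero    = trans (count-catalanWords n _ (λ w p → proj₁ (∧-true⇒ p)))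
  (sumOver-cong (All.universal (λ w → 𝟙-regroup′ (isCatalan w) (evenᵇ (length w)) (ver w ≡ᵇ a) (white w ≡ᵇ b)) (Words n)))
EV1-words n a b (suc c) = sym (sumOver-zero (All.universal (λ w → ℤ.*-zeroʳ (κᴼ b w)) (Words n)))

private
  *-left-comm : ∀ x y z → x ℤ.* (y ℤ.* z) ≡ y ℤ.* (x ℤ.* z)
  *-left-comm = ℤ-Solver.solve-∀

OD-zu-words : ∀ n a b c → sub 0 1 OD n a b c ≡ sumOver (λ w → κᴱ a w ℤ.* final (white w) (last w) b c) (Words n)
OD-zu-words n a b c = begin
  sub 0 1 OD n a b c
    ≡⟨ sub-at 0 1 OD n a b c ⟩
  (1ℤ ℤ.* 𝟙 (1 ℕ.* c ≤ᵇ b)) ℤ.* OD n a (b ∸ 1 ℕ.* c) c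
    ≡⟨ cong (λ k → (1ℤ ℤ.* 𝟙 (k ≤ᵇ b)) ℤ.* OD n a (b ∸ k) c) (ℕ.*-identityˡ c) ⟩
  (1ℤ ℤ.* 𝟙 (c ≤ᵇ b)) ℤ.* OD n a (b ∸ c) c
    ≡⟨ cong₂ ℤ._*_ (ℤ.*-identityˡ (𝟙 (c ≤ᵇ b))) (OD-words n a (b ∸ c) c) ⟩
  𝟙 (c ≤ᵇ b) ℤ.* sumOver (λ w → κᴱ a w ℤ.* 𝟙 ((white w ≡ᵇ b ∸ c) ∧ (last w ≡ᵇ c))) (Words n)
    ≡⟨ sumOver-*ˡ (𝟙 (c ≤ᵇ b)) _ (Words n) ⟩
  sumOver (λ w → 𝟙 (c ≤ᵇ b) ℤ.* (κᴱ a w ℤ.* 𝟙 ((white w ≡ᵇ b ∸ c) ∧ (last w ≡ᵇ c)))) (Words n)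
    ≡⟨ sumOver-cong (All.universal (λ w → *-left-comm (𝟙 (c ≤ᵇ b)) (κᴱ a w) _) (Words n)) ⟩
  sumOver (λ w → κᴱ a w ℤ.* final (white w) (last w) b c) (Words n) ∎
  where open ≡.≡-Reasoning

EV-yu-words : ∀ n a b c → sub 1 0 EV n a b c ≡ sumOver (λ w → κᴼ b w ℤ.* final (ver w) (last w) a c) (Words n)
EV-yu-words n a b c = begin
  sub 1 0 EV n a b c
    ≡⟨ sub-at 1 0 EV n a b c ⟩
  (𝟙 (1 ℕ.* c ≤ᵇ a) ℤ.* 1ℤ) ℤ.* EV n (a ∸ 1 ℕ.* c) b c
    ≡⟨ cong (λ k → (𝟙 (k ≤ᵇ a) ℤ.* 1ℤ) ℤ.* EV n (a ∸ k) b c) (ℕ.*-identityˡ c) ⟩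
  (𝟙 (c ≤ᵇ a) ℤ.* 1ℤ) ℤ.* EV n (a ∸ c) b c
    ≡⟨ cong₂ ℤ._*_ (ℤ.*-identityʳ (𝟙 (c ≤ᵇ a))) (EV-words n (a ∸ c) b c) ⟩
  𝟙 (c ≤ᵇ a) ℤ.* sumOver (λ w → κᴼ b w ℤ.* 𝟙 ((ver w ≡ᵇ a ∸ c) ∧ (last w ≡ᵇ c))) (Words n)
    ≡⟨ sumOver-*ˡ (𝟙 (c ≤ᵇ a)) _ (Words n) ⟩
  sumOver (λ w → 𝟙 (c ≤ᵇ a) ℤ.* (κᴼ b w ℤ.* 𝟙 ((ver w ≡ᵇ a ∸ c) ∧ (last w ≡ᵇ c)))) (Words n)
    ≡⟨ sumOver-cong (All.universal (λ w → *-left-comm (𝟙 (c ≤ᵇ a)) (κᴼ b w) _) (Words n)) ⟩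
  sumOver (λ w → κᴼ b w ℤ.* final (ver w) (last w) a c) (Words n) ∎
  where open ≡.≡-Reasoning

shift-cong : ∀ {g g′ : ℕ → ℕ → ℤ} → (∀ x c → g x c ≡ g′ x c) → ∀ x c → shift g x c ≡ shift g′ x c
shift-cong g≡g′ x       zero    = refl
shift-cong g≡g′ zero    (suc c) = refl
shift-cong g≡g′ (suc x) (suc c) = g≡g′ x c

shift-sumOver : ∀ (κ : List ℕ → ℤ) (G : List ℕ → ℕ → ℕ → ℤ) ws x c →
                shift (λ x c → sumOver (λ w → κ w ℤ.* G w x c) ws) x c ≡ sumOver (λ w → κ w ℤ.* shift (G w) x c) ws
shift-sumOver κ G ws x       zero    = sym (sumOver-zero (All.universal (λ w → ℤ.*-zeroʳ (κ w)) ws))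
shift-sumOver κ G ws zero    (suc c) = sym (sumOver-zero (All.universal (λ w → ℤ.*-zeroʳ (κ w)) ws))
shift-sumOver κ G ws (suc x) (suc c) = refl

⊛-shiftᶻ : ∀ e F N a b c → (mono e 0 1 1 ⊛ F) (e ℕ.+ N) a b c ≡ shift (λ b c → F N a b c) b c
⊛-shiftᶻ e F N a b       zero    = mono-⊛-below e 0 1 1 F (e ℕ.+ N) a b 0 (inj₂ (inj₂ (inj₂ (s≤s z≤n))))
⊛-shiftᶻ e F N a zero    (suc c) = mono-⊛-below e 0 1 1 F (e ℕ.+ N) a 0 (suc c) (inj₂ (inj₂ (inj₁ (s≤s z≤n))))
⊛-shiftᶻ e F N a (suc b) (suc c) = mono-⊛ e 0 1 1 F N a b c

⊛-shiftʸ : ∀ e F N a b c → (mono e 1 0 1 ⊛ F) (e ℕ.+ N) a b c ≡ shift (λ a c → F N a b c) a c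
⊛-shiftʸ e F N a       b zero    = mono-⊛-below e 1 0 1 F (e ℕ.+ N) a b 0 (inj₂ (inj₂ (inj₂ (s≤s z≤n))))
⊛-shiftʸ e F N zero    b (suc c) = mono-⊛-below e 1 0 1 F (e ℕ.+ N) 0 b (suc c) (inj₂ (inj₁ (s≤s z≤n)))
⊛-shiftʸ e F N (suc a) b (suc c) = mono-⊛ e 1 0 1 F N a b c

⊛-shift²ᶻ : ∀ F N a b c → (mono 1 0 2 2 ⊛ F) (suc N) a b c ≡ shift (shift (λ b c → F N a b c)) b c
⊛-shift²ᶻ F N a b             zero          = mono-⊛-below 1 0 2 2 F (suc N) a b 0 (inj₂ (inj₂ (inj₂ (s≤s z≤n))))
⊛-shift²ᶻ F N a zero          (suc c)       = mono-⊛-below 1 0 2 2 F (suc N) a 0 (suc c) (inj₂ (inj₂ (inj₁ (s≤s z≤n))))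
⊛-shift²ᶻ F N a (suc b)       (suc zero)    = mono-⊛-below 1 0 2 2 F (suc N) a (suc b) 1 (inj₂ (inj₂ (inj₂ (s≤s (s≤s z≤n)))))
⊛-shift²ᶻ F N a (suc zero)    (suc (suc c)) = mono-⊛-below 1 0 2 2 F (suc N) a 1 (suc (suc c)) (inj₂ (inj₂ (inj₁ (s≤s (s≤s z≤n)))))
⊛-shift²ᶻ F N a (suc (suc b)) (suc (suc c)) = mono-⊛ 1 0 2 2 F N a b c

⊛-shift²ʸ : ∀ F N a b c → (mono 1 2 0 2 ⊛ F) (suc N) a b c ≡ shift (shift (λ a c → F N a b c)) a c
⊛-shift²ʸ F N a             b zero          = mono-⊛-below 1 2 0 2 F (suc N) a b 0 (inj₂ (inj₂ (inj₂ (s≤s z≤n))))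
⊛-shift²ʸ F N zero          b (suc c)       = mono-⊛-below 1 2 0 2 F (suc N) 0 b (suc c) (inj₂ (inj₁ (s≤s z≤n)))
⊛-shift²ʸ F N (suc a)       b (suc zero)    = mono-⊛-below 1 2 0 2 F (suc N) (suc a) b 1 (inj₂ (inj₂ (inj₂ (s≤s (s≤s z≤n)))))
⊛-shift²ʸ F N (suc zero)    b (suc (suc c)) = mono-⊛-below 1 2 0 2 F (suc N) 1 b (suc (suc c)) (inj₂ (inj₁ (s≤s (s≤s z≤n))))
⊛-shift²ʸ F N (suc (suc a)) b (suc (suc c)) = mono-⊛ 1 2 0 2 F N a b c

sumOver-linear : ∀ (κ f g h : List ℕ → ℤ) ws →
  sumOver (λ w → κ w ℤ.* (f w ℤ.+ g w ℤ.- h w)) ws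
  ≡ sumOver (λ w → κ w ℤ.* f w) ws ℤ.+ sumOver (λ w → κ w ℤ.* g w) ws ℤ.- sumOver (λ w → κ w ℤ.* h w) ws
sumOver-linear κ f g h ws = begin
  sumOver (λ w → κ w ℤ.* (f w ℤ.+ g w ℤ.- h w)) ws
    ≡⟨ sumOver-cong (All.universal (λ w → distribute (κ w) (f w) (g w) (h w)) ws) ⟩
  sumOver (λ w → (κ w ℤ.* f w ℤ.+ κ w ℤ.* g w) ℤ.+ ℤ.- (κ w ℤ.* h w)) ws
    ≡⟨ sumOver-+ (λ w → κ w ℤ.* f w ℤ.+ κ w ℤ.* g w) (λ w → ℤ.- (κ w ℤ.* h w)) ws ⟩
  sumOver (λ w → κ w ℤ.* f w ℤ.+ κ w ℤ.* g w) ws ℤ.+ sumOver (λ w → ℤ.- (κ w ℤ.* h w)) ws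
    ≡⟨ cong₂ ℤ._+_ (sumOver-+ (λ w → κ w ℤ.* f w) (λ w → κ w ℤ.* g w) ws) (sumOver-neg (λ w → κ w ℤ.* h w) ws) ⟩
  sumOver (λ w → κ w ℤ.* f w) ws ℤ.+ sumOver (λ w → κ w ℤ.* g w) ws ℤ.- sumOver (λ w → κ w ℤ.* h w) ws ∎
  where
  open ≡.≡-Reasoning
  distribute : ∀ k x y z → k ℤ.* (x ℤ.+ y ℤ.- z) ≡ (k ℤ.* x ℤ.+ k ℤ.* y) ℤ.+ ℤ.- (k ℤ.* z)
  distribute = ℤ-Solver.solve-∀

EV-order : Order≥ xWeight 2 EV
EV-order zero          a b c _                 = refl
EV-order (suc zero)    a b c _                 = refl
EV-order (suc (suc n)) a b c (s≤s (s≤s ()))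

OD-order : Order≥ xWeight 1 OD
OD-order zero    a b c _        = refl
OD-order (suc n) a b c (s≤s ())

OD1-order : Order≥ xWeight 1 OD1
OD1-order zero    a b zero    _ = refl
OD1-order zero    a b (suc c) _ = refl
OD1-order (suc n) a b c (s≤s ())

EV1-order : Order≥ xWeight 1 EV1
EV1-order zero    a b zero    _ = refl
EV1-order zero    a b (suc c) _ = refl
EV1-order (suc n) a b c (s≤s ())

private
  zero-combination : ∀ {x y z} → x ≡ 0ℤ → y ≡ 0ℤ → z ≡ 0ℤ → 0ℤ ≡ x ℤ.+ y ℤ.- z
  zero-combination refl refl refl = refl

  combine : ∀ {x y z x′ y′ z′} → x ≡ x′ × y ≡ y′ × z ≡ z′ → x ℤ.+ y ℤ.- z ≡ x′ ℤ.+ y′ ℤ.- z′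
  combine (refl , refl , refl) = refl

  window-termsᴱ : ∀ m a b c → let ws = Words (suc m) in
    (uz ⊛ EV) (suc (suc m)) a b c ≡ sumOver (λ w → κᴱ a w ℤ.* shift (window (white w) (last w)) b c) ws
    × (mono 1 0 1 1 ⊛ OD1) (suc (suc m)) a b c ≡ sumOver (λ w → κᴱ a w ℤ.* shift (initial (white w)) b c) ws
    × (mono 1 0 2 2 ⊛ sub 0 1 OD) (suc (suc m)) a b c ≡ sumOver (λ w → κᴱ a w ℤ.* shift (shift (final (white w) (last w))) b c) ws
  window-termsᴱ m a b c =
      trans (⊛-shiftᶻ 0 EV (suc (suc m)) a b c)
            (trans (shift-cong (λ b c → EV-extension m a b c) b c) (shift-sumOver (κᴱ a) (λ w → window (white w) (last w)) ws b c))
    , trans (⊛-shiftᶻ 1 OD1 (suc m) a b c)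
            (trans (shift-cong (λ b c → OD1-words (suc m) a b c) b c) (shift-sumOver (κᴱ a) (λ w → initial (white w)) ws b c))
    , trans (⊛-shift²ᶻ (sub 0 1 OD) (suc m) a b c)
            (trans (shift-cong (shift-cong (λ b c → OD-zu-words (suc m) a b c)) b c)
                   (trans (shift-cong (shift-sumOver (κᴱ a) (λ w → final (white w) (last w)) ws) b c)
                          (shift-sumOver (κᴱ a) (λ w → shift (final (white w) (last w))) ws b c)))
    where
    ws : List (List ℕ)
    ws = Words (suc m)

EV-recurrence : ∀ N a b c → EV N a b c ≡ (uz ⊛ EV ⊕ mono 1 0 1 1 ⊛ OD1 ⊝ mono 1 0 2 2 ⊛ sub 0 1 OD) N a b c
EV-recurrence zero          a b c = zero-combination
  (Order≥-⊛ xWeight (Order≥-mono xWeight 0 0 1 1) EV-order 0 a b c (s≤s z≤n))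
  (Order≥-⊛ xWeight (Order≥-mono xWeight 1 0 1 1) OD1-order 0 a b c (s≤s z≤n))
  (Order≥-⊛ xWeight (Order≥-mono xWeight 1 0 2 2) (sub-Order≥ 0 1 OD-order) 0 a b c (s≤s z≤n))
EV-recurrence (suc zero)    a b c = zero-combination
  (Order≥-⊛ xWeight (Order≥-mono xWeight 0 0 1 1) EV-order 1 a b c (s≤s (s≤s z≤n)))
  (Order≥-⊛ xWeight (Order≥-mono xWeight 1 0 1 1) OD1-order 1 a b c (s≤s (s≤s z≤n)))
  (Order≥-⊛ xWeight (Order≥-mono xWeight 1 0 2 2) (sub-Order≥ 0 1 OD-order) 1 a b c (s≤s (s≤s z≤n)))
EV-recurrence (suc (suc m)) a b c = begin
  EV (suc (suc m)) a b c
    ≡⟨ EV-extension m a b c ⟩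
  sumOver (λ w → κᴱ a w ℤ.* window (white w) (last w) b c) ws
    ≡⟨ sumOver-cong (All.universal (λ w → cong (κᴱ a w ℤ.*_) (window-recurrence (white w) (last w) b c)) ws) ⟩
  sumOver (λ w → κᴱ a w ℤ.* (shift (window (white w) (last w)) b c ℤ.+ shift (initial (white w)) b c
                              ℤ.- shift (shift (final (white w) (last w))) b c)) ws
    ≡⟨ sumOver-linear (κᴱ a) (λ w → shift (window (white w) (last w)) b c) (λ w → shift (initial (white w)) b c)
                      (λ w → shift (shift (final (white w) (last w))) b c) ws ⟩
  sumOver (λ w → κᴱ a w ℤ.* shift (window (white w) (last w)) b c) ws
    ℤ.+ sumOver (λ w → κᴱ a w ℤ.* shift (initial (white w)) b c) ws
    ℤ.- sumOver (λ w → κᴱ a w ℤ.* shift (shift (final (white w) (last w))) b c) ws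
    ≡⟨ combine (window-termsᴱ m a b c) ⟨
  (uz ⊛ EV ⊕ mono 1 0 1 1 ⊛ OD1 ⊝ mono 1 0 2 2 ⊛ sub 0 1 OD) (suc (suc m)) a b c ∎
  where
  open ≡.≡-Reasoning
  ws : List (List ℕ)
  ws = Words (suc m)

shift-zero : ∀ x c → shift (λ _ _ → 0ℤ) x c ≡ 0ℤ
shift-zero x       zero    = refl
shift-zero zero    (suc c) = refl
shift-zero (suc x) (suc c) = refl

OD-one : ∀ a b c → OD 1 a b c ≡ mono 1 1 0 1 1 a b c
OD-one a b c = trans (count-one ((1 ≡ᵇ a) ∧ (0 ≡ᵇ b) ∧ (1 ≡ᵇ c)))
                     (cong 𝟙 (cong₂ _∧_ (≡ᵇ-comm 1 a) (cong₂ _∧_ (≡ᵇ-comm 0 b) (≡ᵇ-comm 1 c))))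
  where
  count-one : ∀ X → + (if X then 1 else 0) ≡ 𝟙 X
  count-one true  = refl
  count-one false = refl
  ≡ᵇ-comm : ∀ m n → (m ≡ᵇ n) ≡ (n ≡ᵇ m)
  ≡ᵇ-comm m n = does-⇔ (mk⇔ sym sym) (m ℕ.≟ n) (n ℕ.≟ m)

private
  window-termsᴼ : ∀ m a b c → let ws = Words (suc m) in
    (uy ⊛ OD) (suc (suc m)) a b c ≡ sumOver (λ w → κᴼ b w ℤ.* shift (window (ver w) (last w)) a c) ws
    × (mono 1 1 0 1 ⊛ EV1) (suc (suc m)) a b c ≡ sumOver (λ w → κᴼ b w ℤ.* shift (initial (ver w)) a c) ws
    × (mono 1 2 0 2 ⊛ sub 1 0 EV) (suc (suc m)) a b c ≡ sumOver (λ w → κᴼ b w ℤ.* shift (shift (final (ver w) (last w))) a c) ws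
  window-termsᴼ m a b c =
      trans (⊛-shiftʸ 0 OD (suc (suc m)) a b c)
            (trans (shift-cong (λ a c → OD-extension m a b c) a c) (shift-sumOver (κᴼ b) (λ w → window (ver w) (last w)) ws a c))
    , trans (⊛-shiftʸ 1 EV1 (suc m) a b c)
            (trans (shift-cong (λ a c → EV1-words (suc m) a b c) a c) (shift-sumOver (κᴼ b) (λ w → initial (ver w)) ws a c))
    , trans (⊛-shift²ʸ (sub 1 0 EV) (suc m) a b c)
            (trans (shift-cong (shift-cong (λ a c → EV-yu-words (suc m) a b c)) a c)
                   (trans (shift-cong (shift-sumOver (κᴼ b) (λ w → final (ver w) (last w)) ws) a c)
                          (shift-sumOver (κᴼ b) (λ w → shift (final (ver w) (last w))) ws a c)))
    where
    ws : List (List ℕ)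
    ws = Words (suc m)

  zero-combination⁵ : ∀ {x y z u v} → x ≡ 0ℤ → y ≡ 0ℤ → z ≡ 0ℤ → u ≡ 0ℤ → v ≡ 0ℤ → 0ℤ ≡ x ℤ.+ y ℤ.- z ℤ.+ u ℤ.- v
  zero-combination⁵ refl refl refl refl refl = refl

OD-recurrence-one : ∀ a b c →
  OD 1 a b c ≡ (uy ⊛ OD ⊕ mono 1 1 0 1 ⊛ EV1 ⊝ mono 1 2 0 2 ⊛ sub 1 0 EV ⊕ mono 1 1 0 1 ⊝ uy ⊛ mono 1 1 0 1) 1 a b c
OD-recurrence-one a b c = begin
  OD 1 a b c
    ≡⟨ OD-one a b c ⟩
  mono 1 1 0 1 1 a b c
    ≡⟨ only-the-column (shift (λ a c → OD 1 a b c) a c) (mono 1 1 0 1 1 a b c) ⟩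
  shift (λ a c → OD 1 a b c) a c ℤ.+ 0ℤ ℤ.- 0ℤ ℤ.+ mono 1 1 0 1 1 a b c ℤ.- shift (λ a c → OD 1 a b c) a c
    ≡⟨ cong₂ (λ l r → l ℤ.+ 0ℤ ℤ.- 0ℤ ℤ.+ mono 1 1 0 1 1 a b c ℤ.- r) (sym (⊛-shiftʸ 0 OD 1 a b c))
             (trans (shift-cong (λ a c → OD-one a b c) a c) (sym (⊛-shiftʸ 0 (mono 1 1 0 1) 1 a b c))) ⟩
  (uy ⊛ OD) 1 a b c ℤ.+ 0ℤ ℤ.- 0ℤ ℤ.+ mono 1 1 0 1 1 a b c ℤ.- (uy ⊛ mono 1 1 0 1) 1 a b c
    ≡⟨ cong₂ (λ y z → (uy ⊛ OD) 1 a b c ℤ.+ y ℤ.- z ℤ.+ mono 1 1 0 1 1 a b c ℤ.- (uy ⊛ mono 1 1 0 1) 1 a b c)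
             (sym (Order≥-⊛ xWeight (Order≥-mono xWeight 1 1 0 1) EV1-order 1 a b c (s≤s (s≤s z≤n))))
             (sym (Order≥-⊛ xWeight (Order≥-mono xWeight 1 2 0 2) (sub-Order≥ 1 0 EV-order) 1 a b c (s≤s (s≤s z≤n)))) ⟩
  (uy ⊛ OD ⊕ mono 1 1 0 1 ⊛ EV1 ⊝ mono 1 2 0 2 ⊛ sub 1 0 EV ⊕ mono 1 1 0 1 ⊝ uy ⊛ mono 1 1 0 1) 1 a b c ∎
  where
  open ≡.≡-Reasoning
  only-the-column : ∀ s m → m ≡ s ℤ.+ 0ℤ ℤ.- 0ℤ ℤ.+ m ℤ.- s
  only-the-column = ℤ-Solver.solve-∀

OD-recurrence : ∀ N a b c →
  OD N a b c ≡ (uy ⊛ OD ⊕ mono 1 1 0 1 ⊛ EV1 ⊝ mono 1 2 0 2 ⊛ sub 1 0 EV ⊕ mono 1 1 0 1 ⊝ uy ⊛ mono 1 1 0 1) N a b c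
OD-recurrence zero          a b c = zero-combination⁵
  (Order≥-⊛ xWeight (Order≥-mono xWeight 0 1 0 1) OD-order 0 a b c (s≤s z≤n))
  (Order≥-⊛ xWeight (Order≥-mono xWeight 1 1 0 1) EV1-order 0 a b c (s≤s z≤n))
  (Order≥-⊛ xWeight (Order≥-mono xWeight 1 2 0 2) (sub-Order≥ 1 0 EV-order) 0 a b c (s≤s z≤n))
  refl
  (Order≥-⊛ xWeight (Order≥-mono xWeight 0 1 0 1) (Order≥-mono xWeight 1 1 0 1) 0 a b c (s≤s z≤n))
OD-recurrence (suc zero)    a b c = OD-recurrence-one a b c
OD-recurrence (suc (suc m)) a b c = begin
  OD (suc (suc m)) a b c
    ≡⟨ OD-extension m a b c ⟩
  sumOver (λ w → κᴼ b w ℤ.* window (ver w) (last w) a c) ws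
    ≡⟨ sumOver-cong (All.universal (λ w → cong (κᴼ b w ℤ.*_) (window-recurrence (ver w) (last w) a c)) ws) ⟩
  sumOver (λ w → κᴼ b w ℤ.* (shift (window (ver w) (last w)) a c ℤ.+ shift (initial (ver w)) a c
                              ℤ.- shift (shift (final (ver w) (last w))) a c)) ws
    ≡⟨ sumOver-linear (κᴼ b) (λ w → shift (window (ver w) (last w)) a c) (λ w → shift (initial (ver w)) a c)
                      (λ w → shift (shift (final (ver w) (last w))) a c) ws ⟩
  sumOver (λ w → κᴼ b w ℤ.* shift (window (ver w) (last w)) a c) ws
    ℤ.+ sumOver (λ w → κᴼ b w ℤ.* shift (initial (ver w)) a c) ws
    ℤ.- sumOver (λ w → κᴼ b w ℤ.* shift (shift (final (ver w) (last w))) a c) ws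
    ≡⟨ combine (window-termsᴼ m a b c) ⟨
  (uy ⊛ OD ⊕ mono 1 1 0 1 ⊛ EV1 ⊝ mono 1 2 0 2 ⊛ sub 1 0 EV) (suc (suc m)) a b c
    ≡⟨ no-single-column _ ⟩
  (uy ⊛ OD ⊕ mono 1 1 0 1 ⊛ EV1 ⊝ mono 1 2 0 2 ⊛ sub 1 0 EV) (suc (suc m)) a b c ℤ.+ 0ℤ ℤ.- 0ℤ
    ≡⟨ cong (λ z → (uy ⊛ OD ⊕ mono 1 1 0 1 ⊛ EV1 ⊝ mono 1 2 0 2 ⊛ sub 1 0 EV) (suc (suc m)) a b c ℤ.+ 0ℤ ℤ.- z)
            (sym (trans (⊛-shiftʸ 0 (mono 1 1 0 1) (suc (suc m)) a b c) (shift-zero a c))) ⟩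
  (uy ⊛ OD ⊕ mono 1 1 0 1 ⊛ EV1 ⊝ mono 1 2 0 2 ⊛ sub 1 0 EV ⊕ mono 1 1 0 1 ⊝ uy ⊛ mono 1 1 0 1) (suc (suc m)) a b c ∎
  where
  open ≡.≡-Reasoning
  ws : List (List ℕ)
  ws = Words (suc m)
  no-single-column : ∀ x → x ≡ x ℤ.+ 0ℤ ℤ.- 0ℤ
  no-single-column = ℤ-Solver.solve-∀

-- Solving the functional equations and unrolling them

open FixedPoints seriesRing using (fixed-point; fixed-point-shifted)

EV-equation : EV ≈ uz * EV + (mono 1 0 1 1 * OD1 - mono 1 0 2 2 * sub 0 1 OD)
EV-equation = begin
  EV                                                           ≈⟨ mk≈ EV-recurrence ⟩
  uz ⊛ EV ⊕ mono 1 0 1 1 ⊛ OD1 ⊝ mono 1 0 2 2 ⊛ sub 0 1 OD     ≈⟨ ⊝≈- (⊕≈+ (⊛≈*ₛ _ _) (⊛≈*ₛ _ _)) (⊛≈*ₛ _ _) ⟩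
  uz * EV + mono 1 0 1 1 * OD1 - mono 1 0 2 2 * sub 0 1 OD     ≈⟨ +-assoc _ _ _ ⟩
  uz * EV + (mono 1 0 1 1 * OD1 - mono 1 0 2 2 * sub 0 1 OD)   ∎
  where open SetoidReasoning setoid

OD-equation : OD ≈ uy * OD + (mono 1 1 0 1 * EV1 - mono 1 2 0 2 * sub 1 0 EV) + mono 1 1 0 1 - uy * mono 1 1 0 1
OD-equation = begin
  OD
    ≈⟨ mk≈ OD-recurrence ⟩
  uy ⊛ OD ⊕ mono 1 1 0 1 ⊛ EV1 ⊝ mono 1 2 0 2 ⊛ sub 1 0 EV ⊕ mono 1 1 0 1 ⊝ uy ⊛ mono 1 1 0 1
    ≈⟨ ⊝≈- (⊕≈+ (⊝≈- (⊕≈+ (⊛≈*ₛ _ _) (⊛≈*ₛ _ _)) (⊛≈*ₛ _ _)) ≈-refl) (⊛≈*ₛ _ _) ⟩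
  uy * OD + mono 1 1 0 1 * EV1 - mono 1 2 0 2 * sub 1 0 EV + mono 1 1 0 1 - uy * mono 1 1 0 1
    ≈⟨ +-cong (+-cong (+-assoc _ _ _) ≈-refl) ≈-refl ⟩
  uy * OD + (mono 1 1 0 1 * EV1 - mono 1 2 0 2 * sub 1 0 EV) + mono 1 1 0 1 - uy * mono 1 1 0 1 ∎
  where open SetoidReasoning setoid

EV1-u-free : ∀ p q → sub p q EV1 ≈ EV1
EV1-u-free p q = sub-u-free p q EV1 (λ _ _ _ _ → refl)

OD1-u-free : ∀ p q → sub p q OD1 ≈ OD1
OD1-u-free p q = sub-u-free p q OD1 (λ _ _ _ _ → refl)

EV-yu-equation : sub 1 0 EV ≈ uyz * sub 1 0 EV + (mono 1 1 1 1 * OD1 - mono 1 2 2 2 * sub 1 1 OD)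
EV-yu-equation = begin
  sub 1 0 EV
    ≈⟨ sub-cong 1 0 EV-equation ⟩
  sub 1 0 (uz * EV + (mono 1 0 1 1 * OD1 - mono 1 0 2 2 * sub 0 1 OD))
    ≈⟨ ≈-trans (sub-homo-+ 1 0 _ _) (+-cong (sub-mono-* 1 0 0 0 1 1 EV) source) ⟩
  uyz * sub 1 0 EV + (mono 1 1 1 1 * OD1 - mono 1 2 2 2 * sub 1 1 OD) ∎
  where
  open SetoidReasoning setoid
  source : sub 1 0 (mono 1 0 1 1 * OD1 - mono 1 0 2 2 * sub 0 1 OD) ≈ mono 1 1 1 1 * OD1 - mono 1 2 2 2 * sub 1 1 OD
  source = ≈-trans (sub-homo-− 1 0 _ _)
    (+-cong (≈-trans (sub-mono-* 1 0 1 0 1 1 OD1) (*-cong ≈-refl (OD1-u-free 1 0)))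
            (-‿cong (≈-trans (sub-mono-* 1 0 1 0 2 2 _) (*-cong ≈-refl (sub-sub 1 0 0 1 OD)))))

OD-zu-equation : sub 0 1 OD ≈ uyz * sub 0 1 OD + (mono 1 1 1 1 * EV1 - mono 1 2 2 2 * sub 1 1 EV)
                             + mono 1 1 1 1 - uyz * mono 1 1 1 1
OD-zu-equation = begin
  sub 0 1 OD
    ≈⟨ sub-cong 0 1 OD-equation ⟩
  sub 0 1 (uy * OD + (mono 1 1 0 1 * EV1 - mono 1 2 0 2 * sub 1 0 EV) + mono 1 1 0 1 - uy * mono 1 1 0 1)
    ≈⟨ ≈-trans (sub-homo-− 0 1 _ _) (+-cong (≈-trans (sub-homo-+ 0 1 _ _) (+-cong (sub-homo-+ 0 1 _ _) (sub-mono 0 1 1 1 0 1)))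
                                      (-‿cong (sub-mono-* 0 1 0 1 0 1 _))) ⟩
  sub 0 1 (uy * OD) + sub 0 1 (mono 1 1 0 1 * EV1 - mono 1 2 0 2 * sub 1 0 EV) + mono 1 1 1 1
    - uyz * sub 0 1 (mono 1 1 0 1)
    ≈⟨ +-cong (+-cong (+-cong (sub-mono-* 0 1 0 1 0 1 OD) source) ≈-refl) (-‿cong (*-cong ≈-refl (sub-mono 0 1 1 1 0 1))) ⟩
  uyz * sub 0 1 OD + (mono 1 1 1 1 * EV1 - mono 1 2 2 2 * sub 1 1 EV) + mono 1 1 1 1 - uyz * mono 1 1 1 1 ∎
  where
  open SetoidReasoning setoid
  source : sub 0 1 (mono 1 1 0 1 * EV1 - mono 1 2 0 2 * sub 1 0 EV) ≈ mono 1 1 1 1 * EV1 - mono 1 2 2 2 * sub 1 1 EV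
  source = ≈-trans (sub-homo-− 0 1 _ _)
    (+-cong (≈-trans (sub-mono-* 0 1 1 1 0 1 EV1) (*-cong ≈-refl (EV1-u-free 0 1)))
            (-‿cong (≈-trans (sub-mono-* 0 1 1 2 0 2 _) (*-cong ≈-refl (sub-sub 0 1 1 0 EV)))))

Az Ayz Ay : Series
Az  = recipMinusOne uz
Ayz = recipMinusOne uyz
Ay  = recipMinusOne uy

Az-inverse : (uz - 1#) * Az ≈ 1#
Az-inverse = recipMinusOne-inverse uz (Order≥-weaken total (s≤s z≤n) (Order≥-mono total 0 0 1 1))

Ayz-inverse : (uyz - 1#) * Ayz ≈ 1#
Ayz-inverse = recipMinusOne-inverse uyz (Order≥-weaken total (s≤s z≤n) (Order≥-mono total 0 1 1 1))

Ay-inverse : (uy - 1#) * Ay ≈ 1#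
Ay-inverse = recipMinusOne-inverse uy (Order≥-weaken total (s≤s z≤n) (Order≥-mono total 0 1 0 1))

infix  4 _≋_
infixl 6 _+ᵥ_

_≋_ : Vec2 → Vec2 → Set
v ≋ w = v₁ v ≈ v₁ w × v₂ v ≈ v₂ w

_+ᵥ_ : Vec2 → Vec2 → Vec2
v +ᵥ w = ⟨ v₁ v ⊕ v₁ w , v₂ v ⊕ v₂ w ⟩

0ᵥ : Vec2
0ᵥ = ⟨ 0ₛ , 0ₛ ⟩

≋-refl : ∀ {v} → v ≋ v
≋-refl = ≈-refl , ≈-refl

≋-sym : ∀ {v w} → v ≋ w → w ≋ v
≋-sym (p , q) = ≈-sym p , ≈-sym q

≋-trans : ∀ {u v w} → u ≋ v → v ≋ w → u ≋ w
≋-trans (p , q) (p′ , q′) = ≈-trans p p′ , ≈-trans q q′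

⊕-cong : ∀ {f f′ g g′} → f ≈ f′ → g ≈ g′ → f ⊕ g ≈ f′ ⊕ g′
⊕-cong f≈f′ g≈g′ = ≈-trans (⊕≈+ f≈f′ g≈g′) (≈-sym (⊕≈+ₛ _ _))

⊝-cong : ∀ {f f′ g g′} → f ≈ f′ → g ≈ g′ → f ⊝ g ≈ f′ ⊝ g′
⊝-cong f≈f′ g≈g′ = ≈-trans (⊝≈- f≈f′ g≈g′) (≈-sym (⊝≈- ≈-refl ≈-refl))

⊛-cong : ∀ {f f′ g g′} → f ≈ f′ → g ≈ g′ → f ⊛ g ≈ f′ ⊛ g′
⊛-cong f≈f′ g≈g′ = ≈-trans (⊛≈* f≈f′ g≈g′) (≈-sym (⊛≈*ₛ _ _))

+ᵥ-cong : ∀ {v v′ w w′} → v ≋ v′ → w ≋ w′ → v +ᵥ w ≋ v′ +ᵥ w′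
+ᵥ-cong (p , q) (p′ , q′) = ⊕-cong p p′ , ⊕-cong q q′

+ᵥ-congʳ : ∀ u {w w′} → w ≋ w′ → u +ᵥ w ≋ u +ᵥ w′
+ᵥ-congʳ u = +ᵥ-cong {u} ≋-refl

−ᵥ-congʳ : ∀ u {w w′} → w ≋ w′ → u −ᵥ w ≋ u −ᵥ w′
−ᵥ-congʳ u (p , q) = ⊝-cong {v₁ u} ≈-refl p , ⊝-cong {v₂ u} ≈-refl q

·ᵥ-congʳ : ∀ A {v w} → v ≋ w → A ·ᵥ v ≋ A ·ᵥ w
·ᵥ-congʳ A (p , q) = ⊕-cong (⊛-cong {m₁₁ A} ≈-refl p) (⊛-cong {m₁₂ A} ≈-refl q)
                    , ⊕-cong (⊛-cong {m₂₁ A} ≈-refl p) (⊛-cong {m₂₂ A} ≈-refl q)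

+ᵥ-assoc : ∀ u v w → (u +ᵥ v) +ᵥ w ≋ u +ᵥ (v +ᵥ w)
+ᵥ-assoc u v w = mk≈ (λ n a b c → ℤ.+-assoc (v₁ u n a b c) _ _) , mk≈ (λ n a b c → ℤ.+-assoc (v₂ u n a b c) _ _)

+ᵥ-identityˡ : ∀ v → 0ᵥ +ᵥ v ≋ v
+ᵥ-identityˡ v = mk≈ (λ n a b c → ℤ.+-identityˡ (v₁ v n a b c)) , mk≈ (λ n a b c → ℤ.+-identityˡ (v₂ v n a b c))

·ᵥ-distrib-+ᵥ : ∀ A v w → A ·ᵥ (v +ᵥ w) ≋ A ·ᵥ v +ᵥ A ·ᵥ w
·ᵥ-distrib-+ᵥ A v w = row (m₁₁ A) (m₁₂ A) , row (m₂₁ A) (m₂₂ A)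
  where
  open SetoidReasoning setoid
  row : ∀ a₁ a₂ → a₁ ⊛ (v₁ v ⊕ v₁ w) ⊕ a₂ ⊛ (v₂ v ⊕ v₂ w) ≈ (a₁ ⊛ v₁ v ⊕ a₂ ⊛ v₂ v) ⊕ (a₁ ⊛ v₁ w ⊕ a₂ ⊛ v₂ w)
  row a₁ a₂ = begin
    a₁ ⊛ (v₁ v ⊕ v₁ w) ⊕ a₂ ⊛ (v₂ v ⊕ v₂ w)
      ≈⟨ ⊕≈+ (⊛≈* ≈-refl (⊕≈+ₛ _ _)) (⊛≈* ≈-refl (⊕≈+ₛ _ _)) ⟩
    a₁ * (v₁ v + v₁ w) + a₂ * (v₂ v + v₂ w)
      ≈⟨ solve 6 (λ a₁ a₂ x₁ x₂ y₁ y₂ → a₁ :* (x₁ :+ y₁) :+ a₂ :* (x₂ :+ y₂) := (a₁ :* x₁ :+ a₂ :* x₂) :+ (a₁ :* y₁ :+ a₂ :* y₂))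
               ≈-refl a₁ a₂ (v₁ v) (v₂ v) (v₁ w) (v₂ w) ⟩
    (a₁ * v₁ v + a₂ * v₂ v) + (a₁ * v₁ w + a₂ * v₂ w)
      ≈⟨ ⊕≈+ (⊕≈+ (⊛≈*ₛ _ _) (⊛≈*ₛ _ _)) (⊕≈+ (⊛≈*ₛ _ _) (⊛≈*ₛ _ _)) ⟨
    (a₁ ⊛ v₁ v ⊕ a₂ ⊛ v₂ v) ⊕ (a₁ ⊛ v₁ w ⊕ a₂ ⊛ v₂ w) ∎

⊗-·ᵥ : ∀ A B v → (A ⊗ B) ·ᵥ v ≋ A ·ᵥ (B ·ᵥ v)
⊗-·ᵥ A B v = row (m₁₁ A) (m₁₂ A) , row (m₂₁ A) (m₂₂ A)
  where
  open SetoidReasoning setoid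
  row : ∀ a₁ a₂ → (a₁ ⊛ m₁₁ B ⊕ a₂ ⊛ m₂₁ B) ⊛ v₁ v ⊕ (a₁ ⊛ m₁₂ B ⊕ a₂ ⊛ m₂₂ B) ⊛ v₂ v
                  ≈ a₁ ⊛ (m₁₁ B ⊛ v₁ v ⊕ m₁₂ B ⊛ v₂ v) ⊕ a₂ ⊛ (m₂₁ B ⊛ v₁ v ⊕ m₂₂ B ⊛ v₂ v)
  row a₁ a₂ = begin
    (a₁ ⊛ m₁₁ B ⊕ a₂ ⊛ m₂₁ B) ⊛ v₁ v ⊕ (a₁ ⊛ m₁₂ B ⊕ a₂ ⊛ m₂₂ B) ⊛ v₂ v
      ≈⟨ ⊕≈+ (⊛≈* (⊕≈+ (⊛≈*ₛ _ _) (⊛≈*ₛ _ _)) ≈-refl) (⊛≈* (⊕≈+ (⊛≈*ₛ _ _) (⊛≈*ₛ _ _)) ≈-refl) ⟩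
    (a₁ * m₁₁ B + a₂ * m₂₁ B) * v₁ v + (a₁ * m₁₂ B + a₂ * m₂₂ B) * v₂ v
      ≈⟨ solve 8 (λ a₁ a₂ b₁₁ b₁₂ b₂₁ b₂₂ x₁ x₂ →
                    (a₁ :* b₁₁ :+ a₂ :* b₂₁) :* x₁ :+ (a₁ :* b₁₂ :+ a₂ :* b₂₂) :* x₂
                    := a₁ :* (b₁₁ :* x₁ :+ b₁₂ :* x₂) :+ a₂ :* (b₂₁ :* x₁ :+ b₂₂ :* x₂))
               ≈-refl a₁ a₂ (m₁₁ B) (m₁₂ B) (m₂₁ B) (m₂₂ B) (v₁ v) (v₂ v) ⟩
    a₁ * (m₁₁ B * v₁ v + m₁₂ B * v₂ v) + a₂ * (m₂₁ B * v₁ v + m₂₂ B * v₂ v)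
      ≈⟨ ⊕≈+ (⊛≈* ≈-refl (⊕≈+ (⊛≈*ₛ _ _) (⊛≈*ₛ _ _))) (⊛≈* ≈-refl (⊕≈+ (⊛≈*ₛ _ _) (⊛≈*ₛ _ _))) ⟨
    a₁ ⊛ (m₁₁ B ⊛ v₁ v ⊕ m₁₂ B ⊛ v₂ v) ⊕ a₂ ⊛ (m₂₁ B ⊛ v₁ v ⊕ m₂₂ B ⊛ v₂ v) ∎

I₂-·ᵥ : ∀ v → I₂ ·ᵥ v ≋ v
I₂-·ᵥ v =
    ≈-trans (⊕≈+ (⊛≈* 1ₛ≈1ₛ′ ≈-refl) (⊛≈* 0ₛ≈0ₛ′ ≈-refl)) (solve 2 (λ x y → con 1ℤ :* x :+ con 0ℤ :* y := x) ≈-refl (v₁ v) (v₂ v))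
  , ≈-trans (⊕≈+ (⊛≈* 0ₛ≈0ₛ′ ≈-refl) (⊛≈* 1ₛ≈1ₛ′ ≈-refl)) (solve 2 (λ x y → con 0ℤ :* x :+ con 1ℤ :* y := y) ≈-refl (v₁ v) (v₂ v))

EV-solution : EV ≈ v₁ ((𝐁 −ᵥ (𝐍 ·ᵥ 𝐕1)) +ᵥ 𝐌 ·ᵥ substUᵥ 1 𝐕)
EV-solution = begin
  EV
    ≈⟨ fixed-point Az-inverse EV-equation ⟩
  - (Az * (xzu * OD1 - xz²u² * sub 0 1 OD))
    ≈⟨ -‿cong (*-cong ≈-refl (+-cong ≈-refl (-‿cong (*-cong ≈-refl (fixed-point-shifted Ayz-inverse OD-zu-equation))))) ⟩
  - (Az * (xzu * OD1 - xz²u² * (xyzu - Ayz * (xyzu * EV1 - xy²z²u² * sub 1 1 EV))))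
    ≈⟨ solve 10 (λ Az Ayz xzu xz²u² xyzu xy²z²u² X1 O1 SX SO →
         :- (Az :* (xzu :* O1 :- xz²u² :* (xyzu :- Ayz :* (xyzu :* X1 :- xy²z²u² :* SX))))
         := (xz²u² :* xyzu) :* Az :- ((xz²u² :* xyzu) :* Az :* Ayz :* X1 :+ xzu :* Az :* O1)
            :+ ((xz²u² :* xy²z²u²) :* Az :* Ayz :* SX :+ con 0ℤ :* SO))
         ≈-refl Az Ayz xzu xz²u² xyzu xy²z²u² EV1 OD1 (sub 1 1 EV) (sub 1 1 OD) ⟩
  (xz²u² * xyzu) * Az - ((xz²u² * xyzu) * Az * Ayz * EV1 + xzu * Az * OD1)
    + ((xz²u² * xy²z²u²) * Az * Ayz * sub 1 1 EV + 0# * sub 1 1 OD)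
    ≈⟨ ⊕≈+ (⊝≈- (⊛≈* (≈-sym (mono-* 1 0 2 2 1 1 1 1)) ≈-refl)
                (⊕≈+ (⊛≈* (⊛≈* (⊛≈* (≈-sym (mono-* 1 0 2 2 1 1 1 1)) ≈-refl) ≈-refl) ≈-refl) (⊛≈* (⊛≈*ₛ _ _) ≈-refl)))
           (⊕≈+ (⊛≈* (⊛≈* (⊛≈* (≈-sym (mono-* 1 0 2 2 1 2 2 2)) ≈-refl) ≈-refl) ≈-refl) (⊛≈* 0ₛ≈0ₛ′ ≈-refl)) ⟨
  v₁ ((𝐁 −ᵥ (𝐍 ·ᵥ 𝐕1)) +ᵥ 𝐌 ·ᵥ substUᵥ 1 𝐕) ∎
  where
  open SetoidReasoning setoid
  xzu xz²u² xyzu xy²z²u² : Series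
  xzu = mono 1 0 1 1
  xz²u² = mono 1 0 2 2
  xyzu = mono 1 1 1 1
  xy²z²u² = mono 1 2 2 2

OD-solution : OD ≈ v₂ ((𝐁 −ᵥ (𝐍 ·ᵥ 𝐕1)) +ᵥ 𝐌 ·ᵥ substUᵥ 1 𝐕)
OD-solution = begin
  OD
    ≈⟨ fixed-point-shifted Ay-inverse OD-equation ⟩
  xyu - Ay * (xyu * EV1 - xy²u² * sub 1 0 EV)
    ≈⟨ +-cong ≈-refl (-‿cong (*-cong ≈-refl (+-cong ≈-refl (-‿cong (*-cong ≈-refl (fixed-point Ayz-inverse EV-yu-equation)))))) ⟩
  xyu - Ay * (xyu * EV1 - xy²u² * - (Ayz * (xyzu * OD1 - xy²z²u² * sub 1 1 OD)))
    ≈⟨ solve 10 (λ Ay Ayz xyu xy²u² xyzu xy²z²u² X1 O1 SX SO →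
         xyu :- Ay :* (xyu :* X1 :- xy²u² :* (:- (Ayz :* (xyzu :* O1 :- xy²z²u² :* SO))))
         := xyu :- (xyu :* Ay :* X1 :+ (xy²u² :* xyzu) :* Ay :* Ayz :* O1)
            :+ (con 0ℤ :* SX :+ (xy²u² :* xy²z²u²) :* Ay :* Ayz :* SO))
         ≈-refl Ay Ayz xyu xy²u² xyzu xy²z²u² EV1 OD1 (sub 1 1 EV) (sub 1 1 OD) ⟩
  xyu - (xyu * Ay * EV1 + (xy²u² * xyzu) * Ay * Ayz * OD1)
    + (0# * sub 1 1 EV + (xy²u² * xy²z²u²) * Ay * Ayz * sub 1 1 OD)
    ≈⟨ ⊕≈+ (⊝≈- ≈-refl (⊕≈+ (⊛≈* (⊛≈*ₛ _ _) ≈-refl) (⊛≈* (⊛≈* (⊛≈* (≈-sym (mono-* 1 2 0 2 1 1 1 1)) ≈-refl) ≈-refl) ≈-refl)))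
           (⊕≈+ (⊛≈* 0ₛ≈0ₛ′ ≈-refl) (⊛≈* (⊛≈* (⊛≈* (≈-sym (mono-* 1 2 0 2 1 2 2 2)) ≈-refl) ≈-refl) ≈-refl)) ⟨
  v₂ ((𝐁 −ᵥ (𝐍 ·ᵥ 𝐕1)) +ᵥ 𝐌 ·ᵥ substUᵥ 1 𝐕) ∎
  where
  open SetoidReasoning setoid
  xyu xy²u² xyzu xy²z²u² : Series
  xyu = mono 1 1 0 1
  xy²u² = mono 1 2 0 2
  xyzu = mono 1 1 1 1
  xy²z²u² = mono 1 2 2 2

functional-equation : 𝐕 ≋ (𝐁 −ᵥ (𝐍 ·ᵥ 𝐕1)) +ᵥ 𝐌 ·ᵥ substUᵥ 1 𝐕
functional-equation = EV-solution , OD-solution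

substUᵥ-cong : ∀ k {v w} → v ≋ w → substUᵥ k v ≋ substUᵥ k w
substUᵥ-cong k (p , q) = sub-cong k k p , sub-cong k k q

substUᵥ-+ᵥ : ∀ k v w → substUᵥ k (v +ᵥ w) ≋ substUᵥ k v +ᵥ substUᵥ k w
substUᵥ-+ᵥ k v w = sub-⊕ k k (v₁ v) (v₁ w) , sub-⊕ k k (v₂ v) (v₂ w)

substUᵥ-−ᵥ : ∀ k v w → substUᵥ k (v −ᵥ w) ≋ substUᵥ k v −ᵥ substUᵥ k w
substUᵥ-−ᵥ k v w = ≈-trans (sub-⊕ k k (v₁ v) (⊖ v₁ w)) (⊕-cong {sub k k (v₁ v)} ≈-refl (sub-⊖ k k (v₁ w)))
                 , ≈-trans (sub-⊕ k k (v₂ v) (⊖ v₂ w)) (⊕-cong {sub k k (v₂ v)} ≈-refl (sub-⊖ k k (v₂ w)))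

substUᵥ-·ᵥ : ∀ k A v → substUᵥ k (A ·ᵥ v) ≋ substUₘ k A ·ᵥ substUᵥ k v
substUᵥ-·ᵥ k A v = ≈-trans (sub-⊕ k k (m₁₁ A ⊛ v₁ v) (m₁₂ A ⊛ v₂ v)) (⊕-cong (sub-⊛ k k (m₁₁ A) (v₁ v)) (sub-⊛ k k (m₁₂ A) (v₂ v)))
                 , ≈-trans (sub-⊕ k k (m₂₁ A ⊛ v₁ v) (m₂₂ A ⊛ v₂ v)) (⊕-cong (sub-⊛ k k (m₂₁ A) (v₁ v)) (sub-⊛ k k (m₂₂ A) (v₂ v)))

substUᵥ-𝐕1 : ∀ k → substUᵥ k 𝐕1 ≋ 𝐕1
substUᵥ-𝐕1 k = EV1-u-free k k , OD1-u-free k k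

substUᵥ-substUᵥ : ∀ k v → substUᵥ k (substUᵥ 1 v) ≋ substUᵥ (suc k) v
substUᵥ-substUᵥ k v = sub-sub k k 1 1 (v₁ v) , sub-sub k k 1 1 (v₂ v)

vecSetoid : Setoid 0ℓ 0ℓ
vecSetoid = record { Carrier = Vec2 ; _≈_ = _≋_ ; isEquivalence = record { refl = ≋-refl ; sym = ≋-sym ; trans = ≋-trans } }

functional-equation-at : ∀ k → substUᵥ k 𝐕 ≋ (substUᵥ k 𝐁 −ᵥ (substUₘ k 𝐍 ·ᵥ 𝐕1)) +ᵥ substUₘ k 𝐌 ·ᵥ substUᵥ (suc k) 𝐕
functional-equation-at k = begin
  substUᵥ k 𝐕
    ≈⟨ substUᵥ-cong k functional-equation ⟩
  substUᵥ k ((𝐁 −ᵥ (𝐍 ·ᵥ 𝐕1)) +ᵥ 𝐌 ·ᵥ substUᵥ 1 𝐕)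
    ≈⟨ substUᵥ-+ᵥ k (𝐁 −ᵥ (𝐍 ·ᵥ 𝐕1)) (𝐌 ·ᵥ substUᵥ 1 𝐕) ⟩
  substUᵥ k (𝐁 −ᵥ (𝐍 ·ᵥ 𝐕1)) +ᵥ substUᵥ k (𝐌 ·ᵥ substUᵥ 1 𝐕)
    ≈⟨ +ᵥ-cong (≋-trans (substUᵥ-−ᵥ k 𝐁 (𝐍 ·ᵥ 𝐕1)) (−ᵥ-congʳ (substUᵥ k 𝐁) source))
               (≋-trans (substUᵥ-·ᵥ k 𝐌 (substUᵥ 1 𝐕)) (·ᵥ-congʳ (substUₘ k 𝐌) (substUᵥ-substUᵥ k 𝐕))) ⟩
  (substUᵥ k 𝐁 −ᵥ (substUₘ k 𝐍 ·ᵥ 𝐕1)) +ᵥ substUₘ k 𝐌 ·ᵥ substUᵥ (suc k) 𝐕 ∎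
  where
  open SetoidReasoning vecSetoid
  source : substUᵥ k (𝐍 ·ᵥ 𝐕1) ≋ substUₘ k 𝐍 ·ᵥ 𝐕1
  source = ≋-trans (substUᵥ-·ᵥ k 𝐍 𝐕1) (·ᵥ-congʳ (substUₘ k 𝐍) (substUᵥ-𝐕1 k))

MatOrder≥ : ℕ → Mat2 → Set
MatOrder≥ p A = Order≥ xWeight p (m₁₁ A) × Order≥ xWeight p (m₁₂ A) × Order≥ xWeight p (m₂₁ A) × Order≥ xWeight p (m₂₂ A)

MatOrder≥-I₂ : MatOrder≥ 0 I₂
MatOrder≥-I₂ = Order≥-zero xWeight _ , Order≥-zero xWeight _ , Order≥-zero xWeight _ , Order≥-zero xWeight _

MatOrder≥-⊗ : ∀ {A B p q} → MatOrder≥ p A → MatOrder≥ q B → MatOrder≥ (p ℕ.+ q) (A ⊗ B)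
MatOrder≥-⊗ (a₁₁ , a₁₂ , a₂₁ , a₂₂) (b₁₁ , b₁₂ , b₂₁ , b₂₂) =
    Order≥-⊕ xWeight (Order≥-⊛ xWeight a₁₁ b₁₁) (Order≥-⊛ xWeight a₁₂ b₂₁)
  , Order≥-⊕ xWeight (Order≥-⊛ xWeight a₁₁ b₁₂) (Order≥-⊛ xWeight a₁₂ b₂₂)
  , Order≥-⊕ xWeight (Order≥-⊛ xWeight a₂₁ b₁₁) (Order≥-⊛ xWeight a₂₂ b₂₁)
  , Order≥-⊕ xWeight (Order≥-⊛ xWeight a₂₁ b₁₂) (Order≥-⊛ xWeight a₂₂ b₂₂)

·ᵥ-Order≥ : ∀ {A p} v → MatOrder≥ p A → Order≥ xWeight p (v₁ (A ·ᵥ v)) × Order≥ xWeight p (v₂ (A ·ᵥ v))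
·ᵥ-Order≥ {p = p} v (a₁₁ , a₁₂ , a₂₁ , a₂₂) = row a₁₁ a₁₂ , row a₂₁ a₂₂
  where
  row : ∀ {a₁ a₂} → Order≥ xWeight p a₁ → Order≥ xWeight p a₂ → Order≥ xWeight p (a₁ ⊛ v₁ v ⊕ a₂ ⊛ v₂ v)
  row a₁≥ a₂≥ = Order≥-⊕ xWeight (Order≥-weaken xWeight (ℕ.m≤m+n p 0) (Order≥-⊛ xWeight a₁≥ (Order≥-zero xWeight (v₁ v))))
                                 (Order≥-weaken xWeight (ℕ.m≤m+n p 0) (Order≥-⊛ xWeight a₂≥ (Order≥-zero xWeight (v₂ v))))

module Unrolling (V T : ℕ → Vec2) (M : ℕ → Mat2)
                 (step : ∀ k → V k ≋ T k +ᵥ M k ·ᵥ V (suc k)) (M≥1 : ∀ k → MatOrder≥ 1 (M k)) where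

  prefix : ℕ → Mat2
  prefix zero    = I₂
  prefix (suc k) = prefix k ⊗ M k

  partial : ℕ → Vec2
  partial zero    = 0ᵥ
  partial (suc K) = partial K +ᵥ prefix K ·ᵥ T K

  unroll : ∀ K → V 0 ≋ partial K +ᵥ prefix K ·ᵥ V K
  unroll zero    = ≋-sym (≋-trans (+ᵥ-identityˡ _) (I₂-·ᵥ (V 0)))
  unroll (suc K) = begin
    V 0
      ≈⟨ unroll K ⟩
    partial K +ᵥ P ·ᵥ V K
      ≈⟨ +ᵥ-congʳ (partial K) (·ᵥ-congʳ P (step K)) ⟩
    partial K +ᵥ P ·ᵥ (T K +ᵥ M K ·ᵥ V′)
      ≈⟨ +ᵥ-congʳ (partial K) (·ᵥ-distrib-+ᵥ P (T K) (M K ·ᵥ V′)) ⟩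
    partial K +ᵥ (P ·ᵥ T K +ᵥ P ·ᵥ (M K ·ᵥ V′))
      ≈⟨ +ᵥ-congʳ (partial K) (+ᵥ-congʳ (P ·ᵥ T K) (≋-sym (⊗-·ᵥ P (M K) V′))) ⟩
    partial K +ᵥ (P ·ᵥ T K +ᵥ prefix (suc K) ·ᵥ V′)
      ≈⟨ +ᵥ-assoc (partial K) (P ·ᵥ T K) (prefix (suc K) ·ᵥ V′) ⟨
    partial (suc K) +ᵥ prefix (suc K) ·ᵥ V′ ∎
    where
    open SetoidReasoning vecSetoid
    P : Mat2
    P = prefix K
    V′ : Vec2
    V′ = V (suc K)

  prefix≥ : ∀ K → MatOrder≥ K (prefix K)
  prefix≥ zero    = MatOrder≥-I₂
  prefix≥ (suc K) = ≡.subst (λ p → MatOrder≥ p (prefix (suc K))) (ℕ.+-comm K 1) (MatOrder≥-⊗ (prefix≥ K) (M≥1 K))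

  partial-at : ∀ K n a b c → v₁ (partial (suc K)) n a b c ≡ Σ≤ K (λ k → v₁ (prefix k ·ᵥ T k) n a b c)
                           × v₂ (partial (suc K)) n a b c ≡ Σ≤ K (λ k → v₂ (prefix k ·ᵥ T k) n a b c)
  partial-at zero    n a b c = ℤ.+-identityˡ _ , ℤ.+-identityˡ _
  partial-at (suc K) n a b c = ≡.cong (ℤ._+ v₁ (prefix (suc K) ·ᵥ T (suc K)) n a b c) (proj₁ (partial-at K n a b c))
                             , ≡.cong (ℤ._+ v₂ (prefix (suc K) ·ᵥ T (suc K)) n a b c) (proj₂ (partial-at K n a b c))

  expansion : ∀ n a b c → v₁ (V 0) n a b c ≡ Σ≤ n (λ k → v₁ (prefix k ·ᵥ T k) n a b c)
                        × v₂ (V 0) n a b c ≡ Σ≤ n (λ k → v₂ (prefix k ·ᵥ T k) n a b c)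
  expansion n a b c =
      split (v₁ (partial (suc n))) (v₁ tail) (proj₁ (unroll (suc n))) (proj₁ (partial-at n n a b c)) (proj₁ tail-vanishes)
    , split (v₂ (partial (suc n))) (v₂ tail) (proj₂ (unroll (suc n))) (proj₂ (partial-at n n a b c)) (proj₂ tail-vanishes)
    where
    tail : Vec2
    tail = prefix (suc n) ·ᵥ V (suc n)
    below : deg xWeight n a b c < suc n
    below = ℕ.≤-reflexive (≡.cong suc (deg-x n a b c))
    tail-vanishes : v₁ tail n a b c ≡ 0ℤ × v₂ tail n a b c ≡ 0ℤ
    tail-vanishes = let o₁ , o₂ = ·ᵥ-Order≥ (V (suc n)) (prefix≥ (suc n)) in o₁ n a b c below , o₂ n a b c below
    split : ∀ {x S} s r → x ≈ s ⊕ r → s n a b c ≡ S → r n a b c ≡ 0ℤ → x n a b c ≡ S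
    split s r x≈s+r s≡S r≡0 = ≡.trans (coeff-≡ x≈s+r n a b c) (≡.trans (≡.cong₂ ℤ._+_ s≡S r≡0) (ℤ.+-identityʳ _))

𝐌≥1 : ∀ k → MatOrder≥ 1 (substUₘ k 𝐌)
𝐌≥1 k = sub-Order≥ k k (corner 2 4 4 Az Ayz) , sub-Order≥ k k (Order≥-0ₛ xWeight 1)
      , sub-Order≥ k k (Order≥-0ₛ xWeight 1) , sub-Order≥ k k (corner 4 2 4 Ay Ayz)
  where
  corner : ∀ b c d A B → Order≥ xWeight 1 (mono 2 b c d ⊛ A ⊛ B)
  corner b c d A B = Order≥-weaken xWeight (s≤s z≤n)
    (Order≥-⊛ xWeight (Order≥-⊛ xWeight (Order≥-mono xWeight 2 b c d) (Order≥-zero xWeight A)) (Order≥-zero xWeight B))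

theorem4p2 : 𝐕 ≈ᵥ sumᵥ (λ k → 𝐏 k ·ᵥ (substUᵥ k 𝐁 −ᵥ (substUₘ k 𝐍 ·ᵥ 𝐕1)))
theorem4p2 = (λ n a b c → trans (proj₁ (expansion n a b c)) (Σ≤-cong n λ k → cong (λ P → v₁ (P ·ᵥ T k) n a b c) (prefix≡𝐏 k)))
           , (λ n a b c → trans (proj₂ (expansion n a b c)) (Σ≤-cong n λ k → cong (λ P → v₂ (P ·ᵥ T k) n a b c) (prefix≡𝐏 k)))
  where
  V T : ℕ → Vec2
  V k = substUᵥ k 𝐕
  T k = substUᵥ k 𝐁 −ᵥ (substUₘ k 𝐍 ·ᵥ 𝐕1)
  M : ℕ → Mat2
  M k = substUₘ k 𝐌
  open Unrolling V T M functional-equation-at 𝐌≥1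
  prefix≡𝐏 : ∀ k → prefix k ≡ 𝐏 k
  prefix≡𝐏 zero    = refl
  prefix≡𝐏 (suc k) = cong (_⊗ M k) (prefix≡𝐏 k)
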